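{- For each $n\geq 0$ there is a polynomial $P_n(q,t)$ with rational coefficients such that for every prime power $q$, $$\sum_{\substack{p \in F_q[x] \text{ monic} \\ \deg p = n}} t^{f(p)} = P_n(q,t),$$ and this polynomial is symmetric in $q$ and $t$, i.e. $P_n(q,t) = P_n(t,q)$.
   Context: $F_q$ is the finite field with $q$ elements. For a monic polynomial $p$, $f(p)$ denotes the number of irreducible factors of $p$ counted with multiplicity. -}

module Defs where

open import Level using (0ℓ)
open import Data.Nat as ℕ using (ℕ; zero; suc; _≤_; _<_)
open import Data.Fin using (Fin)
open import Data.Vec as Vec using (Vec; []; _∷_)
open import Data.List as List using (List; []; _∷_; _++_; [_]; length; filter; concatMap; allFin; upTo)
open import Data.List.Relation.Unary.All using (All)
open import Data.Product using (Σ; ∃; _×_; _,_; ∃-syntax)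
open import Data.Sum using (_⊎_)
open import Relation.Binary.PropositionalEquality using (_≡_)
open import Relation.Nullary using (¬_)
open import Algebra.Structures using (IsCommutativeRing)
open import Function.Bundles using (_↔_; Inverse)
open import Data.Rational as ℚ using (ℚ; 0ℚ)
open import Data.Integer using (+_)

-- Every finite field has prime power order, and for every prime power q
-- there is one, so quantifying over these = quantifying over F_q for all prime powers q.
record FiniteField (q : ℕ) : Set₁ where
  infixl 6 _+_
  infixl 7 _*_
  field
    Carrier : Set
    _+_ _*_ : Carrier → Carrier → Carrier
    -_      : Carrier → Carrier
    0# 1#   : Carrier
    isCommutativeRing : IsCommutativeRing _≡_ _+_ _*_ -_ 0# 1#
    0≢1     : ¬ (0# ≡ 1#)
    inverse : ∀ x → ¬ (x ≡ 0#) → ∃[ y ] (x * y ≡ 1#)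
    enum    : Fin q ↔ Carrier

module Poly {q : ℕ} (F : FiniteField q) where
  open FiniteField F

  -- polynomials as coefficient lists, lowest degree first
  Pol : Set
  Pol = List Carrier

  infixl 6 _+ₚ_
  infixl 7 _*ₚ_
  _+ₚ_ : Pol → Pol → Pol
  [] +ₚ ys = ys
  (x ∷ xs) +ₚ [] = x ∷ xs
  (x ∷ xs) +ₚ (y ∷ ys) = (x + y) ∷ (xs +ₚ ys)

  _*ₚ_ : Pol → Pol → Pol
  [] *ₚ ys = []
  (x ∷ xs) *ₚ ys = List.map (x *_) ys +ₚ (0# ∷ (xs *ₚ ys))

  -- a monic polynomial of degree n is given by its n lower coefficients
  Monic : ℕ → Set
  Monic n = Vec Carrier n

  toPol : ∀ {n} → Monic n → Pol
  toPol a = Vec.toList a ++ [ 1# ]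

  Irreducible : ∀ {n} → Monic n → Set
  Irreducible {n} p =
    1 ≤ n × (∀ {m k} (a : Monic m) (b : Monic k) →
               toPol a *ₚ toPol b ≡ toPol p → m ≡ 0 ⊎ k ≡ 0)

  MonicPoly : Set
  MonicPoly = Σ ℕ Monic

  IrreducibleMP : MonicPoly → Set
  IrreducibleMP (_ , a) = Irreducible a

  prodMP : List MonicPoly → Pol
  prodMP = List.foldr (λ { (_ , a) acc → toPol a *ₚ acc }) [ 1# ]

  -- p has k irreducible factors counted with multiplicity, i.e. f(p) = k
  -- (well defined by unique factorisation in F_q[x])
  FactorCount : ∀ {n} → Monic n → ℕ → Set
  FactorCount p k =
    ∃[ fs ] (length fs ≡ k × All IrreducibleMP fs × prodMP fs ≡ toPol p)

  elems : List Carrier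
  elems = List.map (Inverse.to enum) (allFin q)

  allMonic : ∀ n → List (Monic n)
  allMonic zero = [ [] ]
  allMonic (suc n) = concatMap (λ x → List.map (x ∷_) (allMonic n)) elems

  count : ∀ n → (Monic n → ℕ) → ℕ → ℕ
  count n fc k = length (filter (λ p → fc p ℕ.≟ k) (allMonic n))

ℕ→ℚ : ℕ → ℚ
ℕ→ℚ m = + m ℚ./ 1

-- coefficient of t^k in P(q,t) = Σ_{i,j ≤ D} c i j q^i t^j, evaluated at q
coeffAt : ℕ → (ℕ → ℕ → ℚ) → ℕ → ℕ → ℚ
coeffAt D c q k = List.foldr ℚ._+_ 0ℚ
  (List.map (λ i → c i k ℚ.* ℕ→ℚ (q ℕ.^ i)) (upTo (suc D)))

{-# OPTIONS --safe #-}
module Submission where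

-- Let A n k be the number of monic p of degree n with f(p) = k. Counting the pairs (P, j) with
-- P irreducible and P^j ∣ p, each weighted by deg P, and using unique factorisation, gives
--   n · A n k = ∑_{1≤m≤n} ∑_j β m j · A (n - m) (k - j),   β m j = ∑ {deg P ∣ P irreducible, j · deg P = m};
-- the same count with weight 1 gives Gauss's formula ∑_{d∣r} d · #{irreducible P of degree d} = q^r,
-- that is ∑_{d∣m} β d j = ∑_{i·j=m} q^i. The right side is symmetric in the exponent i of q and j,
-- so Möbius inversion writes β m j = ∑_i b m i j · q^i with b symmetric in i and j, and the recurrence,
-- which treats the exponents of q and t alike, then yields symmetric rational coefficients for A n k.

open import Defs
open import Data.Nat using (ℕ; _<_; _≤_)
open import Data.Product using (_×_; ∃-syntax)
open import Data.Sum using (_⊎_)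
open import Relation.Binary.PropositionalEquality using (_≡_)
open import Data.Rational using (ℚ; 0ℚ)

open import Level using (0ℓ)
open import Algebra.Bundles.Raw using (RawSemiring)
open import Algebra.Structures using (IsCommutativeSemiring; IsCommutativeRing)
open import Data.List.Base using (List)
open import Data.List.Relation.Unary.All using (All)
import Data.Nat as ℕ
import Data.Nat.Properties as ℕP
import Data.Rational.Base as ℚ
import Data.Rational.Properties as ℚP

-- The laws are required up to ≡ rather than the raw semiring's ≈, so that sums can be rewritten with cong.
module FiniteSums (R : RawSemiring 0ℓ 0ℓ)
  (isCommutativeSemiring : IsCommutativeSemiring _≡_
     (RawSemiring._+_ R) (RawSemiring._*_ R) (RawSemiring.0# R) (RawSemiring.1# R)) where

  open RawSemiring R using (_+_; _*_; 0#; 1#) renaming (Carrier to A)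

  open import Data.Nat.Base as ℕ using (zero; suc; _≤_; z≤n; s≤s)
  open import Data.Nat.Properties as ℕ using ()
  open import Data.List.Base using ([]; _∷_; _++_; map; foldr; concatMap; upTo; applyUpTo)
  open import Data.List.Relation.Unary.All using (All; []; _∷_)
  open import Data.Empty using (⊥-elim)
  open import Function using (_∘_; id)
  open import Relation.Nullary using (¬_; Dec; yes; no)
  open import Relation.Binary.Definitions using (DecidableEquality)
  open import Relation.Binary.PropositionalEquality hiding ([_])
  open IsCommutativeSemiring isCommutativeSemiring
    using (+-assoc; +-comm; +-identityˡ; +-identityʳ; *-comm; *-identityˡ; *-identityʳ;
           distribˡ; distribʳ; zeroˡ; zeroʳ)
  open import Algebra.Bundles using (CommutativeSemiring)

  commutativeSemiring : CommutativeSemiring 0ℓ 0ℓ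
  commutativeSemiring = record { isCommutativeSemiring = isCommutativeSemiring }

  open import Algebra.Properties.CommutativeSemigroup
    (CommutativeSemiring.+-commutativeSemigroup commutativeSemiring) using (interchange)
  open ≡-Reasoning

  𝟙 : ∀ {p} {P : Set p} → Dec P → A
  𝟙 (yes _) = 1#
  𝟙 (no _)  = 0#

  𝟙-yes : ∀ {p} {P : Set p} (d : Dec P) → P → 𝟙 d ≡ 1#
  𝟙-yes (yes _) _ = refl
  𝟙-yes (no ¬p) p = ⊥-elim (¬p p)

  𝟙-no : ∀ {p} {P : Set p} (d : Dec P) → ¬ P → 𝟙 d ≡ 0#
  𝟙-no (yes p) ¬p = ⊥-elim (¬p p)
  𝟙-no (no _)  _  = refl

  𝟙-cong : ∀ {p r} {P : Set p} {R : Set r} (d : Dec P) (e : Dec R) → (P → R) → (R → P) → 𝟙 d ≡ 𝟙 e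
  𝟙-cong (yes _) (yes _) _ _ = refl
  𝟙-cong (yes p) (no ¬r) f _ = ⊥-elim (¬r (f p))
  𝟙-cong (no ¬p) (yes r) _ g = ⊥-elim (¬p (g r))
  𝟙-cong (no _)  (no _)  _ _ = refl

  ∑ : ∀ {B : Set} → List B → (B → A) → A
  ∑ xs f = foldr _+_ 0# (map f xs)

  ∑< : ℕ → (ℕ → A) → A
  ∑< zero    f = 0#
  ∑< (suc n) f = f 0 + ∑< n (f ∘ suc)

  syntax ∑ xs (λ x → e) = ∑[ x ∈ xs ] e
  syntax ∑< n (λ i → e) = ∑[ i < n ] e

  private
    variable
      B C : Set

  ∑-cong : ∀ (xs : List B) {f g : B → A} → (∀ x → f x ≡ g x) → ∑ xs f ≡ ∑ xs g
  ∑-cong []       e = refl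
  ∑-cong (x ∷ xs) e = cong₂ _+_ (e x) (∑-cong xs e)

  ∑-cong-All : ∀ {P : B → Set} {xs : List B} → All P xs → {f g : B → A} →
               (∀ x → P x → f x ≡ g x) → ∑ xs f ≡ ∑ xs g
  ∑-cong-All []         e = refl
  ∑-cong-All (px ∷ pxs) e = cong₂ _+_ (e _ px) (∑-cong-All pxs e)

  ∑-zero : ∀ (xs : List B) {f : B → A} → (∀ x → f x ≡ 0#) → ∑ xs f ≡ 0#
  ∑-zero []       e = refl
  ∑-zero (x ∷ xs) e = trans (cong₂ _+_ (e x) (∑-zero xs e)) (+-identityˡ 0#)

  ∑-++ : ∀ (xs ys : List B) (f : B → A) → ∑ (xs ++ ys) f ≡ ∑ xs f + ∑ ys f
  ∑-++ []       ys f = sym (+-identityˡ _)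
  ∑-++ (x ∷ xs) ys f = trans (cong (f x +_) (∑-++ xs ys f)) (sym (+-assoc (f x) _ _))

  ∑-distrib-+ : ∀ (xs : List B) (f g : B → A) → ∑ xs (λ x → f x + g x) ≡ ∑ xs f + ∑ xs g
  ∑-distrib-+ []       f g = sym (+-identityˡ 0#)
  ∑-distrib-+ (x ∷ xs) f g =
    trans (cong (f x + g x +_) (∑-distrib-+ xs f g)) (interchange (f x) (g x) _ _)

  ∑-distribˡ-* : ∀ (xs : List B) c (f : B → A) → ∑ xs (λ x → c * f x) ≡ c * ∑ xs f
  ∑-distribˡ-* []       c f = sym (zeroʳ c)
  ∑-distribˡ-* (x ∷ xs) c f = trans (cong (c * f x +_) (∑-distribˡ-* xs c f)) (sym (distribˡ c (f x) _))

  ∑-distribʳ-* : ∀ (xs : List B) c (f : B → A) → ∑ xs (λ x → f x * c) ≡ ∑ xs f * c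
  ∑-distribʳ-* xs c f =
    trans (∑-cong xs (λ x → *-comm (f x) c)) (trans (∑-distribˡ-* xs c f) (*-comm c _))

  ∑-map : ∀ (g : B → C) (xs : List B) (f : C → A) → ∑ (map g xs) f ≡ ∑ xs (f ∘ g)
  ∑-map g []       f = refl
  ∑-map g (x ∷ xs) f = cong (f (g x) +_) (∑-map g xs f)

  ∑-concatMap : ∀ (g : B → List C) (xs : List B) (f : C → A) →
                ∑ (concatMap g xs) f ≡ ∑[ x ∈ xs ] ∑ (g x) f
  ∑-concatMap g []       f = refl
  ∑-concatMap g (x ∷ xs) f =
    trans (∑-++ (g x) (concatMap g xs) f) (cong (∑ (g x) f +_) (∑-concatMap g xs f))

  ∑-comm : ∀ (xs : List B) (ys : List C) (f : B → C → A) →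
           ∑[ x ∈ xs ] ∑[ y ∈ ys ] f x y ≡ ∑[ y ∈ ys ] ∑[ x ∈ xs ] f x y
  ∑-comm []       ys f = sym (∑-zero ys (λ _ → refl))
  ∑-comm (x ∷ xs) ys f = begin
    ∑ ys (f x) + ∑[ x ∈ xs ] ∑[ y ∈ ys ] f x y  ≡⟨ cong (∑ ys (f x) +_) (∑-comm xs ys f) ⟩
    ∑ ys (f x) + ∑[ y ∈ ys ] ∑[ x ∈ xs ] f x y  ≡⟨ sym (∑-distrib-+ ys (f x) _) ⟩
    ∑[ y ∈ ys ] (f x y + ∑[ x ∈ xs ] f x y)     ∎

  module _ (_≟_ : DecidableEquality B) where

    multiplicity : B → List B → A
    multiplicity x xs = ∑[ y ∈ xs ] 𝟙 (y ≟ x)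

    ∑-𝟙≟ : ∀ (xs : List B) x (f : B → A) → ∑[ y ∈ xs ] (𝟙 (y ≟ x) * f y) ≡ multiplicity x xs * f x
    ∑-𝟙≟ []       x f = sym (zeroˡ (f x))
    ∑-𝟙≟ (y ∷ xs) x f with y ≟ x
    ... | yes refl = trans (cong (1# * f y +_) (∑-𝟙≟ xs y f)) (sym (distribʳ (f y) 1# _))
    ... | no _     = begin
      0# * f y + ∑[ z ∈ xs ] (𝟙 (z ≟ x) * f z)  ≡⟨ cong₂ _+_ (zeroˡ (f y)) (∑-𝟙≟ xs x f) ⟩
      0# + multiplicity x xs * f x              ≡⟨ +-identityˡ _ ⟩
      multiplicity x xs * f x                   ≡⟨ cong (_* f x) (sym (+-identityˡ _)) ⟩
      (0# + multiplicity x xs) * f x            ∎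

    ∑-𝟙≟-once : ∀ (xs : List B) x (f : B → A) → multiplicity x xs ≡ 1# → ∑[ y ∈ xs ] (𝟙 (y ≟ x) * f y) ≡ f x
    ∑-𝟙≟-once xs x f once = trans (∑-𝟙≟ xs x f) (trans (cong (_* f x) once) (*-identityˡ (f x)))

  ∑-applyUpTo : ∀ (g : ℕ → B) n (f : B → A) → ∑ (applyUpTo g n) f ≡ ∑[ i < n ] f (g i)
  ∑-applyUpTo g zero    f = refl
  ∑-applyUpTo g (suc n) f = cong (f (g 0) +_) (∑-applyUpTo (g ∘ suc) n f)

  ∑-upTo : ∀ n (f : ℕ → A) → ∑ (upTo n) f ≡ ∑< n f
  ∑-upTo = ∑-applyUpTo id

  ∑<-cong : ∀ n {f g : ℕ → A} → (∀ i → i < n → f i ≡ g i) → ∑< n f ≡ ∑< n g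
  ∑<-cong zero    e = refl
  ∑<-cong (suc n) e = cong₂ _+_ (e 0 (s≤s z≤n)) (∑<-cong n (λ i i<n → e (suc i) (s≤s i<n)))

  ∑<-zero : ∀ n {f : ℕ → A} → (∀ i → i < n → f i ≡ 0#) → ∑< n f ≡ 0#
  ∑<-zero n e = trans (∑<-cong n e) (trans (sym (∑-upTo n _)) (∑-zero (upTo n) (λ _ → refl)))

  ∑<-distrib-+ : ∀ n (f g : ℕ → A) → ∑[ i < n ] (f i + g i) ≡ ∑< n f + ∑< n g
  ∑<-distrib-+ zero    f g = sym (+-identityˡ 0#)
  ∑<-distrib-+ (suc n) f g =
    trans (cong (f 0 + g 0 +_) (∑<-distrib-+ n (f ∘ suc) (g ∘ suc))) (interchange (f 0) (g 0) _ _)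

  ∑<-distribˡ-* : ∀ n c (f : ℕ → A) → ∑[ i < n ] (c * f i) ≡ c * ∑< n f
  ∑<-distribˡ-* zero    c f = sym (zeroʳ c)
  ∑<-distribˡ-* (suc n) c f =
    trans (cong (c * f 0 +_) (∑<-distribˡ-* n c (f ∘ suc))) (sym (distribˡ c (f 0) _))

  ∑<-distribʳ-* : ∀ n c (f : ℕ → A) → ∑[ i < n ] (f i * c) ≡ ∑< n f * c
  ∑<-distribʳ-* n c f =
    trans (∑<-cong n (λ i _ → *-comm (f i) c)) (trans (∑<-distribˡ-* n c f) (*-comm c _))

  ∑-∑<-comm : ∀ (xs : List B) n (f : B → ℕ → A) →
              ∑[ x ∈ xs ] ∑[ i < n ] f x i ≡ ∑[ i < n ] ∑[ x ∈ xs ] f x i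
  ∑-∑<-comm xs n f = begin
    ∑[ x ∈ xs ] ∑[ i < n ] f x i     ≡⟨ ∑-cong xs (λ x → sym (∑-upTo n (f x))) ⟩
    ∑[ x ∈ xs ] ∑[ i ∈ upTo n ] f x i ≡⟨ ∑-comm xs (upTo n) f ⟩
    ∑[ i ∈ upTo n ] ∑[ x ∈ xs ] f x i ≡⟨ ∑-upTo n _ ⟩
    ∑[ i < n ] ∑[ x ∈ xs ] f x i     ∎

  ∑<-comm : ∀ m n (f : ℕ → ℕ → A) → ∑[ i < m ] ∑[ j < n ] f i j ≡ ∑[ j < n ] ∑[ i < m ] f i j
  ∑<-comm m n f = trans (sym (∑-upTo m _)) (trans (∑-∑<-comm (upTo m) n f) (∑<-cong n (λ j _ → ∑-upTo m _)))

  ∑<-last : ∀ n (f : ℕ → A) → ∑< (suc n) f ≡ ∑< n f + f n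
  ∑<-last zero    f = trans (+-identityʳ (f 0)) (sym (+-identityˡ (f 0)))
  ∑<-last (suc n) f = trans (cong (f 0 +_) (∑<-last n (f ∘ suc))) (sym (+-assoc (f 0) _ _))

  ∑<-extend : ∀ m n (f : ℕ → A) → m ≤ n → (∀ i → m ≤ i → i < n → f i ≡ 0#) → ∑< n f ≡ ∑< m f
  ∑<-extend m zero    f z≤n _ = refl
  ∑<-extend m (suc n) f m≤1+n z with m ℕ.≟ suc n
  ... | yes refl = refl
  ... | no m≢1+n = begin
    ∑< (suc n) f   ≡⟨ ∑<-last n f ⟩
    ∑< n f + f n   ≡⟨ cong₂ _+_ (∑<-extend m n f m≤n (λ i m≤i i<n → z i m≤i (ℕ.m<n⇒m<1+n i<n)))
                                (z n m≤n ℕ.≤-refl) ⟩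
    ∑< m f + 0#    ≡⟨ +-identityʳ _ ⟩
    ∑< m f         ∎
    where
    m≤n : m ≤ n
    m≤n = ℕ.≤-pred (ℕ.≤∧≢⇒< m≤1+n m≢1+n)

  ∑<-𝟙≟ : ∀ n t (h : ℕ → A) → ∑[ i < n ] (𝟙 (i ℕ.≟ t) * h i) ≡ 𝟙 (t ℕ.<? n) * h t
  ∑<-𝟙≟ zero    t       h = sym (trans (cong (_* h t) (𝟙-no (t ℕ.<? 0) λ ())) (zeroˡ (h t)))
  ∑<-𝟙≟ (suc n) zero    h = begin
    1# * h 0 + ∑[ i < n ] (𝟙 (suc i ℕ.≟ 0) * h (suc i))
      ≡⟨ cong (1# * h 0 +_) (∑<-zero n (λ i _ → trans (cong (_* h (suc i)) (𝟙-no (suc i ℕ.≟ 0) λ ())) (zeroˡ _))) ⟩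
    1# * h 0 + 0#                         ≡⟨ +-identityʳ _ ⟩
    1# * h 0                              ≡⟨ cong (_* h 0) (sym (𝟙-yes (0 ℕ.<? suc n) (s≤s z≤n))) ⟩
    𝟙 (0 ℕ.<? suc n) * h 0                ∎
  ∑<-𝟙≟ (suc n) (suc t) h = begin
    0# * h 0 + ∑[ i < n ] (𝟙 (suc i ℕ.≟ suc t) * h (suc i))
      ≡⟨ cong₂ _+_ (zeroˡ (h 0)) (∑<-cong n (λ i _ → cong (_* h (suc i))
           (𝟙-cong (suc i ℕ.≟ suc t) (i ℕ.≟ t) ℕ.suc-injective (cong suc)))) ⟩
    0# + ∑[ i < n ] (𝟙 (i ℕ.≟ t) * h (suc i))  ≡⟨ +-identityˡ _ ⟩
    ∑[ i < n ] (𝟙 (i ℕ.≟ t) * h (suc i))       ≡⟨ ∑<-𝟙≟ n t (h ∘ suc) ⟩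
    𝟙 (t ℕ.<? n) * h (suc t)                   ≡⟨ cong (_* h (suc t)) (𝟙-cong (t ℕ.<? n) (suc t ℕ.<? suc n) s≤s ℕ.s≤s⁻¹) ⟩
    𝟙 (suc t ℕ.<? suc n) * h (suc t)           ∎

module ℕΣ = FiniteSums ℕ.+-*-rawSemiring ℕP.+-*-isCommutativeSemiring
module ℚΣ = FiniteSums ℚ.+-*-rawSemiring
  (IsCommutativeRing.isCommutativeSemiring ℚP.+-*-isCommutativeRing)

module NatEmbedding where

  open import Data.Nat.Base using (zero; suc)
  import Data.Nat.Coprimality as Coprime
  import Data.Integer.Base as ℤ
  import Data.Integer.Properties as ℤ
  open import Data.Rational.Base using (1ℚ; mkℚ; _+_; _*_; 1/_)
  open import Data.Rational.Properties
    using (+-identityˡ; +-assoc; *-zeroˡ; *-identityˡ; *-distribʳ-+; *-inverseˡ; normalize-coprime)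
  open import Function using (_∘_)
  open import Relation.Nullary using (Dec; yes; no)
  open import Relation.Binary.PropositionalEquality
  open ≡-Reasoning

  ℕ→ℚ-mkℚ : ∀ m → ℕ→ℚ m ≡ mkℚ (ℤ.+ m) 0 (Coprime.sym (Coprime.1-coprimeTo m))
  ℕ→ℚ-mkℚ m = normalize-coprime _

  ℕ→ℚ-suc : ∀ m → ℕ→ℚ (suc m) ≡ 1ℚ + ℕ→ℚ m
  ℕ→ℚ-suc m rewrite ℕ→ℚ-mkℚ m =
    cong (ℚ._/ 1) (sym (cong₂ ℤ._+_ (ℤ.*-identityʳ (ℤ.+ 1)) (ℤ.*-identityʳ (ℤ.+ m))))

  ℕ→ℚ-homo-+ : ∀ a b → ℕ→ℚ (a ℕ.+ b) ≡ ℕ→ℚ a + ℕ→ℚ b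
  ℕ→ℚ-homo-+ zero    b = sym (+-identityˡ (ℕ→ℚ b))
  ℕ→ℚ-homo-+ (suc a) b = begin
    ℕ→ℚ (suc (a ℕ.+ b))       ≡⟨ ℕ→ℚ-suc (a ℕ.+ b) ⟩
    1ℚ + ℕ→ℚ (a ℕ.+ b)        ≡⟨ cong (1ℚ +_) (ℕ→ℚ-homo-+ a b) ⟩
    1ℚ + (ℕ→ℚ a + ℕ→ℚ b)      ≡⟨ sym (+-assoc 1ℚ (ℕ→ℚ a) (ℕ→ℚ b)) ⟩
    1ℚ + ℕ→ℚ a + ℕ→ℚ b        ≡⟨ cong (_+ ℕ→ℚ b) (sym (ℕ→ℚ-suc a)) ⟩
    ℕ→ℚ (suc a) + ℕ→ℚ b       ∎

  ℕ→ℚ-homo-* : ∀ a b → ℕ→ℚ (a ℕ.* b) ≡ ℕ→ℚ a * ℕ→ℚ b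
  ℕ→ℚ-homo-* zero    b = sym (*-zeroˡ (ℕ→ℚ b))
  ℕ→ℚ-homo-* (suc a) b = begin
    ℕ→ℚ (b ℕ.+ a ℕ.* b)              ≡⟨ ℕ→ℚ-homo-+ b (a ℕ.* b) ⟩
    ℕ→ℚ b + ℕ→ℚ (a ℕ.* b)            ≡⟨ cong₂ _+_ (sym (*-identityˡ (ℕ→ℚ b))) (ℕ→ℚ-homo-* a b) ⟩
    1ℚ * ℕ→ℚ b + ℕ→ℚ a * ℕ→ℚ b       ≡⟨ sym (*-distribʳ-+ (ℕ→ℚ b) 1ℚ (ℕ→ℚ a)) ⟩
    (1ℚ + ℕ→ℚ a) * ℕ→ℚ b             ≡⟨ cong (_* ℕ→ℚ b) (sym (ℕ→ℚ-suc a)) ⟩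
    ℕ→ℚ (suc a) * ℕ→ℚ b              ∎

  ℕ→ℚ-𝟙 : ∀ {p} {P : Set p} (d : Dec P) → ℕ→ℚ (ℕΣ.𝟙 d) ≡ ℚΣ.𝟙 d
  ℕ→ℚ-𝟙 (yes _) = refl
  ℕ→ℚ-𝟙 (no _)  = refl

  ℕ→ℚ-homo-∑< : ∀ n (f : ℕ → ℕ) → ℕ→ℚ (ℕΣ.∑< n f) ≡ ℚΣ.∑< n (ℕ→ℚ ∘ f)
  ℕ→ℚ-homo-∑< zero    f = refl
  ℕ→ℚ-homo-∑< (suc n) f = trans (ℕ→ℚ-homo-+ (f 0) _) (cong (ℕ→ℚ (f 0) +_) (ℕ→ℚ-homo-∑< n (f ∘ suc)))

  ℕ→ℚ-𝟙* : ∀ {p} {P : Set p} (d : Dec P) x → ℕ→ℚ (ℕΣ.𝟙 d ℕ.* x) ≡ ℚΣ.𝟙 d * ℕ→ℚ x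
  ℕ→ℚ-𝟙* d x = trans (ℕ→ℚ-homo-* (ℕΣ.𝟙 d) x) (cong (_* ℕ→ℚ x) (ℕ→ℚ-𝟙 d))

  1/suc : ℕ → ℚ
  1/suc n = 1/ mkℚ (ℤ.+ suc n) 0 (Coprime.sym (Coprime.1-coprimeTo (suc n)))

  1/suc-inverse : ∀ n → 1/suc n * ℕ→ℚ (suc n) ≡ 1ℚ
  1/suc-inverse n rewrite ℕ→ℚ-mkℚ (suc n) = *-inverseˡ (mkℚ (ℤ.+ suc n) 0 (Coprime.sym (Coprime.1-coprimeTo (suc n))))

module Convolution where

  open import Data.Nat.Base using (suc; _∸_)
  open import Data.Rational.Base using (_*_)
  open import Data.Rational.Properties using (*-zeroˡ)
  open import Relation.Binary.PropositionalEquality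
  open ℚΣ

  _⋆_ : (ℕ → ℚ) → (ℕ → ℚ) → ℕ → ℚ
  (f ⋆ g) i = ∑[ a < suc i ] (f a * g (i ∸ a))

  ⋆-zeroˡ : ∀ f g → (∀ a → f a ≡ 0ℚ) → ∀ i → (f ⋆ g) i ≡ 0ℚ
  ⋆-zeroˡ f g f≡0 i = ∑<-zero (suc i) (λ a _ → trans (cong (_* g (i ∸ a)) (f≡0 a)) (*-zeroˡ (g (i ∸ a))))

module Evaluation (q : ℕ) where

  open import Data.Nat.Base using (zero; suc; _^_; _<_; z≤n; s≤s)
  open import Data.Rational.Base using (1ℚ; _+_; _*_)
  open import Data.Rational.Properties
    using (+-assoc; +-identityʳ; *-assoc; *-identityʳ; *-zeroˡ; *-zeroʳ; *-distribˡ-+; *-distribʳ-+;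
           *-1-commutativeMonoid)
  open import Algebra.Bundles using (CommutativeMonoid)
  open import Algebra.Properties.CommutativeSemigroup
    (CommutativeMonoid.commutativeSemigroup *-1-commutativeMonoid) using (x∙yz≈y∙xz)
  open import Function using (_∘_)
  open import Relation.Binary.PropositionalEquality
  open ≡-Reasoning
  open ℚΣ
  open NatEmbedding
  open Convolution

  power : ℕ → ℚ
  power i = ℕ→ℚ (q ^ i)

  eval : ℕ → (ℕ → ℚ) → ℚ
  eval n f = ∑[ i < n ] (f i * power i)

  eval-⋆-suc : ∀ L f g → eval (suc L) (f ⋆ g) ≡ f 0 * eval (suc L) g + ℕ→ℚ q * eval L ((f ∘ suc) ⋆ g)
  eval-⋆-suc L f g = begin
    (f 0 * g 0 + 0ℚ) * 1ℚ + ∑[ i < L ] ((f ⋆ g) (suc i) * power (suc i))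
      ≡⟨ cong₂ _+_ (trans (*-identityʳ (f 0 * g 0 + 0ℚ)) (+-identityʳ (f 0 * g 0))) (∑<-cong L (λ i _ → term i)) ⟩
    f 0 * g 0 + ∑[ i < L ] (f 0 * (g (suc i) * power (suc i)) + ℕ→ℚ q * (h i * power i))
      ≡⟨ cong (f 0 * g 0 +_) (trans (∑<-distrib-+ L (λ i → f 0 * (g (suc i) * power (suc i))) (λ i → ℕ→ℚ q * (h i * power i)))
           (cong₂ _+_ (∑<-distribˡ-* L (f 0) (λ i → g (suc i) * power (suc i)))
                      (∑<-distribˡ-* L (ℕ→ℚ q) (λ i → h i * power i)))) ⟩
    f 0 * g 0 + (f 0 * G + ℕ→ℚ q * eval L h)
      ≡⟨ sym (+-assoc (f 0 * g 0) (f 0 * G) (ℕ→ℚ q * eval L h)) ⟩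
    f 0 * g 0 + f 0 * G + ℕ→ℚ q * eval L h
      ≡⟨ cong (_+ ℕ→ℚ q * eval L h) (sym (*-distribˡ-+ (f 0) (g 0) G)) ⟩
    f 0 * (g 0 + G) + ℕ→ℚ q * eval L h
      ≡⟨ cong (λ z → f 0 * (z + G) + ℕ→ℚ q * eval L h) (sym (*-identityʳ (g 0))) ⟩
    f 0 * (g 0 * 1ℚ + G) + ℕ→ℚ q * eval L h
      ≡⟨⟩
    f 0 * eval (suc L) g + ℕ→ℚ q * eval L h ∎
    where
    h : ℕ → ℚ
    h = (f ∘ suc) ⋆ g
    G : ℚ
    G = ∑[ i < L ] (g (suc i) * power (suc i))
    term : ∀ i → (f 0 * g (suc i) + h i) * power (suc i) ≡ f 0 * (g (suc i) * power (suc i)) + ℕ→ℚ q * (h i * power i)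
    term i = begin
      (f 0 * g (suc i) + h i) * power (suc i)             ≡⟨ *-distribʳ-+ (power (suc i)) (f 0 * g (suc i)) (h i) ⟩
      f 0 * g (suc i) * power (suc i) + h i * power (suc i)
        ≡⟨ cong₂ _+_ (*-assoc (f 0) _ _) (cong (h i *_) (ℕ→ℚ-homo-* q (q ^ i))) ⟩
      f 0 * (g (suc i) * power (suc i)) + h i * (ℕ→ℚ q * power i)
        ≡⟨ cong (f 0 * (g (suc i) * power (suc i)) +_) (x∙yz≈y∙xz (h i) (ℕ→ℚ q) (power i)) ⟩
      f 0 * (g (suc i) * power (suc i)) + ℕ→ℚ q * (h i * power i) ∎

  eval-⋆ : ∀ M K (f g : ℕ → ℚ) → (∀ a → M < a → f a ≡ 0ℚ) → (∀ c → K < c → g c ≡ 0ℚ) →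
           eval (suc (M ℕ.+ K)) (f ⋆ g) ≡ eval (suc M) f * eval (suc K) g
  eval-⋆ zero K f g f≡0 g≡0 = begin
    eval (suc K) (f ⋆ g)                                ≡⟨ eval-⋆-suc K f g ⟩
    f 0 * G + ℕ→ℚ q * eval K ((f ∘ suc) ⋆ g)
      ≡⟨ cong (λ z → f 0 * G + ℕ→ℚ q * z)
           (∑<-zero K (λ i _ → trans (cong (_* power i) (⋆-zeroˡ (f ∘ suc) g (λ a → f≡0 (suc a) (s≤s z≤n)) i))
                                     (*-zeroˡ (power i)))) ⟩
    f 0 * G + ℕ→ℚ q * 0ℚ                                ≡⟨ trans (cong (f 0 * G +_) (*-zeroʳ (ℕ→ℚ q))) (+-identityʳ (f 0 * G)) ⟩
    f 0 * G                                             ≡⟨ cong (_* G) (sym (trans (+-identityʳ (f 0 * 1ℚ)) (*-identityʳ (f 0)))) ⟩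
    (f 0 * 1ℚ + 0ℚ) * G                                 ∎
    where
    G : ℚ
    G = eval (suc K) g
  eval-⋆ (suc M) K f g f≡0 g≡0 = begin
    eval (suc (suc (M ℕ.+ K))) (f ⋆ g)
      ≡⟨ eval-⋆-suc (suc (M ℕ.+ K)) f g ⟩
    f 0 * eval (suc (suc (M ℕ.+ K))) g + ℕ→ℚ q * eval (suc (M ℕ.+ K)) ((f ∘ suc) ⋆ g)
      ≡⟨ cong₂ (λ u v → f 0 * u + ℕ→ℚ q * v)
           (∑<-extend (suc K) (suc (suc (M ℕ.+ K))) (λ i → g i * power i) (s≤s (ℕP.m≤n+m K (suc M)))
              (λ i K<i _ → trans (cong (_* power i) (g≡0 i K<i)) (*-zeroˡ (power i))))
           (eval-⋆ M K (f ∘ suc) g (λ a M<a → f≡0 (suc a) (s≤s M<a)) g≡0) ⟩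
    f 0 * G + ℕ→ℚ q * (F′ * G)                          ≡⟨ cong (f 0 * G +_) (sym (*-assoc (ℕ→ℚ q) F′ G)) ⟩
    f 0 * G + ℕ→ℚ q * F′ * G                            ≡⟨ sym (*-distribʳ-+ G (f 0) (ℕ→ℚ q * F′)) ⟩
    (f 0 + ℕ→ℚ q * F′) * G                              ≡⟨ cong (_* G) (cong₂ _+_ (sym (*-identityʳ (f 0))) qF′) ⟩
    (f 0 * 1ℚ + ∑[ a < suc M ] (f (suc a) * power (suc a))) * G ∎
    where
    G  = eval (suc K) g
    F′ : ℚ
    F′ = eval (suc M) (f ∘ suc)
    qF′ : ℕ→ℚ q * F′ ≡ ∑[ a < suc M ] (f (suc a) * power (suc a))
    qF′ = begin
      ℕ→ℚ q * F′                                      ≡⟨ sym (∑<-distribˡ-* (suc M) (ℕ→ℚ q) (λ a → f (suc a) * power a)) ⟩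
      ∑[ a < suc M ] (ℕ→ℚ q * (f (suc a) * power a))  ≡⟨ ∑<-cong (suc M) (λ a _ → x∙yz≈y∙xz (ℕ→ℚ q) (f (suc a)) (power a)) ⟩
      ∑[ a < suc M ] (f (suc a) * (ℕ→ℚ q * power a))  ≡⟨ ∑<-cong (suc M) (λ a _ → cong (f (suc a) *_) (sym (ℕ→ℚ-homo-* q (q ^ a)))) ⟩
      ∑[ a < suc M ] (f (suc a) * power (suc a))      ∎

module Coefficients where

  open import Data.Nat.Base using (zero; suc; _∸_; _≤_; _<_; z≤n; s≤s)
  open import Data.Nat.Divisibility using (_∣_; _∣?_; divides)
  open import Data.Rational.Base using (_*_; _-_)
  open import Data.Rational.Properties using (*-comm; *-zeroˡ; *-zeroʳ; +-inverseʳ)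
  open import Relation.Nullary using (¬_; Dec; yes; no)
  open import Relation.Binary.PropositionalEquality
  open ≡-Reasoning
  open ℚΣ
  open NatEmbedding using (1/suc)

  hyperbola : ℕ → ℕ → ℕ → ℚ
  hyperbola m i j = 𝟙 (i ℕ.* j ℕ.≟ m)

  -- Möbius inversion of hyperbola over the divisors of m; the fuel f only has to exceed m.
  irreducibleWeightᶠ : ℕ → ℕ → ℕ → ℕ → ℚ
  irreducibleWeightᶠ zero    m i j = 0ℚ
  irreducibleWeightᶠ (suc f) m i j = hyperbola m i j - ∑[ d < m ] (𝟙 (d ∣? m) * irreducibleWeightᶠ f d i j)

  irreducibleWeight : ℕ → ℕ → ℕ → ℚ
  irreducibleWeight m = irreducibleWeightᶠ (suc m) m

  -- The recurrence of the header solved for A n k, with b = irreducibleWeight; the fuel f only has to exceed n.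
  countPolyᶠ : ℕ → ℕ → ℕ → ℕ → ℚ
  countPolyᶠ zero    n       i k = 0ℚ
  countPolyᶠ (suc f) zero    i k = 𝟙 (i ℕ.≟ 0) * 𝟙 (k ℕ.≟ 0)
  countPolyᶠ (suc f) (suc n) i k = 1/suc n *
    ∑[ m < suc n ] ∑[ j < suc k ] ∑[ a < suc i ] (irreducibleWeight (suc m) a j * countPolyᶠ f (n ∸ m) (i ∸ a) (k ∸ j))

  countPoly : ℕ → ℕ → ℕ → ℚ
  countPoly n = countPolyᶠ (suc n) n

  hyperbola-sym : ∀ m i j → hyperbola m i j ≡ hyperbola m j i
  hyperbola-sym m i j = 𝟙-cong (i ℕ.* j ℕ.≟ m) (j ℕ.* i ℕ.≟ m) (trans (ℕP.*-comm j i)) (trans (ℕP.*-comm i j))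

  irreducibleWeightᶠ-sym : ∀ f m i j → irreducibleWeightᶠ f m i j ≡ irreducibleWeightᶠ f m j i
  irreducibleWeightᶠ-sym zero    m i j = refl
  irreducibleWeightᶠ-sym (suc f) m i j =
    cong₂ _-_ (hyperbola-sym m i j) (∑<-cong m (λ d _ → cong (𝟙 (d ∣? m) *_) (irreducibleWeightᶠ-sym f d i j)))

  0∣⇒≡0 : ∀ {m} → 0 ∣ m → m ≡ 0
  0∣⇒≡0 (divides c eq) = trans eq (ℕP.*-zeroʳ c)

  irreducibleWeightᶠ-vanishes : ∀ f m i j → 1 ≤ m → m < i → irreducibleWeightᶠ f m i j ≡ 0ℚ
  irreducibleWeightᶠ-vanishes zero    m i j _   _   = refl
  irreducibleWeightᶠ-vanishes (suc f) m i j 1≤m m<i = begin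
    hyperbola m i j - ∑[ d < m ] (𝟙 (d ∣? m) * irreducibleWeightᶠ f d i j)  ≡⟨ cong₂ _-_ hyperbola≡0 (∑<-zero m term≡0) ⟩
    0ℚ - 0ℚ                                                          ≡⟨ +-inverseʳ 0ℚ ⟩
    0ℚ                                                               ∎
    where
    ij≢m : ∀ j → ¬ i ℕ.* j ≡ m
    ij≢m zero    eq = ℕP.<-irrefl (trans (sym (ℕP.*-zeroʳ i)) eq) 1≤m
    ij≢m (suc j) eq = ℕP.<-irrefl refl (ℕP.<-≤-trans m<i (subst (i ≤_) eq (ℕP.m≤m*n i (suc j))))
    hyperbola≡0 : hyperbola m i j ≡ 0ℚ
    hyperbola≡0 = 𝟙-no (i ℕ.* j ℕ.≟ m) (ij≢m j)
    term≡0 : ∀ d → d < m → 𝟙 (d ∣? m) * irreducibleWeightᶠ f d i j ≡ 0ℚ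
    term≡0 zero    _   = trans (cong (_* irreducibleWeightᶠ f 0 i j) (𝟙-no (0 ∣? m) (λ 0∣m → ℕP.<-irrefl (sym (0∣⇒≡0 0∣m)) 1≤m)))
                               (*-zeroˡ (irreducibleWeightᶠ f 0 i j))
    term≡0 (suc d) d<m = trans (cong (𝟙 (suc d ∣? m) *_) (irreducibleWeightᶠ-vanishes f (suc d) i j (s≤s z≤n) (ℕP.<-trans d<m m<i)))
                               (*-zeroʳ (𝟙 (suc d ∣? m)))

  countPolyᶠ-sym : ∀ f n i k → countPolyᶠ f n i k ≡ countPolyᶠ f n k i
  countPolyᶠ-sym zero    n       i k = refl
  countPolyᶠ-sym (suc f) zero    i k = *-comm (𝟙 (i ℕ.≟ 0)) (𝟙 (k ℕ.≟ 0))
  countPolyᶠ-sym (suc f) (suc n) i k = cong (1/suc n *_) (∑<-cong (suc n) (λ m _ → begin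
    ∑[ j < suc k ] ∑[ a < suc i ] (irreducibleWeight (suc m) a j * countPolyᶠ f (n ∸ m) (i ∸ a) (k ∸ j))
      ≡⟨ ∑<-comm (suc k) (suc i) (λ j a → irreducibleWeight (suc m) a j * countPolyᶠ f (n ∸ m) (i ∸ a) (k ∸ j)) ⟩
    ∑[ a < suc i ] ∑[ j < suc k ] (irreducibleWeight (suc m) a j * countPolyᶠ f (n ∸ m) (i ∸ a) (k ∸ j))
      ≡⟨ ∑<-cong (suc i) (λ a _ → ∑<-cong (suc k) (λ j _ →
           cong₂ _*_ (irreducibleWeightᶠ-sym (suc (suc m)) (suc m) a j) (countPolyᶠ-sym f (n ∸ m) (i ∸ a) (k ∸ j)))) ⟩
    ∑[ a < suc i ] ∑[ j < suc k ] (irreducibleWeight (suc m) j a * countPolyᶠ f (n ∸ m) (k ∸ j) (i ∸ a)) ∎))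

  countPolyᶠ-vanishes : ∀ f n i k → n < i → countPolyᶠ f n i k ≡ 0ℚ
  countPolyᶠ-vanishes zero    n       i k _   = refl
  countPolyᶠ-vanishes (suc f) zero    i k 0<i =
    trans (cong (_* 𝟙 (k ℕ.≟ 0)) (𝟙-no (i ℕ.≟ 0) (λ i≡0 → ℕP.<-irrefl (sym i≡0) 0<i))) (*-zeroˡ (𝟙 (k ℕ.≟ 0)))
  countPolyᶠ-vanishes (suc f) (suc n) i k n<i =
    trans (cong (1/suc n *_) (∑<-zero (suc n) (λ m m≤n →
             ∑<-zero (suc k) (λ j _ → ∑<-zero (suc i) (λ a _ → term≡0 m m≤n j a (suc m ℕ.<? a))))))
          (*-zeroʳ (1/suc n))
    where
    term≡0 : ∀ m → m < suc n → ∀ j a → Dec (suc m < a) →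
             irreducibleWeight (suc m) a j * countPolyᶠ f (n ∸ m) (i ∸ a) (k ∸ j) ≡ 0ℚ
    term≡0 m _ j a (yes 1+m<a) =
      trans (cong (_* countPolyᶠ f (n ∸ m) (i ∸ a) (k ∸ j)) (irreducibleWeightᶠ-vanishes (suc (suc m)) (suc m) a j (s≤s z≤n) 1+m<a))
            (*-zeroˡ (countPolyᶠ f (n ∸ m) (i ∸ a) (k ∸ j)))
    term≡0 m m<1+n j a (no 1+m≮a) =
      trans (cong (irreducibleWeight (suc m) a j *_) (countPolyᶠ-vanishes f (n ∸ m) (i ∸ a) (k ∸ j) n-m<i-a))
            (*-zeroʳ (irreducibleWeight (suc m) a j))
      where
      n-m<i-a : n ∸ m < i ∸ a
      n-m<i-a = ℕP.<-≤-trans (ℕP.∸-monoˡ-< {suc n} {suc m} {i} n<i m<1+n) (ℕP.∸-monoʳ-≤ i (ℕP.≮⇒≥ 1+m≮a))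

module CountingLaws where

  open import Data.Nat.Base using (suc; _*_; _∸_; _^_; _≤_)
  open import Data.Nat.Divisibility using (_∣?_)
  open ℕΣ

  -- In the application β m j = ∑ deg P over the irreducible P with j · deg P = m.
  DivisorSumLaw : ℕ → ℕ → (ℕ → ℕ → ℕ) → Set
  DivisorSumLaw q N β = ∀ m → 1 ≤ m → m ≤ N → ∀ j →
    ∑[ d < suc m ] (𝟙 (d ∣? m) * β d j) ≡ ∑[ i < suc m ] (𝟙 (i * j ℕ.≟ m) * q ^ i)

  Recurrence : ℕ → (ℕ → ℕ → ℕ) → (ℕ → ℕ → ℕ) → Set
  Recurrence N β A = ∀ n → n ≤ N → ∀ k →
    n * A n k ≡ ∑[ m < n ] ∑[ j < suc k ] (β (suc m) j * A (n ∸ suc m) (k ∸ j))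

open CountingLaws

module CoefficientValues (q N : ℕ) (β : ℕ → ℕ → ℕ) (divisorSumLaw : DivisorSumLaw q N β) where

  open import Data.Nat.Base using (zero; suc; _∸_; _^_; _≤_; _<_; z≤n; s≤s)
  open import Data.Nat.Divisibility using (_∣_; _∣?_; ∣-refl)
  open import Data.Rational.Base using (1ℚ; _+_; _*_; -_; _-_)
  open import Data.Rational.Properties
    using (*-assoc; *-identityˡ; *-identityʳ; *-zeroˡ; +-identityʳ; neg-distrib-+; +-0-abelianGroup; +-*-ring)
  open import Algebra.Properties.AbelianGroup +-0-abelianGroup using (xyx⁻¹≈y)
  open import Algebra.Properties.Ring +-*-ring using ([y-z]x≈yx-zx)
  open import Data.Empty using (⊥-elim)
  open import Function using (_∘_)
  open import Relation.Nullary using (yes; no)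
  open import Relation.Binary.PropositionalEquality
  open ≡-Reasoning
  open ℚΣ
  open NatEmbedding
  open Convolution
  open Evaluation q
  open Coefficients

  ∑<-neg : ∀ n (f : ℕ → ℚ) → ∑[ i < n ] (- f i) ≡ - ∑< n f
  ∑<-neg zero    f = refl
  ∑<-neg (suc n) f = trans (cong (- f 0 +_) (∑<-neg n (f ∘ suc))) (sym (neg-distrib-+ (f 0) _))

  eval-- : ∀ n (f g : ℕ → ℚ) → eval n (λ i → f i - g i) ≡ eval n f - eval n g
  eval-- n f g = begin
    ∑[ i < n ] ((f i - g i) * power i)          ≡⟨ ∑<-cong n (λ i _ → [y-z]x≈yx-zx (power i) (f i) (g i)) ⟩
    ∑[ i < n ] (f i * power i - g i * power i)  ≡⟨ ∑<-distrib-+ n (λ i → f i * power i) (λ i → - (g i * power i)) ⟩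
    eval n f + ∑[ i < n ] (- (g i * power i))   ≡⟨ cong (eval n f +_) (∑<-neg n (λ i → g i * power i)) ⟩
    eval n f - eval n g                         ∎

  eval-ℕ : ∀ n (f : ℕ → ℕ) → ℚΣ.∑< n (ℕ→ℚ ∘ f) ≡ ℕ→ℚ (ℕΣ.∑< n f)
  eval-ℕ n f = sym (ℕ→ℚ-homo-∑< n f)

  divisorSum : ℕ → ℕ → ℕ
  divisorSum m j = ℕΣ.∑< m (λ d → ℕΣ.𝟙 (d ∣? m) ℕ.* β d j)

  eval-hyperbola : ∀ m → 1 ≤ m → m ≤ N → ∀ j → eval (suc m) (λ i → hyperbola m i j) ≡ ℕ→ℚ (divisorSum m j ℕ.+ β m j)
  eval-hyperbola m 1≤m m≤N j = begin
    eval (suc m) (λ i → hyperbola m i j)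
      ≡⟨ ∑<-cong (suc m) (λ i _ → sym (ℕ→ℚ-𝟙* (i ℕ.* j ℕ.≟ m) (q ^ i))) ⟩
    ℚΣ.∑< (suc m) (λ i → ℕ→ℚ (ℕΣ.𝟙 (i ℕ.* j ℕ.≟ m) ℕ.* q ^ i))
      ≡⟨ eval-ℕ (suc m) (λ i → ℕΣ.𝟙 (i ℕ.* j ℕ.≟ m) ℕ.* q ^ i) ⟩
    ℕ→ℚ (ℕΣ.∑< (suc m) (λ i → ℕΣ.𝟙 (i ℕ.* j ℕ.≟ m) ℕ.* q ^ i))
      ≡⟨ cong ℕ→ℚ (sym (divisorSumLaw m 1≤m m≤N j)) ⟩
    ℕ→ℚ (ℕΣ.∑< (suc m) (λ d → ℕΣ.𝟙 (d ∣? m) ℕ.* β d j))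
      ≡⟨ cong ℕ→ℚ (ℕΣ.∑<-last m (λ d → ℕΣ.𝟙 (d ∣? m) ℕ.* β d j)) ⟩
    ℕ→ℚ (divisorSum m j ℕ.+ ℕΣ.𝟙 (m ∣? m) ℕ.* β m j)
      ≡⟨ cong (λ z → ℕ→ℚ (divisorSum m j ℕ.+ z ℕ.* β m j)) (ℕΣ.𝟙-yes (m ∣? m) ∣-refl) ⟩
    ℕ→ℚ (divisorSum m j ℕ.+ 1 ℕ.* β m j)
      ≡⟨ cong (λ z → ℕ→ℚ (divisorSum m j ℕ.+ z)) (ℕP.*-identityˡ (β m j)) ⟩
    ℕ→ℚ (divisorSum m j ℕ.+ β m j) ∎

  eval-divisorSum : ∀ (w : ℕ → ℕ → ℕ → ℚ) m → 1 ≤ m → ∀ j →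
                    (∀ d → 1 ≤ d → d < m → ∀ i → d < i → w d i j ≡ 0ℚ) →
                    (∀ d → 1 ≤ d → d < m → eval (suc d) (λ i → w d i j) ≡ ℕ→ℚ (β d j)) →
                    eval (suc m) (λ i → ∑[ d < m ] (𝟙 (d ∣? m) * w d i j)) ≡ ℕ→ℚ (divisorSum m j)
  eval-divisorSum w m 1≤m j w-vanishes eval-w = begin
    ∑[ i < suc m ] (∑[ d < m ] (𝟙 (d ∣? m) * w d i j) * power i)
      ≡⟨ ∑<-cong (suc m) (λ i _ → trans (sym (∑<-distribʳ-* m (power i) (λ d → 𝟙 (d ∣? m) * w d i j)))
                                        (∑<-cong m (λ d _ → *-assoc (𝟙 (d ∣? m)) (w d i j) (power i)))) ⟩
    ∑[ i < suc m ] ∑[ d < m ] (𝟙 (d ∣? m) * (w d i j * power i))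
      ≡⟨ ∑<-comm (suc m) m (λ i d → 𝟙 (d ∣? m) * (w d i j * power i)) ⟩
    ∑[ d < m ] ∑[ i < suc m ] (𝟙 (d ∣? m) * (w d i j * power i))
      ≡⟨ ∑<-cong m (λ d d<m → trans (∑<-distribˡ-* (suc m) (𝟙 (d ∣? m)) (λ i → w d i j * power i)) (term d d<m)) ⟩
    ℚΣ.∑< m (λ d → ℕ→ℚ (ℕΣ.𝟙 (d ∣? m) ℕ.* β d j))
      ≡⟨ eval-ℕ m (λ d → ℕΣ.𝟙 (d ∣? m) ℕ.* β d j) ⟩
    ℕ→ℚ (divisorSum m j) ∎
    where
    positive : ∀ {d} → d ∣ m → 1 ≤ d
    positive {zero}  0∣m = ⊥-elim (ℕP.<-irrefl (sym (0∣⇒≡0 0∣m)) 1≤m)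
    positive {suc _} _   = s≤s z≤n
    term : ∀ d → d < m → 𝟙 (d ∣? m) * eval (suc m) (λ i → w d i j) ≡ ℕ→ℚ (ℕΣ.𝟙 (d ∣? m) ℕ.* β d j)
    term d d<m with d ∣? m
    ... | no _    = *-zeroˡ (eval (suc m) (λ i → w d i j))
    ... | yes d∣m = begin
      1ℚ * eval (suc m) (λ i → w d i j)
        ≡⟨ *-identityˡ _ ⟩
      eval (suc m) (λ i → w d i j)
        ≡⟨ ∑<-extend (suc d) (suc m) (λ i → w d i j * power i) (ℕP.<⇒≤ (s≤s d<m))
             (λ i d<i _ → trans (cong (_* power i) (w-vanishes d (positive d∣m) d<m i d<i)) (*-zeroˡ (power i))) ⟩
      eval (suc d) (λ i → w d i j)
        ≡⟨ eval-w d (positive d∣m) d<m ⟩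
      ℕ→ℚ (β d j)
        ≡⟨ cong ℕ→ℚ (sym (ℕP.+-identityʳ (β d j))) ⟩
      ℕ→ℚ (1 ℕ.* β d j) ∎

  eval-irreducibleWeightᶠ : ∀ f m → 1 ≤ m → m < f → m ≤ N → ∀ j →
                            eval (suc m) (λ i → irreducibleWeightᶠ f m i j) ≡ ℕ→ℚ (β m j)
  eval-irreducibleWeightᶠ (suc f) m 1≤m (s≤s m≤f) m≤N j = begin
    eval (suc m) (λ i → hyperbola m i j - D i)             ≡⟨ eval-- (suc m) (λ i → hyperbola m i j) D ⟩
    eval (suc m) (λ i → hyperbola m i j) - eval (suc m) D  ≡⟨ cong₂ _-_ (eval-hyperbola m 1≤m m≤N j) eval-D ⟩
    ℕ→ℚ (divisorSum m j ℕ.+ β m j) - ℕ→ℚ (divisorSum m j)  ≡⟨ cong (_- ℕ→ℚ (divisorSum m j)) (ℕ→ℚ-homo-+ (divisorSum m j) (β m j)) ⟩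
    ℕ→ℚ (divisorSum m j) + ℕ→ℚ (β m j) - ℕ→ℚ (divisorSum m j) ≡⟨ xyx⁻¹≈y (ℕ→ℚ (divisorSum m j)) (ℕ→ℚ (β m j)) ⟩
    ℕ→ℚ (β m j)                                            ∎
    where
    D : ℕ → ℚ
    D i = ∑[ d < m ] (𝟙 (d ∣? m) * irreducibleWeightᶠ f d i j)
    eval-D : eval (suc m) D ≡ ℕ→ℚ (divisorSum m j)
    eval-D = eval-divisorSum (irreducibleWeightᶠ f) m 1≤m j
      (λ d 1≤d _ i d<i → irreducibleWeightᶠ-vanishes f d i j 1≤d d<i)
      (λ d 1≤d d<m → eval-irreducibleWeightᶠ f d 1≤d (ℕP.<-≤-trans d<m m≤f) (ℕP.≤-trans (ℕP.<⇒≤ d<m) m≤N) j)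

  eval-irreducibleWeight : ∀ m → 1 ≤ m → m ≤ N → ∀ j → eval (suc m) (λ i → irreducibleWeight m i j) ≡ ℕ→ℚ (β m j)
  eval-irreducibleWeight m 1≤m = eval-irreducibleWeightᶠ (suc m) m 1≤m ℕP.≤-refl

  module _ (A : ℕ → ℕ → ℕ) (recurrence : Recurrence N β A) (A-zero : ∀ k → A 0 k ≡ ℕΣ.𝟙 (k ℕ.≟ 0)) where

    eval-recurrence : ∀ n k (w r : ℕ → ℕ → ℕ → ℚ) → suc n ≤ N →
      (∀ m → m < suc n → ∀ j → eval (suc (suc n)) (w m j ⋆ r m j) ≡ ℕ→ℚ (β (suc m) j ℕ.* A (suc n ∸ suc m) (k ∸ j))) →
      eval (suc (suc n)) (λ i → ∑[ m < suc n ] ∑[ j < suc k ] (w m j ⋆ r m j) i) ≡ ℕ→ℚ (suc n) * ℕ→ℚ (A (suc n) k)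
    eval-recurrence n k w r 1+n≤N eval-term = begin
      ∑[ i < suc (suc n) ] (∑[ m < suc n ] ∑[ j < suc k ] (w m j ⋆ r m j) i * power i)
        ≡⟨ ∑<-cong (suc (suc n)) (λ i _ →
             trans (sym (∑<-distribʳ-* (suc n) (power i) (λ m → ∑[ j < suc k ] (w m j ⋆ r m j) i)))
                   (∑<-cong (suc n) (λ m _ → sym (∑<-distribʳ-* (suc k) (power i) (λ j → (w m j ⋆ r m j) i))))) ⟩
      ∑[ i < suc (suc n) ] ∑[ m < suc n ] ∑[ j < suc k ] ((w m j ⋆ r m j) i * power i)
        ≡⟨ ∑<-comm (suc (suc n)) (suc n) (λ i m → ∑[ j < suc k ] ((w m j ⋆ r m j) i * power i)) ⟩
      ∑[ m < suc n ] ∑[ i < suc (suc n) ] ∑[ j < suc k ] ((w m j ⋆ r m j) i * power i)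
        ≡⟨ ∑<-cong (suc n) (λ m _ → ∑<-comm (suc (suc n)) (suc k) (λ i j → (w m j ⋆ r m j) i * power i)) ⟩
      ∑[ m < suc n ] ∑[ j < suc k ] eval (suc (suc n)) (w m j ⋆ r m j)
        ≡⟨ ∑<-cong (suc n) (λ m m<1+n → ∑<-cong (suc k) (λ j _ → eval-term m m<1+n j)) ⟩
      ℚΣ.∑< (suc n) (λ m → ℚΣ.∑< (suc k) (λ j → ℕ→ℚ (β (suc m) j ℕ.* A (suc n ∸ suc m) (k ∸ j))))
        ≡⟨ ∑<-cong (suc n) (λ m _ → eval-ℕ (suc k) (λ j → β (suc m) j ℕ.* A (suc n ∸ suc m) (k ∸ j))) ⟩
      ℚΣ.∑< (suc n) (λ m → ℕ→ℚ (ℕΣ.∑< (suc k) (λ j → β (suc m) j ℕ.* A (suc n ∸ suc m) (k ∸ j))))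
        ≡⟨ eval-ℕ (suc n) (λ m → ℕΣ.∑< (suc k) (λ j → β (suc m) j ℕ.* A (suc n ∸ suc m) (k ∸ j))) ⟩
      ℕ→ℚ (ℕΣ.∑< (suc n) (λ m → ℕΣ.∑< (suc k) (λ j → β (suc m) j ℕ.* A (suc n ∸ suc m) (k ∸ j))))
        ≡⟨ cong ℕ→ℚ (sym (recurrence (suc n) 1+n≤N k)) ⟩
      ℕ→ℚ (suc n ℕ.* A (suc n) k)
        ≡⟨ ℕ→ℚ-homo-* (suc n) (A (suc n) k) ⟩
      ℕ→ℚ (suc n) * ℕ→ℚ (A (suc n) k) ∎

    eval-countPolyᶠ : ∀ f n → n < f → n ≤ N → ∀ k → eval (suc n) (λ i → countPolyᶠ f n i k) ≡ ℕ→ℚ (A n k)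
    eval-countPolyᶠ (suc f) zero _ _ k = begin
      (1ℚ * 𝟙 (k ℕ.≟ 0)) * 1ℚ + 0ℚ  ≡⟨ trans (+-identityʳ _) (trans (*-identityʳ _) (*-identityˡ _)) ⟩
      𝟙 (k ℕ.≟ 0)                    ≡⟨ sym (ℕ→ℚ-𝟙 (k ℕ.≟ 0)) ⟩
      ℕ→ℚ (ℕΣ.𝟙 (k ℕ.≟ 0))          ≡⟨ cong ℕ→ℚ (sym (A-zero k)) ⟩
      ℕ→ℚ (A 0 k)                    ∎
    eval-countPolyᶠ (suc f) (suc n) (s≤s n<f) 1+n≤N k = begin
      ∑[ i < suc (suc n) ] (1/suc n * X i * power i)   ≡⟨ ∑<-cong (suc (suc n)) (λ i _ → *-assoc (1/suc n) (X i) (power i)) ⟩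
      ∑[ i < suc (suc n) ] (1/suc n * (X i * power i)) ≡⟨ ∑<-distribˡ-* (suc (suc n)) (1/suc n) (λ i → X i * power i) ⟩
      1/suc n * eval (suc (suc n)) X                  ≡⟨ cong (1/suc n *_) (eval-recurrence n k weight rest 1+n≤N eval-term) ⟩
      1/suc n * (ℕ→ℚ (suc n) * ℕ→ℚ (A (suc n) k))     ≡⟨ sym (*-assoc (1/suc n) (ℕ→ℚ (suc n)) (ℕ→ℚ (A (suc n) k))) ⟩
      1/suc n * ℕ→ℚ (suc n) * ℕ→ℚ (A (suc n) k)       ≡⟨ cong (_* ℕ→ℚ (A (suc n) k)) (1/suc-inverse n) ⟩
      1ℚ * ℕ→ℚ (A (suc n) k)                          ≡⟨ *-identityˡ _ ⟩
      ℕ→ℚ (A (suc n) k)                               ∎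
      where
      weight : ℕ → ℕ → ℕ → ℚ
      weight m j a = irreducibleWeight (suc m) a j
      rest : ℕ → ℕ → ℕ → ℚ
      rest m j c = countPolyᶠ f (n ∸ m) c (k ∸ j)
      X : ℕ → ℚ
      X i = ∑[ m < suc n ] ∑[ j < suc k ] (weight m j ⋆ rest m j) i
      eval-term : ∀ m → m < suc n → ∀ j →
                  eval (suc (suc n)) (weight m j ⋆ rest m j) ≡ ℕ→ℚ (β (suc m) j ℕ.* A (suc n ∸ suc m) (k ∸ j))
      eval-term m (s≤s m≤n) j = begin
        eval (suc (suc n)) (weight m j ⋆ rest m j)
          ≡⟨ cong (λ z → eval (suc z) (weight m j ⋆ rest m j)) (sym (cong suc (ℕP.m+[n∸m]≡n m≤n))) ⟩
        eval (suc (suc m ℕ.+ (n ∸ m))) (weight m j ⋆ rest m j)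
          ≡⟨ eval-⋆ (suc m) (n ∸ m) (weight m j) (rest m j)
               (λ a 1+m<a → irreducibleWeightᶠ-vanishes (suc (suc m)) (suc m) a j (s≤s z≤n) 1+m<a)
               (λ c n-m<c → countPolyᶠ-vanishes f (n ∸ m) c (k ∸ j) n-m<c) ⟩
        eval (suc (suc m)) (weight m j) * eval (suc (n ∸ m)) (rest m j)
          ≡⟨ cong₂ _*_ (eval-irreducibleWeight (suc m) (s≤s z≤n) (ℕP.≤-trans (s≤s m≤n) 1+n≤N) j)
                       (eval-countPolyᶠ f (n ∸ m) (ℕP.≤-<-trans (ℕP.m∸n≤m n m) n<f)
                          (ℕP.≤-trans (ℕP.m∸n≤m n m) (ℕP.≤-trans (ℕP.n≤1+n n) 1+n≤N)) (k ∸ j)) ⟩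
        ℕ→ℚ (β (suc m) j) * ℕ→ℚ (A (n ∸ m) (k ∸ j))
          ≡⟨ sym (ℕ→ℚ-homo-* (β (suc m) j) (A (n ∸ m) (k ∸ j))) ⟩
        ℕ→ℚ (β (suc m) j ℕ.* A (suc n ∸ suc m) (k ∸ j)) ∎

    eval-countPoly : ∀ n → n ≤ N → ∀ k → eval (suc n) (λ i → countPoly n i k) ≡ ℕ→ℚ (A n k)
    eval-countPoly n = eval-countPolyᶠ (suc n) n ℕP.≤-refl

module DegreeArithmetic (q N : ℕ) (degs : List ℕ) (degs-positive : All (1 ≤_) degs) where

  open import Data.Nat.Base using (zero; suc; _+_; _*_; _∸_; _^_; _<_; z≤n; s≤s; NonZero; >-nonZero; >-nonZero⁻¹; ≢-nonZero)
  open import Data.Nat using (_≟_; _≤?_; _<?_)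
  open import Data.Nat.Properties
  open import Data.Nat.Divisibility using (_∣_; _∣?_; divides; ∣⇒≤; *-cancelˡ-∣; *-monoʳ-∣; m*n∣⇒m∣)
  open import Algebra.Properties.CommutativeSemigroup *-commutativeSemigroup using (x∙yz≈y∙xz)
  open import Data.Empty using (⊥-elim)
  open import Data.Sum using (inj₁; inj₂)
  open import Function using (_∘_)
  open import Relation.Nullary using (¬_; yes; no)
  open import Relation.Binary.PropositionalEquality
  open ≡-Reasoning
  open ℕΣ
  open Coefficients using (0∣⇒≡0)

  β : ℕ → ℕ → ℕ
  β m j = ∑[ e ∈ degs ] (𝟙 (m ≟ j * e) * e)

  divisorDegreeSum : ℕ → ℕ
  divisorDegreeSum r = ∑[ e ∈ degs ] (𝟙 (e ∣? r) * e)

  ∑<-const : ∀ n c → ∑[ i < n ] c ≡ n * c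
  ∑<-const zero    c = refl
  ∑<-const (suc n) c = cong (c +_) (∑<-const n c)

  ∑<-select : ∀ n x (h : ℕ → ℕ) → ∑[ r < n ] (𝟙 (suc r ≟ suc x) * h (suc r)) ≡ 𝟙 (suc x ≤? n) * h (suc x)
  ∑<-select n x h = trans (∑<-cong n (λ r _ → cong (_* h (suc r)) (𝟙-cong (suc r ≟ suc x) (r ≟ x) suc-injective (cong suc))))
                          (∑<-𝟙≟ n x (h ∘ suc))

  multiples-count : ∀ e M t → 1 ≤ t → t ≤ M → ∑[ j < M ] 𝟙 (t ≟ suc j * suc e) ≡ 𝟙 (suc e ∣? t)
  multiples-count e M t 1≤t t≤M with suc e ∣? t
  ... | no e∤t = ∑<-zero M (λ j _ → 𝟙-no (t ≟ suc j * suc e) (λ t≡ → e∤t (divides (suc j) t≡)))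
  ... | yes (divides zero    t≡0) = ⊥-elim (<-irrefl (sym t≡0) 1≤t)
  ... | yes (divides (suc c) t≡) = begin
    ∑[ j < M ] 𝟙 (t ≟ suc j * suc e)  ≡⟨ ∑<-cong M (λ j _ → trans (𝟙-cong (t ≟ suc j * suc e) (j ≟ c) to from) (sym (*-identityʳ _))) ⟩
    ∑[ j < M ] (𝟙 (j ≟ c) * 1)        ≡⟨ ∑<-𝟙≟ M c (λ _ → 1) ⟩
    𝟙 (c <? M) * 1                    ≡⟨ cong (_* 1) (𝟙-yes (c <? M) (≤-trans (subst (suc c ≤_) (sym t≡) (m≤m*n (suc c) (suc e))) t≤M)) ⟩
    1                                 ∎
    where
    to : ∀ {j} → t ≡ suc j * suc e → j ≡ c
    to {j} t≡′ = suc-injective (*-cancelʳ-≡ (suc j) (suc c) (suc e) (trans (sym t≡′) t≡))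
    from : ∀ {j} → j ≡ c → t ≡ suc j * suc e
    from refl = t≡

  ∑<-multiples : ∀ e n (h : ℕ → ℕ) →
                 ∑[ j < n ] (𝟙 (suc j * suc e ≤? n) * h (suc j * suc e)) ≡ ∑[ r < n ] (𝟙 (suc e ∣? suc r) * h (suc r))
  ∑<-multiples e n h = begin
    ∑[ j < n ] (𝟙 (suc j * suc e ≤? n) * h (suc j * suc e))
      ≡⟨ ∑<-cong n (λ j _ → sym (∑<-select n (e + j * suc e) h)) ⟩
    ∑[ j < n ] ∑[ r < n ] (𝟙 (suc r ≟ suc j * suc e) * h (suc r))
      ≡⟨ ∑<-comm n n (λ j r → 𝟙 (suc r ≟ suc j * suc e) * h (suc r)) ⟩
    ∑[ r < n ] ∑[ j < n ] (𝟙 (suc r ≟ suc j * suc e) * h (suc r))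
      ≡⟨ ∑<-cong n (λ r _ → ∑<-distribʳ-* n (h (suc r)) (λ j → 𝟙 (suc r ≟ suc j * suc e))) ⟩
    ∑[ r < n ] (∑[ j < n ] 𝟙 (suc r ≟ suc j * suc e) * h (suc r))
      ≡⟨ ∑<-cong n (λ r r<n → cong (_* h (suc r)) (multiples-count e n (suc r) (s≤s z≤n) r<n)) ⟩
    ∑[ r < n ] (𝟙 (suc e ∣? suc r) * h (suc r)) ∎

  module _ (degree-identity : ∀ n → n ≤ N →
              n * q ^ n ≡ ∑[ e ∈ degs ] ∑[ j < n ] (𝟙 (suc j * e ≤? n) * (e * q ^ (n ∸ suc j * e)))) where

    degree-identity′ : ∀ n → n ≤ N → n * q ^ n ≡ ∑[ r < n ] (divisorDegreeSum (suc r) * q ^ (n ∸ suc r))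
    degree-identity′ n n≤N = begin
      n * q ^ n
        ≡⟨ degree-identity n n≤N ⟩
      ∑[ e ∈ degs ] ∑[ j < n ] (𝟙 (suc j * e ≤? n) * (e * q ^ (n ∸ suc j * e)))
        ≡⟨ ∑-cong-All degs-positive (λ { (suc e) _ → ∑<-multiples e n (λ r → suc e * q ^ (n ∸ r)) }) ⟩
      ∑[ e ∈ degs ] ∑[ r < n ] (𝟙 (e ∣? suc r) * (e * q ^ (n ∸ suc r)))
        ≡⟨ ∑-∑<-comm degs n (λ e r → 𝟙 (e ∣? suc r) * (e * q ^ (n ∸ suc r))) ⟩
      ∑[ r < n ] ∑[ e ∈ degs ] (𝟙 (e ∣? suc r) * (e * q ^ (n ∸ suc r)))
        ≡⟨ ∑<-cong n (λ r _ → trans (∑-cong degs (λ e → sym (*-assoc (𝟙 (e ∣? suc r)) e _)))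
                                    (∑-distribʳ-* degs (q ^ (n ∸ suc r)) (λ e → 𝟙 (e ∣? suc r) * e))) ⟩
      ∑[ r < n ] (divisorDegreeSum (suc r) * q ^ (n ∸ suc r)) ∎

    -- Strong induction: the r = n term of degree-identity′ is the only unknown one.
    divisorDegreeSum<≡q^ : ∀ n → n ≤ N → ∀ r → r < n → divisorDegreeSum (suc r) ≡ q ^ suc r
    divisorDegreeSum<≡q^ (suc n) 1+n≤N r r<1+n with r ≟ n
    ... | no r≢n = divisorDegreeSum<≡q^ n (≤-trans (n≤1+n n) 1+n≤N) r (≤∧≢⇒< (≤-pred r<1+n) r≢n)
    ... | yes refl = +-cancelʳ-≡ _ _ _ (sym both-sides)
      where
      IH : ∀ r′ → r′ < r → divisorDegreeSum (suc r′) ≡ q ^ suc r′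
      IH = divisorDegreeSum<≡q^ r (≤-trans (n≤1+n r) 1+n≤N)
      S : ℕ → ℕ
      S = divisorDegreeSum
      power-split : ∀ r′ → r′ < r → q ^ suc r′ * q ^ (r ∸ r′) ≡ q ^ suc r
      power-split r′ r′<r = trans (sym (^-distribˡ-+-* q (suc r′) (r ∸ r′))) (cong (λ z → q ^ suc z) (m+[n∸m]≡n (<⇒≤ r′<r)))
      both-sides : q ^ suc r + r * q ^ suc r ≡ S (suc r) + r * q ^ suc r
      both-sides = begin
        suc r * q ^ suc r
          ≡⟨ degree-identity′ (suc r) 1+n≤N ⟩
        ∑[ r′ < suc r ] (S (suc r′) * q ^ (suc r ∸ suc r′))
          ≡⟨ ∑<-last r (λ r′ → S (suc r′) * q ^ (suc r ∸ suc r′)) ⟩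
        ∑[ r′ < r ] (S (suc r′) * q ^ (r ∸ r′)) + S (suc r) * q ^ (r ∸ r)
          ≡⟨ cong₂ _+_ (trans (∑<-cong r (λ r′ r′<r → trans (cong (_* q ^ (r ∸ r′)) (IH r′ r′<r)) (power-split r′ r′<r)))
                              (∑<-const r (q ^ suc r)))
                       (trans (cong (λ z → S (suc r) * q ^ z) (n∸n≡0 r)) (*-identityʳ _)) ⟩
        r * q ^ suc r + S (suc r)
          ≡⟨ +-comm (r * q ^ suc r) (S (suc r)) ⟩
        S (suc r) + r * q ^ suc r ∎

    divisorDegreeSum≡q^ : ∀ r → 1 ≤ r → r ≤ N → divisorDegreeSum r ≡ q ^ r
    divisorDegreeSum≡q^ (suc r) _ r<N = divisorDegreeSum<≡q^ N ≤-refl r r<N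

    ∑-divisors-β : ∀ m → 1 ≤ m → ∀ j → ∑[ d < suc m ] (𝟙 (d ∣? m) * β d j) ≡ ∑[ e ∈ degs ] (𝟙 (j * e ∣? m) * e)
    ∑-divisors-β m 1≤m j = begin
      ∑[ d < suc m ] (𝟙 (d ∣? m) * ∑[ e ∈ degs ] (𝟙 (d ≟ j * e) * e))
        ≡⟨ ∑<-cong (suc m) (λ d _ → sym (∑-distribˡ-* degs (𝟙 (d ∣? m)) (λ e → 𝟙 (d ≟ j * e) * e))) ⟩
      ∑[ d < suc m ] ∑[ e ∈ degs ] (𝟙 (d ∣? m) * (𝟙 (d ≟ j * e) * e))
        ≡⟨ sym (∑-∑<-comm degs (suc m) (λ e d → 𝟙 (d ∣? m) * (𝟙 (d ≟ j * e) * e))) ⟩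
      ∑[ e ∈ degs ] ∑[ d < suc m ] (𝟙 (d ∣? m) * (𝟙 (d ≟ j * e) * e))
        ≡⟨ ∑-cong degs (λ e → trans (∑<-cong (suc m) (λ d _ → x∙yz≈y∙xz (𝟙 (d ∣? m)) (𝟙 (d ≟ j * e)) e)) (select e)) ⟩
      ∑[ e ∈ degs ] (𝟙 (j * e ∣? m) * e) ∎
      where
      instance
        m-nonZero : NonZero m
        m-nonZero = >-nonZero 1≤m
      select : ∀ e → ∑[ d < suc m ] (𝟙 (d ≟ j * e) * (𝟙 (d ∣? m) * e)) ≡ 𝟙 (j * e ∣? m) * e
      select e = trans (∑<-𝟙≟ (suc m) (j * e) (λ d → 𝟙 (d ∣? m) * e)) (guard (j * e ∣? m))
        where
        guard : ∀ d → 𝟙 (j * e <? suc m) * (𝟙 d * e) ≡ 𝟙 d * e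
        guard (yes je∣m) = trans (cong (_* (1 * e)) (𝟙-yes (j * e <? suc m) (s≤s (∣⇒≤ je∣m)))) (+-identityʳ _)
        guard (no _)     = *-zeroʳ (𝟙 (j * e <? suc m))

    divisorSumLaw : DivisorSumLaw q N β
    divisorSumLaw m 1≤m m≤N j = trans (∑-divisors-β m 1≤m j) (by-j j)
      where
      m≢0 : ¬ m ≡ 0
      m≢0 m≡0 = <-irrefl (sym m≡0) 1≤m
      by-j : ∀ j → ∑[ e ∈ degs ] (𝟙 (j * e ∣? m) * e) ≡ ∑[ i < suc m ] (𝟙 (i * j ≟ m) * q ^ i)
      by-j zero = trans (∑-zero degs (λ e → cong (_* e) (𝟙-no (0 ∣? m) (λ 0∣m → m≢0 (0∣⇒≡0 0∣m)))))
                        (sym (∑<-zero (suc m) (λ i _ → cong (_* q ^ i) (𝟙-no (i * 0 ≟ m) (λ i0≡m → m≢0 (trans (sym i0≡m) (*-zeroʳ i)))))))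
      by-j (suc j) with suc j ∣? m
      ... | no j∤m =
        trans (∑-zero degs (λ e → cong (_* e) (𝟙-no (suc j * e ∣? m) (λ je∣m → j∤m (m*n∣⇒m∣ (suc j) e je∣m)))))
              (sym (∑<-zero (suc m) (λ i _ → cong (_* q ^ i) (𝟙-no (i * suc j ≟ m) (λ ij≡m → j∤m (divides i (sym ij≡m)))))))
      ... | yes (divides r m≡rj) = begin
        ∑[ e ∈ degs ] (𝟙 (suc j * e ∣? m) * e)
          ≡⟨ ∑-cong degs (λ e → cong (_* e) (𝟙-cong (suc j * e ∣? m) (e ∣? r) cancel multiply)) ⟩
        divisorDegreeSum r
          ≡⟨ divisorDegreeSum≡q^ r 1≤r (≤-trans r≤m m≤N) ⟩
        q ^ r
          ≡⟨ trans (sym (*-identityˡ (q ^ r))) (cong (_* q ^ r) (sym (𝟙-yes (r <? suc m) (s≤s r≤m)))) ⟩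
        𝟙 (r <? suc m) * q ^ r
          ≡⟨ sym (∑<-𝟙≟ (suc m) r (q ^_)) ⟩
        ∑[ i < suc m ] (𝟙 (i ≟ r) * q ^ i)
          ≡⟨ ∑<-cong (suc m) (λ i _ → cong (_* q ^ i) (𝟙-cong (i ≟ r) (i * suc j ≟ m) (λ { refl → sym m≡rj })
                                                              (λ ij≡m → *-cancelʳ-≡ i r (suc j) (trans ij≡m m≡rj)))) ⟩
        ∑[ i < suc m ] (𝟙 (i * suc j ≟ m) * q ^ i) ∎
        where
        m≡jr : m ≡ suc j * r
        m≡jr = trans m≡rj (*-comm r (suc j))
        cancel : ∀ {e} → suc j * e ∣ m → e ∣ r
        cancel je∣m = *-cancelˡ-∣ (suc j) (subst (suc j * _ ∣_) m≡jr je∣m)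
        multiply : ∀ {e} → e ∣ r → suc j * e ∣ m
        multiply e∣r = subst (suc j * _ ∣_) (sym m≡jr) (*-monoʳ-∣ (suc j) e∣r)
        1≤r : 1 ≤ r
        1≤r = >-nonZero⁻¹ r {{≢-nonZero (λ { refl → m≢0 m≡rj })}}
        r≤m : r ≤ m
        r≤m = subst (r ≤_) (sym m≡rj) (m≤m*n r (suc j))

  module _ (A : ℕ → ℕ → ℕ)
           (count-identity : ∀ n → n ≤ N → ∀ k → n * A n k ≡
              ∑[ e ∈ degs ] ∑[ j < n ] (𝟙 (suc j * e ≤? n) * (e * (𝟙 (suc j ≤? k) * A (n ∸ suc j * e) (k ∸ suc j))))) where

    countTerm : ℕ → ℕ → ℕ → ℕ → ℕ
    countTerm n k e j = 𝟙 (suc j * e ≤? n) * (e * A (n ∸ suc j * e) (k ∸ suc j))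

    -- The exponent j of P^j is at most both n and k, so either bound can cut off the sum.
    truncate : ∀ n k e → ∑[ j < n ] (𝟙 (suc j * suc e ≤? n) * (suc e * (𝟙 (suc j ≤? k) * A (n ∸ suc j * suc e) (k ∸ suc j))))
                         ≡ ∑[ j < k ] countTerm n k (suc e) j
    truncate n k e = trans n-to-k (∑<-cong k (λ j j<k → cong (λ z → 𝟙 (suc j * suc e ≤? n) * (suc e * z))
                                                     (trans (cong (_* a j) (𝟙-yes (suc j ≤? k) j<k)) (+-identityʳ (a j)))))
      where
      a : ℕ → ℕ
      a j = A (n ∸ suc j * suc e) (k ∸ suc j)
      Ψ : ℕ → ℕ
      Ψ j = 𝟙 (suc j * suc e ≤? n) * (suc e * (𝟙 (suc j ≤? k) * a j))
      Ψ-vanishes : ∀ j → n ≤ j ⊎ k ≤ j → Ψ j ≡ 0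
      Ψ-vanishes j (inj₁ n≤j) =
        cong (_* (suc e * (𝟙 (suc j ≤? k) * a j)))
             (𝟙-no (suc j * suc e ≤? n) (λ je≤n → <-irrefl refl (≤-trans (s≤s n≤j) (≤-trans (m≤m*n (suc j) (suc e)) je≤n))))
      Ψ-vanishes j (inj₂ k≤j) = begin
        Ψ j                                   ≡⟨ cong (λ z → 𝟙 (suc j * suc e ≤? n) * (suc e * (z * a j)))
                                                      (𝟙-no (suc j ≤? k) (λ j<k → <-irrefl refl (≤-trans (s≤s k≤j) j<k))) ⟩
        𝟙 (suc j * suc e ≤? n) * (suc e * 0)  ≡⟨ cong (𝟙 (suc j * suc e ≤? n) *_) (*-zeroʳ (suc e)) ⟩
        𝟙 (suc j * suc e ≤? n) * 0            ≡⟨ *-zeroʳ (𝟙 (suc j * suc e ≤? n)) ⟩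
        0                                     ∎
      n-to-k : ∑< n Ψ ≡ ∑< k Ψ
      n-to-k with ≤-total n k
      ... | inj₁ n≤k = sym (∑<-extend n k Ψ n≤k (λ j n≤j _ → Ψ-vanishes j (inj₁ n≤j)))
      ... | inj₂ k≤n = ∑<-extend k n Ψ k≤n (λ j k≤j _ → Ψ-vanishes j (inj₂ k≤j))

    spread : ∀ n k e → ∑[ j < k ] countTerm n k (suc e) j ≡
                       ∑[ j < suc k ] ∑[ m < n ] (𝟙 (suc m ≟ j * suc e) * (suc e * A (n ∸ suc m) (k ∸ j)))
    spread n k e = sym (cong₂ _+_ (∑<-zero n (λ m _ → cong (_* (suc e * A (n ∸ suc m) k)) (𝟙-no (suc m ≟ 0) λ ())))
                                  (∑<-cong k (λ j _ → ∑<-select n (e + j * suc e) (λ m → suc e * A (n ∸ m) (k ∸ suc j)))))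

    recurrence : Recurrence N β A
    recurrence n n≤N k = begin
      n * A n k
        ≡⟨ count-identity n n≤N k ⟩
      ∑[ e ∈ degs ] ∑[ j < n ] (𝟙 (suc j * e ≤? n) * (e * (𝟙 (suc j ≤? k) * A (n ∸ suc j * e) (k ∸ suc j))))
        ≡⟨ ∑-cong-All degs-positive (λ { (suc e) _ → trans (truncate n k e) (spread n k e) }) ⟩
      ∑[ e ∈ degs ] ∑[ j < suc k ] ∑[ m < n ] (𝟙 (suc m ≟ j * e) * (e * A (n ∸ suc m) (k ∸ j)))
        ≡⟨ ∑-∑<-comm degs (suc k) (λ e j → ∑[ m < n ] (𝟙 (suc m ≟ j * e) * (e * A (n ∸ suc m) (k ∸ j)))) ⟩
      ∑[ j < suc k ] ∑[ e ∈ degs ] ∑[ m < n ] (𝟙 (suc m ≟ j * e) * (e * A (n ∸ suc m) (k ∸ j)))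
        ≡⟨ ∑<-cong (suc k) (λ j _ → ∑-∑<-comm degs n (λ e m → 𝟙 (suc m ≟ j * e) * (e * A (n ∸ suc m) (k ∸ j)))) ⟩
      ∑[ j < suc k ] ∑[ m < n ] ∑[ e ∈ degs ] (𝟙 (suc m ≟ j * e) * (e * A (n ∸ suc m) (k ∸ j)))
        ≡⟨ ∑<-comm (suc k) n (λ j m → ∑[ e ∈ degs ] (𝟙 (suc m ≟ j * e) * (e * A (n ∸ suc m) (k ∸ j)))) ⟩
      ∑[ m < n ] ∑[ j < suc k ] ∑[ e ∈ degs ] (𝟙 (suc m ≟ j * e) * (e * A (n ∸ suc m) (k ∸ j)))
        ≡⟨ ∑<-cong n (λ m _ → ∑<-cong (suc k) (λ j _ →
             trans (∑-cong degs (λ e → sym (*-assoc (𝟙 (suc m ≟ j * e)) e (A (n ∸ suc m) (k ∸ j)))))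
                   (∑-distribʳ-* degs (A (n ∸ suc m) (k ∸ j)) (λ e → 𝟙 (suc m ≟ j * e) * e)))) ⟩
      ∑[ m < n ] ∑[ j < suc k ] (β (suc m) j * A (n ∸ suc m) (k ∸ j)) ∎


module PolynomialRing {q : ℕ} (F : FiniteField q) where
  open import Data.Nat using (zero; suc)

  open import Level using (0ℓ)
  open import Data.List as List using (List; []; _∷_; [_])
  open import Data.Vec using ([]; _∷_)
  open import Data.Product using (_×_; _,_)
  open import Relation.Binary.PropositionalEquality hiding ([_])
  open import Algebra.Bundles using (Ring)
  open import Algebra.Structures using (IsCommutativeRing)

  open FiniteField F public
  open Poly F public
  open IsCommutativeRing isCommutativeRing public
    using (+-assoc; +-comm; +-identityˡ; +-identityʳ; *-assoc; *-comm; *-identityˡ; *-identityʳ;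
           distribˡ; distribʳ; zeroˡ; zeroʳ; -‿inverseˡ; -‿inverseʳ; isRing)

  ring : Ring 0ℓ 0ℓ
  ring = record { isRing = isRing }

  open import Algebra.Properties.CommutativeSemigroup (Ring.+-commutativeSemigroup ring) using (interchange)
  open import Algebra.Properties.Ring ring
    using (-1*x≈-x)

  open ≡-Reasoning

  coef : Pol → ℕ → Carrier
  coef [] i = 0#
  coef (x ∷ p) zero = x
  coef (x ∷ p) (suc i) = coef p i

  infix 4 _≈_
  record _≈_ (p r : Pol) : Set where
    constructor ≈i
    field
      at : ∀ i → coef p i ≡ coef r i
  open _≈_ public

  ≈-refl : ∀ {p} → p ≈ p
  ≈-refl = ≈i (λ i → refl)

  ≈-sym : ∀ {p r} → p ≈ r → r ≈ p
  ≈-sym e = ≈i (λ i → sym (at e i))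

  ≈-trans : ∀ {p r s} → p ≈ r → r ≈ s → p ≈ s
  ≈-trans e f = ≈i (λ i → trans (at e i) (at f i))

  ≡⇒≈ : ∀ {p r} → p ≡ r → p ≈ r
  ≡⇒≈ refl = ≈-refl

  ∷-cong : ∀ {x y p r} → x ≡ y → p ≈ r → (x ∷ p) ≈ (y ∷ r)
  ∷-cong e f = ≈i pointwise
    where
    pointwise : ∀ i → _
    pointwise zero = e
    pointwise (suc i) = at f i

  ∷-inj : ∀ {x y p r} → (x ∷ p) ≈ (y ∷ r) → x ≡ y × p ≈ r
  ∷-inj e = at e zero , ≈i (λ i → at e (suc i))

  0∷-≈[] : ∀ {p} → p ≈ [] → (0# ∷ p) ≈ []
  0∷-≈[] e = ≈i pointwise
    where
    pointwise : ∀ i → _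
    pointwise zero = refl
    pointwise (suc i) = at e i

  ∷≈[]⁻¹ : ∀ {x p} → (x ∷ p) ≈ [] → x ≡ 0# × p ≈ []
  ∷≈[]⁻¹ e = at e zero , ≈i (λ i → at e (suc i))

  coef-+ : ∀ p r i → coef (p +ₚ r) i ≡ coef p i + coef r i
  coef-+ [] r i = sym (+-identityˡ _)
  coef-+ (x ∷ p) [] i = sym (+-identityʳ _)
  coef-+ (x ∷ p) (y ∷ r) zero = refl
  coef-+ (x ∷ p) (y ∷ r) (suc i) = coef-+ p r i

  +ₚ-cong : ∀ {p p' r r'} → p ≈ p' → r ≈ r' → (p +ₚ r) ≈ (p' +ₚ r')
  +ₚ-cong {p} {p'} {r} {r'} e f = ≈i λ i → begin
    coef (p +ₚ r) i ≡⟨ coef-+ p r i ⟩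
    coef p i + coef r i ≡⟨ cong₂ _+_ (at e i) (at f i) ⟩
    coef p' i + coef r' i ≡⟨ sym (coef-+ p' r' i) ⟩
    coef (p' +ₚ r') i ∎

  +ₚ-comm : ∀ p r → (p +ₚ r) ≈ (r +ₚ p)
  +ₚ-comm p r = ≈i λ i → trans (coef-+ p r i) (trans (+-comm _ _) (sym (coef-+ r p i)))

  +ₚ-assoc : ∀ p r s → ((p +ₚ r) +ₚ s) ≈ (p +ₚ (r +ₚ s))
  +ₚ-assoc p r s = ≈i λ i → begin
    coef ((p +ₚ r) +ₚ s) i ≡⟨ coef-+ (p +ₚ r) s i ⟩
    coef (p +ₚ r) i + coef s i ≡⟨ cong (_+ coef s i) (coef-+ p r i) ⟩
    coef p i + coef r i + coef s i ≡⟨ +-assoc _ _ _ ⟩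
    coef p i + (coef r i + coef s i) ≡⟨ cong (coef p i +_) (sym (coef-+ r s i)) ⟩
    coef p i + coef (r +ₚ s) i ≡⟨ sym (coef-+ p (r +ₚ s) i) ⟩
    coef (p +ₚ (r +ₚ s)) i ∎

  +ₚ-zeroʳ : ∀ p z → z ≈ [] → (p +ₚ z) ≈ p
  +ₚ-zeroʳ p z e = ≈i λ i → trans (coef-+ p z i) (trans (cong (coef p i +_) (at e i)) (+-identityʳ _))

  +ₚ-zeroˡ : ∀ p z → z ≈ [] → (z +ₚ p) ≈ p
  +ₚ-zeroˡ p z e = ≈-trans (+ₚ-comm z p) (+ₚ-zeroʳ p z e)

  scale : Carrier → Pol → Pol
  scale c = List.map (c *_)

  coef-scale : ∀ c p i → coef (scale c p) i ≡ c * coef p i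
  coef-scale c [] i = sym (zeroʳ c)
  coef-scale c (x ∷ p) zero = refl
  coef-scale c (x ∷ p) (suc i) = coef-scale c p i

  scale-cong : ∀ c {p r} → p ≈ r → scale c p ≈ scale c r
  scale-cong c {p} {r} e = ≈i λ i → trans (coef-scale c p i) (trans (cong (c *_) (at e i)) (sym (coef-scale c r i)))

  scale-0 : ∀ p → scale 0# p ≈ []
  scale-0 p = ≈i λ i → trans (coef-scale 0# p i) (zeroˡ _)

  scale-1 : ∀ p → scale 1# p ≈ p
  scale-1 p = ≈i λ i → trans (coef-scale 1# p i) (*-identityˡ _)

  scale-scale : ∀ c d p → scale c (scale d p) ≈ scale (c * d) p
  scale-scale c d p = ≈i λ i → begin
    coef (scale c (scale d p)) i ≡⟨ coef-scale c (scale d p) i ⟩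
    c * coef (scale d p) i ≡⟨ cong (c *_) (coef-scale d p i) ⟩
    c * (d * coef p i) ≡⟨ sym (*-assoc _ _ _) ⟩
    c * d * coef p i ≡⟨ sym (coef-scale (c * d) p i) ⟩
    coef (scale (c * d) p) i ∎

  scale-+ : ∀ c p r → scale c (p +ₚ r) ≈ (scale c p +ₚ scale c r)
  scale-+ c p r = ≈i λ i → begin
    coef (scale c (p +ₚ r)) i ≡⟨ coef-scale c (p +ₚ r) i ⟩
    c * coef (p +ₚ r) i ≡⟨ cong (c *_) (coef-+ p r i) ⟩
    c * (coef p i + coef r i) ≡⟨ distribˡ _ _ _ ⟩
    c * coef p i + c * coef r i ≡⟨ cong₂ _+_ (sym (coef-scale c p i)) (sym (coef-scale c r i)) ⟩
    coef (scale c p) i + coef (scale c r) i ≡⟨ sym (coef-+ (scale c p) (scale c r) i) ⟩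
    coef (scale c p +ₚ scale c r) i ∎

  scale-+ˡ : ∀ c d p → scale (c + d) p ≈ (scale c p +ₚ scale d p)
  scale-+ˡ c d p = ≈i λ i → begin
    coef (scale (c + d) p) i ≡⟨ coef-scale (c + d) p i ⟩
    (c + d) * coef p i ≡⟨ distribʳ _ _ _ ⟩
    c * coef p i + d * coef p i ≡⟨ cong₂ _+_ (sym (coef-scale c p i)) (sym (coef-scale d p i)) ⟩
    coef (scale c p) i + coef (scale d p) i ≡⟨ sym (coef-+ (scale c p) (scale d p) i) ⟩
    coef (scale c p +ₚ scale d p) i ∎

  negₚ : Pol → Pol
  negₚ = scale (- 1#)

  coef-neg : ∀ p i → coef (negₚ p) i ≡ - coef p i
  coef-neg p i = trans (coef-scale (- 1#) p i) (-1*x≈-x _)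

  +ₚ-negʳ : ∀ p → (p +ₚ negₚ p) ≈ []
  +ₚ-negʳ p = ≈i λ i → trans (coef-+ p (negₚ p) i) (trans (cong (coef p i +_) (coef-neg p i)) (-‿inverseʳ _))

  _-ₚ_ : Pol → Pol → Pol
  p -ₚ r = p +ₚ negₚ r

  -ₚ≈[]⇒≈ : ∀ p r → (p -ₚ r) ≈ [] → p ≈ r
  -ₚ≈[]⇒≈ p r e = ≈i λ i → begin
    coef p i ≡⟨ sym (+-identityʳ _) ⟩
    coef p i + 0# ≡⟨ cong (coef p i +_) (sym (-‿inverseˡ (coef r i))) ⟩
    coef p i + (- coef r i + coef r i) ≡⟨ sym (+-assoc _ _ _) ⟩
    coef p i + - coef r i + coef r i ≡⟨ cong (λ z → coef p i + z + coef r i) (sym (coef-neg r i)) ⟩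
    coef p i + coef (negₚ r) i + coef r i ≡⟨ cong (_+ coef r i) (sym (coef-+ p (negₚ r) i)) ⟩
    coef (p -ₚ r) i + coef r i ≡⟨ cong (_+ coef r i) (at e i) ⟩
    0# + coef r i ≡⟨ +-identityˡ _ ⟩
    coef r i ∎

  infixr 2 _≈⟨_⟩_
  infix 3 _∎≈
  _≈⟨_⟩_ : ∀ p {r s} → p ≈ r → r ≈ s → p ≈ s
  p ≈⟨ e ⟩ f = ≈-trans e f
  _∎≈ : ∀ p → p ≈ p
  p ∎≈ = ≈-refl

  +ₚ-congˡ : ∀ {p p'} r → p ≈ p' → (p +ₚ r) ≈ (p' +ₚ r)
  +ₚ-congˡ r e = +ₚ-cong e ≈-refl

  +ₚ-congʳ : ∀ p {r r'} → r ≈ r' → (p +ₚ r) ≈ (p +ₚ r')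
  +ₚ-congʳ p e = +ₚ-cong ≈-refl e

  +ₚ-interchange : ∀ a b c d → ((a +ₚ b) +ₚ (c +ₚ d)) ≈ ((a +ₚ c) +ₚ (b +ₚ d))
  +ₚ-interchange a b c d = ≈i λ i → begin
    coef ((a +ₚ b) +ₚ (c +ₚ d)) i
      ≡⟨ trans (coef-+ (a +ₚ b) (c +ₚ d) i) (cong₂ _+_ (coef-+ a b i) (coef-+ c d i)) ⟩
    (coef a i + coef b i) + (coef c i + coef d i)
      ≡⟨ interchange (coef a i) (coef b i) (coef c i) (coef d i) ⟩
    (coef a i + coef c i) + (coef b i + coef d i)
      ≡⟨ sym (trans (coef-+ (a +ₚ c) (b +ₚ d) i) (cong₂ _+_ (coef-+ a c i) (coef-+ b d i))) ⟩
    coef ((a +ₚ c) +ₚ (b +ₚ d)) i ∎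

  +ₚ-leftComm : ∀ a b c → (a +ₚ (b +ₚ c)) ≈ (b +ₚ (a +ₚ c))
  +ₚ-leftComm a b c = ≈-trans (≈-sym (+ₚ-assoc a b c)) (≈-trans (+ₚ-congˡ c (+ₚ-comm a b)) (+ₚ-assoc b a c))

  0∷-+ : ∀ a b → (0# ∷ (a +ₚ b)) ≈ ((0# ∷ a) +ₚ (0# ∷ b))
  0∷-+ a b = ∷-cong (sym (+-identityʳ 0#)) ≈-refl

  scale-0∷ : ∀ c a → scale c (0# ∷ a) ≈ (0# ∷ scale c a)
  scale-0∷ c a = ∷-cong (zeroʳ c) ≈-refl

  *ₚ-[]ʳ : ∀ p → (p *ₚ []) ≈ []
  *ₚ-[]ʳ [] = ≈-refl
  *ₚ-[]ʳ (x ∷ p) = 0∷-≈[] (*ₚ-[]ʳ p)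

  *ₚ-shiftˡ : ∀ p r → ((0# ∷ p) *ₚ r) ≈ (0# ∷ (p *ₚ r))
  *ₚ-shiftˡ p r = +ₚ-zeroˡ (0# ∷ (p *ₚ r)) (scale 0# r) (scale-0 r)

  *ₚ-≈[]ˡ : ∀ p r → p ≈ [] → (p *ₚ r) ≈ []
  *ₚ-≈[]ˡ [] r e = ≈-refl
  *ₚ-≈[]ˡ (x ∷ p) r e with ∷≈[]⁻¹ e
  ... | refl , e' = ≈-trans (*ₚ-shiftˡ p r) (0∷-≈[] (*ₚ-≈[]ˡ p r e'))

  *ₚ-congˡ : ∀ {p p'} r → p ≈ p' → (p *ₚ r) ≈ (p' *ₚ r)
  *ₚ-congˡ {[]} {p'} r e = ≈-sym (*ₚ-≈[]ˡ p' r (≈-sym e))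
  *ₚ-congˡ {x ∷ p} {[]} r e = *ₚ-≈[]ˡ (x ∷ p) r e
  *ₚ-congˡ {x ∷ p} {x' ∷ p'} r e with ∷-inj e
  ... | refl , e' = +ₚ-congʳ (scale x r) (∷-cong refl (*ₚ-congˡ r e'))

  *ₚ-congʳ : ∀ p {r r'} → r ≈ r' → (p *ₚ r) ≈ (p *ₚ r')
  *ₚ-congʳ [] e = ≈-refl
  *ₚ-congʳ (x ∷ p) e = +ₚ-cong (scale-cong x e) (∷-cong refl (*ₚ-congʳ p e))

  *ₚ-cong : ∀ {p p' r r'} → p ≈ p' → r ≈ r' → (p *ₚ r) ≈ (p' *ₚ r')
  *ₚ-cong {p} {p'} {r} {r'} e f = ≈-trans (*ₚ-congˡ r e) (*ₚ-congʳ p' f)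

  *ₚ-distribʳ-+ₚ : ∀ p p' r → ((p +ₚ p') *ₚ r) ≈ ((p *ₚ r) +ₚ (p' *ₚ r))
  *ₚ-distribʳ-+ₚ [] p' r = ≈-refl
  *ₚ-distribʳ-+ₚ (x ∷ p) [] r = ≈-sym (+ₚ-zeroʳ ((x ∷ p) *ₚ r) [] ≈-refl)
  *ₚ-distribʳ-+ₚ (x ∷ p) (y ∷ p') r =
    (scale (x + y) r +ₚ (0# ∷ ((p +ₚ p') *ₚ r)))
      ≈⟨ +ₚ-cong (scale-+ˡ x y r) (∷-cong refl (*ₚ-distribʳ-+ₚ p p' r)) ⟩
    ((scale x r +ₚ scale y r) +ₚ (0# ∷ ((p *ₚ r) +ₚ (p' *ₚ r))))
      ≈⟨ +ₚ-congʳ (scale x r +ₚ scale y r) (0∷-+ (p *ₚ r) (p' *ₚ r)) ⟩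
    ((scale x r +ₚ scale y r) +ₚ ((0# ∷ (p *ₚ r)) +ₚ (0# ∷ (p' *ₚ r))))
      ≈⟨ +ₚ-interchange (scale x r) (scale y r) (0# ∷ (p *ₚ r)) (0# ∷ (p' *ₚ r)) ⟩
    ((scale x r +ₚ (0# ∷ (p *ₚ r))) +ₚ (scale y r +ₚ (0# ∷ (p' *ₚ r)))) ∎≈

  *ₚ-distribˡ-+ₚ : ∀ p r r' → (p *ₚ (r +ₚ r')) ≈ ((p *ₚ r) +ₚ (p *ₚ r'))
  *ₚ-distribˡ-+ₚ [] r r' = ≈-refl
  *ₚ-distribˡ-+ₚ (x ∷ p) r r' =
    (scale x (r +ₚ r') +ₚ (0# ∷ (p *ₚ (r +ₚ r'))))
      ≈⟨ +ₚ-cong (scale-+ x r r') (∷-cong refl (*ₚ-distribˡ-+ₚ p r r')) ⟩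
    ((scale x r +ₚ scale x r') +ₚ (0# ∷ ((p *ₚ r) +ₚ (p *ₚ r'))))
      ≈⟨ +ₚ-congʳ (scale x r +ₚ scale x r') (0∷-+ (p *ₚ r) (p *ₚ r')) ⟩
    ((scale x r +ₚ scale x r') +ₚ ((0# ∷ (p *ₚ r)) +ₚ (0# ∷ (p *ₚ r'))))
      ≈⟨ +ₚ-interchange (scale x r) (scale x r') (0# ∷ (p *ₚ r)) (0# ∷ (p *ₚ r')) ⟩
    ((scale x r +ₚ (0# ∷ (p *ₚ r))) +ₚ (scale x r' +ₚ (0# ∷ (p *ₚ r')))) ∎≈

  *ₚ-scaleˡ : ∀ c p r → (scale c p *ₚ r) ≈ scale c (p *ₚ r)
  *ₚ-scaleˡ c [] r = ≈-refl
  *ₚ-scaleˡ c (x ∷ p) r =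
    (scale (c * x) r +ₚ (0# ∷ (scale c p *ₚ r)))
      ≈⟨ +ₚ-cong (≈-sym (scale-scale c x r)) (∷-cong refl (*ₚ-scaleˡ c p r)) ⟩
    (scale c (scale x r) +ₚ (0# ∷ scale c (p *ₚ r)))
      ≈⟨ +ₚ-congʳ (scale c (scale x r)) (≈-sym (scale-0∷ c (p *ₚ r))) ⟩
    (scale c (scale x r) +ₚ scale c (0# ∷ (p *ₚ r)))
      ≈⟨ ≈-sym (scale-+ c (scale x r) (0# ∷ (p *ₚ r))) ⟩
    scale c (scale x r +ₚ (0# ∷ (p *ₚ r))) ∎≈

  *ₚ-scaleʳ : ∀ c p r → (p *ₚ scale c r) ≈ scale c (p *ₚ r)
  *ₚ-scaleʳ c [] r = ≈-refl
  *ₚ-scaleʳ c (x ∷ p) r =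
    (scale x (scale c r) +ₚ (0# ∷ (p *ₚ scale c r)))
      ≈⟨ +ₚ-cong (≈-trans (scale-scale x c r) (≈-trans (≡⇒≈ (cong (λ z → scale z r) (*-comm x c))) (≈-sym (scale-scale c x r))))
                 (∷-cong refl (*ₚ-scaleʳ c p r)) ⟩
    (scale c (scale x r) +ₚ (0# ∷ scale c (p *ₚ r)))
      ≈⟨ +ₚ-congʳ (scale c (scale x r)) (≈-sym (scale-0∷ c (p *ₚ r))) ⟩
    (scale c (scale x r) +ₚ scale c (0# ∷ (p *ₚ r)))
      ≈⟨ ≈-sym (scale-+ c (scale x r) (0# ∷ (p *ₚ r))) ⟩
    scale c (scale x r +ₚ (0# ∷ (p *ₚ r))) ∎≈

  *ₚ-∷ʳ : ∀ p x r → (p *ₚ (x ∷ r)) ≈ (scale x p +ₚ (0# ∷ (p *ₚ r)))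
  *ₚ-∷ʳ [] x r = ≈-sym (0∷-≈[] ≈-refl)
  *ₚ-∷ʳ (y ∷ p) x r =
    ((y * x) ∷ scale y r) +ₚ (0# ∷ (p *ₚ (x ∷ r)))
      ≈⟨ ∷-cong (trans (+-identityʳ _) (trans (*-comm y x) (sym (+-identityʳ _))))
                (+ₚ-congʳ (scale y r) (*ₚ-∷ʳ p x r)) ⟩
    ((x * y + 0#) ∷ (scale y r +ₚ (scale x p +ₚ (0# ∷ (p *ₚ r)))))
      ≈⟨ ∷-cong refl (+ₚ-leftComm (scale y r) (scale x p) (0# ∷ (p *ₚ r))) ⟩
    ((x * y + 0#) ∷ (scale x p +ₚ (scale y r +ₚ (0# ∷ (p *ₚ r))))) ∎≈

  *ₚ-comm : ∀ p r → (p *ₚ r) ≈ (r *ₚ p)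
  *ₚ-comm [] r = ≈-sym (*ₚ-[]ʳ r)
  *ₚ-comm (x ∷ p) r =
    (scale x r +ₚ (0# ∷ (p *ₚ r)))
      ≈⟨ +ₚ-congʳ (scale x r) (∷-cong refl (*ₚ-comm p r)) ⟩
    (scale x r +ₚ (0# ∷ (r *ₚ p)))
      ≈⟨ ≈-sym (*ₚ-∷ʳ r x p) ⟩
    (r *ₚ (x ∷ p)) ∎≈

  *ₚ-assoc : ∀ p r s → ((p *ₚ r) *ₚ s) ≈ (p *ₚ (r *ₚ s))
  *ₚ-assoc [] r s = ≈-refl
  *ₚ-assoc (x ∷ p) r s =
    ((scale x r +ₚ (0# ∷ (p *ₚ r))) *ₚ s)
      ≈⟨ *ₚ-distribʳ-+ₚ (scale x r) (0# ∷ (p *ₚ r)) s ⟩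
    ((scale x r *ₚ s) +ₚ ((0# ∷ (p *ₚ r)) *ₚ s))
      ≈⟨ +ₚ-cong (*ₚ-scaleˡ x r s) (≈-trans (*ₚ-shiftˡ (p *ₚ r) s) (∷-cong refl (*ₚ-assoc p r s))) ⟩
    (scale x (r *ₚ s) +ₚ (0# ∷ (p *ₚ (r *ₚ s)))) ∎≈

  1ₚ : Pol
  1ₚ = [ 1# ]

  *ₚ-identityˡ : ∀ r → (1ₚ *ₚ r) ≈ r
  *ₚ-identityˡ r = ≈-trans (+ₚ-zeroʳ (scale 1# r) (0# ∷ []) (0∷-≈[] ≈-refl)) (scale-1 r)

  *ₚ-identityʳ : ∀ r → (r *ₚ 1ₚ) ≈ r
  *ₚ-identityʳ r = ≈-trans (*ₚ-comm r 1ₚ) (*ₚ-identityˡ r)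

  *ₚ-negˡ : ∀ p r → (negₚ p *ₚ r) ≈ negₚ (p *ₚ r)
  *ₚ-negˡ p r = *ₚ-scaleˡ (- 1#) p r

  *ₚ-distribʳ--ₚ : ∀ a b c → ((a -ₚ b) *ₚ c) ≈ ((a *ₚ c) -ₚ (b *ₚ c))
  *ₚ-distribʳ--ₚ a b c = ≈-trans (*ₚ-distribʳ-+ₚ a (negₚ b) c) (+ₚ-congʳ (a *ₚ c) (*ₚ-negˡ b c))


module MonicPolynomials {q : ℕ} (F : FiniteField q) where
  open import Data.Nat using (zero; suc; _≤_; _<_; z≤n; s≤s; _⊔_)

  open import Data.List as List using (List; []; _∷_; [_]; length)
  open import Data.List.Properties as LP using (length-map)
  open import Data.Vec using ([]; _∷_)
  open import Data.Product using (∃; ∃₂; _×_; _,_; proj₁; proj₂)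
  open import Data.Empty using (⊥-elim)
  open import Relation.Nullary using (¬_; Dec; yes; no)
  open import Relation.Binary.PropositionalEquality hiding ([_])
  open import Relation.Binary.Definitions using (tri<; tri≈; tri>)
  open import Function.Properties.Inverse using (↔⇒↣; ↔-sym)
  open import Relation.Binary.Definitions using (DecidableEquality)
  import Data.Fin.Properties as FinP
  open PolynomialRing F public

  open ≡-Reasoning

  _≟c_ : DecidableEquality Carrier
  _≟c_ = FinP.inj⇒≟ (↔⇒↣ (↔-sym enum))

  isZero? : (p : Pol) → Dec (p ≈ [])
  isZero? [] = yes ≈-refl
  isZero? (x ∷ p) with x ≟c 0# | isZero? p
  ... | yes refl | yes e = yes (0∷-≈[] e)
  ... | yes _ | no ne = no (λ e → ne (proj₂ (∷≈[]⁻¹ e)))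
  ... | no ne | _ = no (λ e → ne (proj₁ (∷≈[]⁻¹ e)))

  1≢0 : ¬ (1# ≡ 0#)
  1≢0 e = 0≢1 (sym e)

  inv : (c : Carrier) → ¬ (c ≡ 0#) → Carrier
  inv c nz = proj₁ (inverse c nz)

  inv-r : (c : Carrier) (nz : ¬ (c ≡ 0#)) → c * inv c nz ≡ 1#
  inv-r c nz = proj₂ (inverse c nz)

  coef-len : ∀ p i → length p ≤ i → coef p i ≡ 0#
  coef-len [] i _ = refl
  coef-len (x ∷ p) (suc i) (s≤s le) = coef-len p i le

  coef-0∷[] : ∀ i → coef (0# ∷ []) i ≡ 0#
  coef-0∷[] zero = refl
  coef-0∷[] (suc i) = refl

  len-toPol : ∀ {m} (a : Monic m) → length (toPol a) ≡ suc m
  len-toPol [] = refl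
  len-toPol (x ∷ a) = cong suc (len-toPol a)

  coef-toPol-top : ∀ {m} (a : Monic m) → coef (toPol a) m ≡ 1#
  coef-toPol-top [] = refl
  coef-toPol-top (x ∷ a) = coef-toPol-top a

  coef-toPol-high : ∀ {m} (a : Monic m) i → m < i → coef (toPol a) i ≡ 0#
  coef-toPol-high a i lt = coef-len (toPol a) i (subst (_≤ i) (sym (len-toPol a)) lt)

  len-+ : ∀ p r → length (p +ₚ r) ≡ length p ⊔ length r
  len-+ [] r = refl
  len-+ (x ∷ p) [] = refl
  len-+ (x ∷ p) (y ∷ r) = cong suc (len-+ p r)

  len-scale : ∀ c p → length (scale c p) ≡ length p
  len-scale c p = length-map (c *_) p

  len-mul : ∀ x p y r → length ((x ∷ p) *ₚ (y ∷ r)) ≡ suc (length p ℕ.+ length r)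
  len-mul x [] y r = cong suc (trans (len-+ (scale x r) []) (trans (ℕP.⊔-identityʳ _) (len-scale x r)))
  len-mul x (x' ∷ p) y r = cong suc (begin
    length (scale x r +ₚ ((x' ∷ p) *ₚ (y ∷ r))) ≡⟨ len-+ (scale x r) ((x' ∷ p) *ₚ (y ∷ r)) ⟩
    length (scale x r) ⊔ length ((x' ∷ p) *ₚ (y ∷ r)) ≡⟨ cong₂ _⊔_ (len-scale x r) (len-mul x' p y r) ⟩
    length r ⊔ suc (length p ℕ.+ length r) ≡⟨ ℕP.m≤n⇒m⊔n≡n (ℕP.m≤n⇒m≤1+n (ℕP.m≤n+m (length r) (length p))) ⟩
    suc (length p ℕ.+ length r) ∎)

  top-mul : ∀ x p y r → coef ((x ∷ p) *ₚ (y ∷ r)) (length p ℕ.+ length r) ≡ coef (x ∷ p) (length p) * coef (y ∷ r) (length r)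
  top-mul x [] y r = begin
    coef (scale x (y ∷ r) +ₚ (0# ∷ [])) (length r) ≡⟨ coef-+ (scale x (y ∷ r)) (0# ∷ []) (length r) ⟩
    coef (scale x (y ∷ r)) (length r) + coef (0# ∷ []) (length r) ≡⟨ cong₂ _+_ (coef-scale x (y ∷ r) (length r)) (coef-0∷[] (length r)) ⟩
    x * coef (y ∷ r) (length r) + 0# ≡⟨ +-identityʳ _ ⟩
    x * coef (y ∷ r) (length r) ∎
  top-mul x (x' ∷ p) y r = begin
    coef (scale x (y ∷ r) +ₚ (0# ∷ ((x' ∷ p) *ₚ (y ∷ r)))) (suc (length p ℕ.+ length r))
      ≡⟨ coef-+ (scale x (y ∷ r)) (0# ∷ ((x' ∷ p) *ₚ (y ∷ r))) (suc (length p ℕ.+ length r)) ⟩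
    coef (scale x (y ∷ r)) (suc (length p ℕ.+ length r)) + coef ((x' ∷ p) *ₚ (y ∷ r)) (length p ℕ.+ length r)
      ≡⟨ cong₂ _+_ (trans (coef-scale x (y ∷ r) (suc (length p ℕ.+ length r)))
                          (trans (cong (x *_) (coef-len r (length p ℕ.+ length r) (ℕP.m≤n+m (length r) (length p)))) (zeroʳ x)))
                   (top-mul x' p y r) ⟩
    0# + coef (x' ∷ p) (length p) * coef (y ∷ r) (length r) ≡⟨ +-identityˡ _ ⟩
    coef (x' ∷ p) (length p) * coef (y ∷ r) (length r) ∎

  toMonic : ∀ N l → length l ≡ suc N → coef l N ≡ 1# → ∃ λ (v : Monic N) → l ≡ toPol v
  toMonic zero (x ∷ []) refl refl = [] , refl
  toMonic (suc N) (x ∷ l) e c with toMonic N l (ℕP.suc-injective e) c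
  ... | v , refl = (x ∷ v) , refl

  toPol-split : ∀ {m} (a : Monic m) → ∃₂ λ x p → toPol a ≡ x ∷ p × length p ≡ m
  toPol-split [] = 1# , [] , refl , refl
  toPol-split (y ∷ a) = y , toPol a , refl , len-toPol a

  opaque
    monic-mul : ∀ {m k} (a : Monic m) (b : Monic k) → ∃ λ (v : Monic (m ℕ.+ k)) → toPol a *ₚ toPol b ≡ toPol v
    monic-mul {m} {k} a b with toPol-split a | toPol-split b
    ... | x , p , ea , la | y , r , eb , lb = toMonic (m ℕ.+ k) (toPol a *ₚ toPol b) L C
      where
      L : length (toPol a *ₚ toPol b) ≡ suc (m ℕ.+ k)
      L = begin
        length (toPol a *ₚ toPol b) ≡⟨ cong₂ (λ u w → length (u *ₚ w)) ea eb ⟩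
        length ((x ∷ p) *ₚ (y ∷ r)) ≡⟨ len-mul x p y r ⟩
        suc (length p ℕ.+ length r) ≡⟨ cong₂ (λ u w → suc (u ℕ.+ w)) la lb ⟩
        suc (m ℕ.+ k) ∎
      C : coef (toPol a *ₚ toPol b) (m ℕ.+ k) ≡ 1#
      C = begin
        coef (toPol a *ₚ toPol b) (m ℕ.+ k) ≡⟨ cong₂ (λ u w → coef (u *ₚ w) (m ℕ.+ k)) ea eb ⟩
        coef ((x ∷ p) *ₚ (y ∷ r)) (m ℕ.+ k) ≡⟨ cong₂ (λ u w → coef ((x ∷ p) *ₚ (y ∷ r)) (u ℕ.+ w)) (sym la) (sym lb) ⟩
        coef ((x ∷ p) *ₚ (y ∷ r)) (length p ℕ.+ length r) ≡⟨ top-mul x p y r ⟩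
        coef (x ∷ p) (length p) * coef (y ∷ r) (length r) ≡⟨ cong₂ (λ u w → coef u (length p) * coef w (length r)) (sym ea) (sym eb) ⟩
        coef (toPol a) (length p) * coef (toPol b) (length r) ≡⟨ cong₂ (λ u w → coef (toPol a) u * coef (toPol b) w) la lb ⟩
        coef (toPol a) m * coef (toPol b) k ≡⟨ cong₂ _*_ (coef-toPol-top a) (coef-toPol-top b) ⟩
        1# * 1# ≡⟨ *-identityˡ _ ⟩
        1# ∎

  ≈⇒≡-len : ∀ p r → length p ≡ length r → p ≈ r → p ≡ r
  ≈⇒≡-len [] [] _ _ = refl
  ≈⇒≡-len (x ∷ p) (y ∷ r) l e = cong₂ _∷_ (at e zero) (≈⇒≡-len p r (ℕP.suc-injective l) (≈i λ i → at e (suc i)))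

  toPol-inj : ∀ {m} (a b : Monic m) → toPol a ≡ toPol b → a ≡ b
  toPol-inj [] [] _ = refl
  toPol-inj (x ∷ a) (y ∷ b) e with LP.∷-injective e
  ... | refl , e' = cong (x ∷_) (toPol-inj a b e')

  scale-monic≈monic : ∀ {m n} (a : Monic m) (b : Monic n) c → scale c (toPol a) ≈ toPol b →
              c ≡ 1# × _≡_ {A = MonicPoly} (m , a) (n , b)
  scale-monic≈monic {m} {n} a b c e with ℕP.<-cmp m n
  ... | tri< lt _ _ = ⊥-elim (0≢1 (begin
          0# ≡⟨ sym (zeroʳ c) ⟩
          c * 0# ≡⟨ cong (c *_) (sym (coef-toPol-high a n lt)) ⟩
          c * coef (toPol a) n ≡⟨ sym (coef-scale c (toPol a) n) ⟩
          coef (scale c (toPol a)) n ≡⟨ at e n ⟩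
          coef (toPol b) n ≡⟨ coef-toPol-top b ⟩
          1# ∎))
  ... | tri> _ _ gt = ⊥-elim (0≢1 (begin
          0# ≡⟨ sym (zeroˡ _) ⟩
          0# * coef (toPol a) n ≡⟨ cong (_* coef (toPol a) n) (sym c≡0) ⟩
          c * coef (toPol a) n ≡⟨ sym (coef-scale c (toPol a) n) ⟩
          coef (scale c (toPol a)) n ≡⟨ at e n ⟩
          coef (toPol b) n ≡⟨ coef-toPol-top b ⟩
          1# ∎))
    where
    c≡0 : c ≡ 0#
    c≡0 = begin
      c ≡⟨ sym (*-identityʳ c) ⟩
      c * 1# ≡⟨ cong (c *_) (sym (coef-toPol-top a)) ⟩
      c * coef (toPol a) m ≡⟨ sym (coef-scale c (toPol a) m) ⟩
      coef (scale c (toPol a)) m ≡⟨ at e m ⟩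
      coef (toPol b) m ≡⟨ coef-toPol-high b m gt ⟩
      0# ∎
  ... | tri≈ _ refl _ = c≡1 , cong (m ,_) (toPol-inj a b (≈⇒≡-len (toPol a) (toPol b) (trans (len-toPol a) (sym (len-toPol b))) e'))
    where
    c≡1 : c ≡ 1#
    c≡1 = begin
      c ≡⟨ sym (*-identityʳ c) ⟩
      c * 1# ≡⟨ cong (c *_) (sym (coef-toPol-top a)) ⟩
      c * coef (toPol a) m ≡⟨ sym (coef-scale c (toPol a) m) ⟩
      coef (scale c (toPol a)) m ≡⟨ at e m ⟩
      coef (toPol b) m ≡⟨ coef-toPol-top b ⟩
      1# ∎
    e' : toPol a ≈ toPol b
    e' = ≈-trans (≈-sym (≈-trans (≡⇒≈ (cong (λ z → scale z (toPol a)) c≡1)) (scale-1 (toPol a)))) e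

  toPol≉0 : ∀ {m} (a : Monic m) → ¬ (toPol a ≈ [])
  toPol≉0 {m} a e = 1≢0 (trans (sym (coef-toPol-top a)) (at e m))

  record MonicMultiple (p : Pol) : Set where
    constructor monicMultiple
    field
      deg : ℕ
      mon : Monic deg
      lc : Carrier
      lc≢0 : ¬ (lc ≡ 0#)
      eqv : p ≈ scale lc (toPol mon)
      len : suc deg ≤ length p

  normalize : ∀ p → ¬ (p ≈ []) → MonicMultiple p
  normalize [] ne = ⊥-elim (ne ≈-refl)
  normalize (x ∷ p) ne with isZero? p
  ... | yes z = monicMultiple 0 [] x x≢0 (∷-cong (sym (*-identityʳ x)) z) (s≤s z≤n)
    where
    x≢0 : ¬ (x ≡ 0#)
    x≢0 refl = ne (0∷-≈[] z)
  ... | no nz with normalize p nz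
  ... | monicMultiple d a c c≢0 e l = monicMultiple (suc d) ((x * inv c c≢0) ∷ a) c c≢0 (∷-cong eqx e) (s≤s l)
    where
    eqx : x ≡ c * (x * inv c c≢0)
    eqx = begin
      x ≡⟨ sym (*-identityʳ x) ⟩
      x * 1# ≡⟨ cong (x *_) (sym (inv-r c c≢0)) ⟩
      x * (c * inv c c≢0) ≡⟨ sym (*-assoc _ _ _) ⟩
      x * c * inv c c≢0 ≡⟨ cong (_* inv c c≢0) (*-comm x c) ⟩
      c * x * inv c c≢0 ≡⟨ *-assoc _ _ _ ⟩
      c * (x * inv c c≢0) ∎


module MonicDivisibility {q : ℕ} (F : FiniteField q) where
  open import Data.Nat using (zero; suc)

  open import Data.List using ([]; _∷_; [_]; length)
  open import Data.Vec as Vec using (Vec; []; _∷_)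
  open import Data.Product using (∃₂; _,_; proj₂)
  open import Data.Empty using (⊥-elim)
  open import Relation.Nullary using (yes; no)
  open import Relation.Binary.PropositionalEquality hiding ([_])
  open MonicPolynomials F public

  open ≡-Reasoning

  *ₚ-negʳ : ∀ p r → (p *ₚ negₚ r) ≈ negₚ (p *ₚ r)
  *ₚ-negʳ p r = *ₚ-scaleʳ (- 1#) p r

  -ₚ-self : ∀ {x y} → x ≈ y → (x -ₚ y) ≈ []
  -ₚ-self {x} {y} e = ≈-trans (+ₚ-congˡ (negₚ y) e) (+ₚ-negʳ y)

  *ₚ-distribˡ--ₚ : ∀ a s s' → (a *ₚ (s -ₚ s')) ≈ ((a *ₚ s) -ₚ (a *ₚ s'))
  *ₚ-distribˡ--ₚ a s s' = ≈-trans (*ₚ-distribˡ-+ₚ a s (negₚ s')) (+ₚ-congʳ (a *ₚ s) (*ₚ-negʳ a s'))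

  *ₚ-cancelˡ-[] : ∀ {m} (a : Monic m) s → (toPol a *ₚ s) ≈ [] → s ≈ []
  *ₚ-cancelˡ-[] {m} a s e with isZero? s
  ... | yes z = z
  ... | no nz with normalize s nz
  ... | monicMultiple k b c c≢0 es _ with monic-mul a b
  ... | v , ev = ⊥-elim (c≢0 (begin
      c ≡⟨ sym (*-identityʳ c) ⟩
      c * 1# ≡⟨ cong (c *_) (sym (coef-toPol-top v)) ⟩
      c * coef (toPol v) (m ℕ.+ k) ≡⟨ sym (coef-scale c (toPol v) (m ℕ.+ k)) ⟩
      coef (scale c (toPol v)) (m ℕ.+ k) ≡⟨ sym (at E (m ℕ.+ k)) ⟩
      coef (toPol a *ₚ s) (m ℕ.+ k) ≡⟨ at e (m ℕ.+ k) ⟩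
      0# ∎))
    where
    E : (toPol a *ₚ s) ≈ scale c (toPol v)
    E = ≈-trans (*ₚ-congʳ (toPol a) es) (≈-trans (*ₚ-scaleʳ c (toPol a) (toPol b)) (scale-cong c (≡⇒≈ ev)))

  *ₚ-cancelˡ : ∀ {m} (a : Monic m) s s' → (toPol a *ₚ s) ≈ (toPol a *ₚ s') → s ≈ s'
  *ₚ-cancelˡ a s s' e = -ₚ≈[]⇒≈ s s' (*ₚ-cancelˡ-[] a (s -ₚ s') (≈-trans (*ₚ-distribˡ--ₚ (toPol a) s s') (-ₚ-self e)))

  leading : ∀ {A : Set} {n} → Vec A (suc n) → A
  leading (x ∷ []) = x
  leading (x ∷ y ∷ v) = leading (y ∷ v)

  reduceTop : ∀ {e} → Vec Carrier (suc e) → Monic e → Vec Carrier e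
  reduceTop (u ∷ []) [] = []
  reduceTop (u ∷ u' ∷ v) (w ∷ b) = (u + - (leading (u' ∷ v) * w)) ∷ reduceTop (u' ∷ v) b

  reduceTop-≈ : ∀ {e} (v : Vec Carrier (suc e)) (b : Monic e) →
           Vec.toList v ≈ (scale (leading v) (toPol b) +ₚ Vec.toList (reduceTop v b))
  reduceTop-≈ (u ∷ []) [] = ∷-cong (sym (*-identityʳ u)) ≈-refl
  reduceTop-≈ (u ∷ u' ∷ v) (w ∷ b) = ∷-cong hd (reduceTop-≈ (u' ∷ v) b)
    where
    c : Carrier
    c = leading (u' ∷ v)
    hd : u ≡ c * w + (u + - (c * w))
    hd = begin
      u ≡⟨ sym (+-identityˡ u) ⟩
      0# + u ≡⟨ cong (_+ u) (sym (-‿inverseʳ (c * w))) ⟩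
      (c * w + - (c * w)) + u ≡⟨ +-assoc _ _ _ ⟩
      c * w + (- (c * w) + u) ≡⟨ cong (c * w +_) (+-comm _ _) ⟩
      c * w + (u + - (c * w)) ∎

  replicate-0#≈[] : ∀ e → Vec.toList (Vec.replicate e 0#) ≈ []
  replicate-0#≈[] zero = ≈-refl
  replicate-0#≈[] (suc e) = 0∷-≈[] (replicate-0#≈[] e)

  record DivisionResult {e} (b : Monic e) (p : Pol) : Set where
    constructor divisionResult
    field
      quo : Pol
      rem : Vec Carrier e
      deq : p ≈ ((toPol b *ₚ quo) +ₚ Vec.toList rem)

  divMod : ∀ {e} (b : Monic e) (p : Pol) → DivisionResult b p
  divMod {e} b [] = divisionResult [] (Vec.replicate e 0#)
    (≈-sym (≈-trans (+ₚ-zeroˡ (Vec.toList (Vec.replicate e 0#)) (toPol b *ₚ []) (*ₚ-[]ʳ (toPol b))) (replicate-0#≈[] e)))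
  divMod {e} b (x ∷ p) with divMod b p
  ... | divisionResult s' r' e' = divisionResult (c ∷ s') (reduceTop v b) E
    where
    v : Vec Carrier (suc e)
    v = x ∷ r'
    c : Carrier
    c = leading v
    B : Pol
    B = toPol b
    R : Pol
    R = Vec.toList (reduceTop v b)
    E : (x ∷ p) ≈ ((B *ₚ (c ∷ s')) +ₚ R)
    E = (x ∷ p)
          ≈⟨ ∷-cong (sym (+-identityˡ x)) e' ⟩
        ((0# ∷ (B *ₚ s')) +ₚ Vec.toList v)
          ≈⟨ +ₚ-congʳ (0# ∷ (B *ₚ s')) (reduceTop-≈ v b) ⟩
        ((0# ∷ (B *ₚ s')) +ₚ (scale c B +ₚ R))
          ≈⟨ ≈-sym (+ₚ-assoc (0# ∷ (B *ₚ s')) (scale c B) R) ⟩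
        (((0# ∷ (B *ₚ s')) +ₚ scale c B) +ₚ R)
          ≈⟨ +ₚ-congˡ R (+ₚ-comm (0# ∷ (B *ₚ s')) (scale c B)) ⟩
        ((scale c B +ₚ (0# ∷ (B *ₚ s'))) +ₚ R)
          ≈⟨ +ₚ-congˡ R (≈-sym (*ₚ-∷ʳ B c s')) ⟩
        ((B *ₚ (c ∷ s')) +ₚ R) ∎≈

  record Divides {m} (a : Monic m) (g : Pol) : Set where
    constructor _,_
    field
      dquo : Pol
      dprf : (toPol a *ₚ dquo) ≈ g

  Divides-≈ : ∀ {m} {a : Monic m} {g g'} → Divides a g → g ≈ g' → Divides a g'
  Divides-≈ (s , e) e' = s , ≈-trans e e'

  Divides-+ : ∀ {m} {a : Monic m} {g h} → Divides a g → Divides a h → Divides a (g +ₚ h)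
  Divides-+ {a = a} (s , e) (s' , e') = (s +ₚ s') , ≈-trans (*ₚ-distribˡ-+ₚ (toPol a) s s') (+ₚ-cong e e')

  Divides-scale : ∀ {m} {a : Monic m} {g} c → Divides a g → Divides a (scale c g)
  Divides-scale {a = a} c (s , e) = scale c s , ≈-trans (*ₚ-scaleʳ c (toPol a) s) (scale-cong c e)

  Divides-*ʳ : ∀ {m} {a : Monic m} {g} h → Divides a g → Divides a (g *ₚ h)
  Divides-*ʳ {a = a} h (s , e) = (s *ₚ h) , ≈-trans (≈-sym (*ₚ-assoc (toPol a) s h)) (*ₚ-congˡ h e)

  Divides-*ˡ : ∀ {m} {a : Monic m} {h} g → Divides a h → Divides a (g *ₚ h)
  Divides-*ˡ {h = h} g d = Divides-≈ (Divides-*ʳ g d) (*ₚ-comm h g)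

  Divides-self : ∀ {m} (a : Monic m) h → Divides a (toPol a *ₚ h)
  Divides-self a h = h , ≈-refl

  Divides-- : ∀ {m} {a : Monic m} {g h} → Divides a g → Divides a h → Divides a (g -ₚ h)
  Divides-- degree dh = Divides-+ degree (Divides-scale (- 1#) dh)

  monic-cofactor : ∀ {m n} (a : Monic m) (p : Monic n) → Divides a (toPol p) →
            ∃₂ λ k (b : Monic k) → toPol a *ₚ toPol b ≡ toPol p
  monic-cofactor {m} {n} a p (s , e) with isZero? s
  ... | yes z = ⊥-elim (toPol≉0 p (≈-trans (≈-sym e) (≈-trans (*ₚ-congʳ (toPol a) z) (*ₚ-[]ʳ (toPol a)))))
  ... | no nz with normalize s nz
  ... | monicMultiple k b c c≢0 es _ with monic-mul a b
  ... | v , ev with scale-monic≈monic v p c E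
    where
    E : scale c (toPol v) ≈ toPol p
    E = ≈-trans (≈-sym (≈-trans (*ₚ-congʳ (toPol a) es) (≈-trans (*ₚ-scaleʳ c (toPol a) (toPol b)) (scale-cong c (≡⇒≈ ev))))) e
  ... | _ , epair = k , b , trans ev (cong (λ z → toPol (proj₂ z)) epair)

  degree-* : ∀ {m k n} (a : Monic m) (b : Monic k) (p : Monic n) → toPol a *ₚ toPol b ≡ toPol p → m ℕ.+ k ≡ n
  degree-* {m} {k} {n} a b p e with monic-mul a b
  ... | v , ev = ℕP.suc-injective (trans (sym (len-toPol v)) (trans (cong length (trans (sym ev) e)) (len-toPol p)))


module UniqueFactorisation {q : ℕ} (F : FiniteField q) where
  open import Data.Nat using (zero; suc; _≤_; _<_; z≤n; s≤s)

  open import Data.List as List using (List; []; _∷_; _++_; [_]; length)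
  open import Data.Vec as Vec using (Vec; []; _∷_)
  import Data.Vec.Properties as VP
  open import Data.Product using (_,_; proj₁; proj₂)
  open import Data.Sum using (_⊎_; inj₁; inj₂)
  open import Data.Empty using (⊥; ⊥-elim)
  open import Relation.Nullary using (¬_; yes; no)
  open import Relation.Binary.PropositionalEquality hiding ([_])
  open import Data.List.Relation.Unary.All as All using (All; []; _∷_)
  import Data.List.Relation.Unary.All.Properties as AllP
  open import Data.List.Relation.Unary.Any using (here; there)
  open import Data.List.Membership.Propositional using (_∈_)
  open import Data.List.Membership.Propositional.Properties using (∈-∃++)
  open import Data.List.Relation.Binary.Permutation.Propositional as Perm using (_↭_; ↭-sym; ↭-trans; prep)
  open import Data.List.Relation.Binary.Permutation.Propositional.Properties using (shift)
  open MonicDivisibility F public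

  open ≡-Reasoning

  +ₚ⇒-ₚ : ∀ {X Y Z} → X ≈ (Y +ₚ Z) → Z ≈ (X -ₚ Y)
  +ₚ⇒-ₚ {X} {Y} {Z} e = ≈i λ i → begin
    coef Z i ≡⟨ sym (+-identityˡ _) ⟩
    0# + coef Z i ≡⟨ cong (_+ coef Z i) (sym (-‿inverseʳ (coef Y i))) ⟩
    (coef Y i + - coef Y i) + coef Z i ≡⟨ +-assoc _ _ _ ⟩
    coef Y i + (- coef Y i + coef Z i) ≡⟨ cong (coef Y i +_) (+-comm _ _) ⟩
    coef Y i + (coef Z i + - coef Y i) ≡⟨ sym (+-assoc _ _ _) ⟩
    (coef Y i + coef Z i) + - coef Y i ≡⟨ cong₂ _+_ (sym (coef-+ Y Z i)) (sym (coef-neg Y i)) ⟩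
    coef (Y +ₚ Z) i + coef (negₚ Y) i ≡⟨ cong (_+ coef (negₚ Y) i) (sym (at e i)) ⟩
    coef X i + coef (negₚ Y) i ≡⟨ sym (coef-+ X (negₚ Y) i) ⟩
    coef (X -ₚ Y) i ∎

  scale-inverse : ∀ c (nz : ¬ (c ≡ 0#)) p → scale (inv c nz) (scale c p) ≈ p
  scale-inverse c nz p = ≈-trans (scale-scale (inv c nz) c p)
    (≈-trans (≡⇒≈ (cong (λ z → scale z p) (trans (*-comm _ _) (inv-r c nz)))) (scale-1 p))

  module EuclidsLemma {d} (π : Monic d) (irr : Irreducible π) where

    1≤d : 1 ≤ d
    1≤d = proj₁ irr

    no-proper-divisor : ∀ {e} (a : Monic e) → 1 ≤ e → e < d → Divides a (toPol π) → ⊥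
    no-proper-divisor {e} a 1≤e e<d dv with monic-cofactor a π dv
    ... | k , b , eq with proj₂ irr a b eq
    ... | inj₁ refl = ℕP.<-irrefl refl 1≤e
    ... | inj₂ refl = ℕP.<-irrefl (trans (sym (ℕP.+-identityʳ e)) (degree-* a b π eq)) e<d

    euclid-by-degree : ∀ n (r : Pol) → length r ≤ n → n ≤ d → ∀ h → Divides π (r *ₚ h) → r ≈ [] ⊎ Divides π h
    euclid-by-degree zero [] _ _ h _ = inj₁ ≈-refl
    euclid-by-degree (suc n) r lr nd h dv with isZero? r
    ... | yes z = inj₁ z
    ... | no nz with normalize r nz
    ... | monicMultiple e a c c≢0 er le = by-monic-part e a er le
      where
      π∣monic-part*h : ∀ {e'} (a : Monic e') → r ≈ scale c (toPol a) → Divides π (toPol a *ₚ h)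
      π∣monic-part*h a er = Divides-≈ (Divides-scale (inv c c≢0) dv)
                (≈-trans (scale-cong (inv c c≢0) (≈-trans (*ₚ-congˡ h er) (*ₚ-scaleˡ c (toPol a) h)))
                         (scale-inverse c c≢0 (toPol a *ₚ h)))
      by-monic-part : ∀ e' (a : Monic e') → r ≈ scale c (toPol a) → suc e' ≤ length r → r ≈ [] ⊎ Divides π h
      by-monic-part zero [] er le = inj₂ (Divides-≈ (π∣monic-part*h [] er) (*ₚ-identityˡ h))
      by-monic-part (suc e'') a' er le with divMod a' (toPol π)
      ... | divisionResult s ρ eq with isZero? (Vec.toList ρ)
      ... | yes z = ⊥-elim (no-proper-divisor a' (s≤s z≤n) e<d
                      (s , ≈-sym (≈-trans eq (+ₚ-zeroʳ (toPol a' *ₚ s) (Vec.toList ρ) z))))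
        where
        e<d : suc e'' < d
        e<d = ℕP.<-≤-trans (s≤s (ℕP.≤-pred (ℕP.≤-trans le lr))) nd
      ... | no nzρ with euclid-by-degree n (Vec.toList ρ) (subst (_≤ n) (sym (VP.length-toList ρ)) (ℕP.≤-pred (ℕP.≤-trans le lr)))
                                         (ℕP.≤-trans (ℕP.n≤1+n n) nd) h dvρ
        where
        dva' : Divides π (toPol a' *ₚ h)
        dva' = π∣monic-part*h a' er
        dvρ : Divides π (Vec.toList ρ *ₚ h)
        dvρ = Divides-≈ (Divides-- (Divides-self π h)
                                   (Divides-≈ (Divides-*ˡ s dva') (≈-trans (≈-sym (*ₚ-assoc s (toPol a') h)) (*ₚ-congˡ h (*ₚ-comm s (toPol a'))))))
                   (≈-sym (≈-trans (*ₚ-congˡ h (+ₚ⇒-ₚ eq)) (*ₚ-distribʳ--ₚ (toPol π) (toPol a' *ₚ s) h)))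
      ... | inj₁ z = ⊥-elim (nzρ z)
      ... | inj₂ dh = inj₂ dh

    euclid : ∀ g h → Divides π (g *ₚ h) → Divides π g ⊎ Divides π h
    euclid g h dv with divMod π g
    ... | divisionResult s ρ eq with euclid-by-degree d (Vec.toList ρ) (ℕP.≤-reflexive (VP.length-toList ρ)) ℕP.≤-refl h dvρ
      where
      dvρ : Divides π (Vec.toList ρ *ₚ h)
      dvρ = Divides-≈ (Divides-- dv (Divides-≈ (Divides-self π (s *ₚ h)) (≈-sym (*ₚ-assoc (toPol π) s h))))
                 (≈-sym (≈-trans (*ₚ-congˡ h (+ₚ⇒-ₚ eq)) (*ₚ-distribʳ--ₚ g (toPol π *ₚ s) h)))
    ... | inj₁ z = inj₁ (s , ≈-sym (≈-trans eq (+ₚ-zeroʳ (toPol π *ₚ s) (Vec.toList ρ) z)))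
    ... | inj₂ dh = inj₂ dh

    irreducible∣irreducible : ∀ {k} (g : Monic k) → Irreducible g → Divides π (toPol g) → _≡_ {A = MonicPoly} (d , π) (k , g)
    irreducible∣irreducible {k} g irrg dv with monic-cofactor π g dv
    ... | k' , b , eq with proj₂ irrg π b eq
    ... | inj₁ d≡0 = ⊥-elim (ℕP.<-irrefl (sym d≡0) 1≤d)
    ... | inj₂ refl with b
    ... | [] = proj₂ (scale-monic≈monic π g 1# (≈-trans (scale-1 (toPol π)) (≈-trans (≈-sym (*ₚ-identityʳ (toPol π))) (≡⇒≈ eq))))

    ∣prodMP⇒∈ : ∀ gs → All IrreducibleMP gs → Divides π (prodMP gs) → (d , π) ∈ gs
    ∣prodMP⇒∈ [] _ dv with monic-cofactor π [] dv
    ... | k , b , eq = ⊥-elim (ℕP.<-irrefl (sym (ℕP.m+n≡0⇒m≡0 d (degree-* π b [] eq))) 1≤d)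
    ∣prodMP⇒∈ ((k , g) ∷ gs) (ig ∷ igs) dv with euclid (toPol g) (prodMP gs) dv
    ... | inj₁ π∣g  = here (irreducible∣irreducible g ig π∣g)
    ... | inj₂ π∣gs = there (∣prodMP⇒∈ gs igs π∣gs)

  prodMP-↭ : ∀ {fs gs} → fs ↭ gs → prodMP fs ≈ prodMP gs
  prodMP-↭ Perm.refl = ≈-refl
  prodMP-↭ (Perm.prep (_ , a) p) = *ₚ-congʳ (toPol a) (prodMP-↭ p)
  prodMP-↭ (Perm.swap {xs} {ys} (_ , a) (_ , b) p) =
    ≈-trans (≈-sym (*ₚ-assoc (toPol a) (toPol b) (prodMP xs)))
    (≈-trans (*ₚ-congˡ (prodMP xs) (*ₚ-comm (toPol a) (toPol b)))
    (≈-trans (*ₚ-assoc (toPol b) (toPol a) (prodMP xs))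
    (*ₚ-congʳ (toPol b) (*ₚ-congʳ (toPol a) (prodMP-↭ p)))))
  prodMP-↭ (Perm.trans p p') = ≈-trans (prodMP-↭ p) (prodMP-↭ p')

  prodMP-++ : ∀ fs gs → prodMP (fs ++ gs) ≈ (prodMP fs *ₚ prodMP gs)
  prodMP-++ [] gs = ≈-sym (*ₚ-identityˡ (prodMP gs))
  prodMP-++ ((_ , a) ∷ fs) gs = ≈-trans (*ₚ-congʳ (toPol a) (prodMP-++ fs gs)) (≈-sym (*ₚ-assoc (toPol a) (prodMP fs) (prodMP gs)))

  ¬∣1ₚ : ∀ {d} (π : Monic d) → 1 ≤ d → Divides π (prodMP []) → ⊥
  ¬∣1ₚ π 1≤d dv with monic-cofactor π [] dv
  ... | k , b , eq = ℕP.<-irrefl (sym (ℕP.m+n≡0⇒m≡0 _ (degree-* π b [] eq))) 1≤d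

  unique-factorisation : ∀ fs gs → All IrreducibleMP fs → All IrreducibleMP gs → prodMP fs ≈ prodMP gs → fs ↭ gs
  unique-factorisation [] [] _ _ _ = Perm.refl
  unique-factorisation [] ((k , g) ∷ gs) _ (ig ∷ _) e =
    ⊥-elim (¬∣1ₚ g (proj₁ ig) (prodMP gs , ≈-sym e))
  unique-factorisation ((d , f) ∷ fs) gs (if ∷ ifs) igs e with ∈-∃++ (EuclidsLemma.∣prodMP⇒∈ f if gs igs (prodMP fs , e))
  ... | ys , zs , refl = ↭-trans (prep (d , f) IH) (↭-sym (shift (d , f) ys zs))
    where
    igs' : All IrreducibleMP (ys ++ zs)
    igs' with AllP.++⁻ ys igs
    ... | iys , (_ ∷ izs) = AllP.++⁺ iys izs
    e' : (toPol f *ₚ prodMP fs) ≈ (toPol f *ₚ prodMP (ys ++ zs))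
    e' = ≈-trans e (prodMP-↭ (shift (d , f) ys zs))
    IH : fs ↭ (ys ++ zs)
    IH = unique-factorisation fs (ys ++ zs) ifs igs' (*ₚ-cancelˡ f (prodMP fs) (prodMP (ys ++ zs)) e')


module Enumeration {q : ℕ} (F : FiniteField q) where
  open import Data.Nat using (zero; suc; _≤_; _<_; z≤n; s≤s; _∸_)

  open import Data.List as List using (List; []; _∷_; [_]; length; concatMap; upTo; allFin)
  open import Data.List.Properties as LP using (length-map)
  open import Data.Vec as Vec using (Vec; []; _∷_)
  import Data.Vec.Properties as VP
  import Data.Product.Properties as ΣP
  open import Data.Product using (Σ; ∃; _×_; _,_; proj₁; proj₂)
  open import Data.Sum using (_⊎_; inj₁; inj₂)
  open import Data.Empty using (⊥-elim)
  open import Relation.Nullary using (¬_; Dec; yes; no)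
  open import Relation.Binary.PropositionalEquality hiding ([_])
  open import Relation.Binary.Definitions using (DecidableEquality)
  open import Data.List.Relation.Unary.All as All using ([]; _∷_)
  open import Data.List.Relation.Unary.Any using (here; there)
  open import Data.List.Membership.Propositional using (_∈_)
  open import Data.List.Membership.Propositional.Properties using (∈-upTo⁺; ∈-upTo⁻)
  open import Function.Bundles using (Inverse)
  open import Data.Fin as Fin using (Fin)
  import Data.Fin.Properties as FinP
  open ℕΣ
  open UniqueFactorisation F public

  open ≡-Reasoning

  _≟m_ : ∀ {n} → DecidableEquality (Monic n)
  _≟m_ = VP.≡-dec _≟c_

  _≟P_ : DecidableEquality Pol
  _≟P_ = LP.≡-dec _≟c_

  _≟MP_ : DecidableEquality MonicPoly
  _≟MP_ = ΣP.≡-dec ℕ._≟_ _≟m_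

  sumFin : ∀ n → (Fin n → ℕ) → ℕ
  sumFin zero f = 0
  sumFin (suc n) f = f Fin.zero ℕ.+ sumFin n (λ i → f (Fin.suc i))

  ∑-tabulate : ∀ {A : Set} n (f : Fin n → A) (g : A → ℕ) → ∑ (List.tabulate f) g ≡ sumFin n (λ i → g (f i))
  ∑-tabulate zero f g = refl
  ∑-tabulate (suc n) f g = cong (g (f Fin.zero) ℕ.+_) (∑-tabulate n (λ i → f (Fin.suc i)) g)

  sumFin-cong : ∀ n {f g : Fin n → ℕ} → (∀ i → f i ≡ g i) → sumFin n f ≡ sumFin n g
  sumFin-cong zero e = refl
  sumFin-cong (suc n) e = cong₂ ℕ._+_ (e Fin.zero) (sumFin-cong n (λ i → e (Fin.suc i)))

  sumFin-0 : ∀ n {f : Fin n → ℕ} → (∀ i → f i ≡ 0) → sumFin n f ≡ 0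
  sumFin-0 zero e = refl
  sumFin-0 (suc n) e = cong₂ ℕ._+_ (e Fin.zero) (sumFin-0 n (λ i → e (Fin.suc i)))

  sumFin-𝟙≟ : ∀ n (k : Fin n) → sumFin n (λ i → 𝟙 (i FinP.≟ k)) ≡ 1
  sumFin-𝟙≟ (suc n) Fin.zero = cong suc (sumFin-0 n (λ i → 𝟙-no (Fin.suc i FinP.≟ Fin.zero) (λ ())))
  sumFin-𝟙≟ (suc n) (Fin.suc k) =
    trans (sumFin-cong n (λ i → 𝟙-cong (Fin.suc i FinP.≟ Fin.suc k) (i FinP.≟ k) FinP.suc-injective (cong Fin.suc))) (sumFin-𝟙≟ n k)

  multiplicity-elems : ∀ c → multiplicity _≟c_ c elems ≡ 1
  multiplicity-elems c = begin
    ∑ (List.map to (allFin q)) (λ y → 𝟙 (y ≟c c)) ≡⟨ ∑-map to (allFin q) _ ⟩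
    ∑ (allFin q) (λ i → 𝟙 (to i ≟c c)) ≡⟨ ∑-cong (allFin q) (λ i → 𝟙-cong (to i ≟c c) (i FinP.≟ from c) f g) ⟩
    ∑ (allFin q) (λ i → 𝟙 (i FinP.≟ from c)) ≡⟨ ∑-tabulate q (λ i → i) _ ⟩
    sumFin q (λ i → 𝟙 (i FinP.≟ from c)) ≡⟨ sumFin-𝟙≟ q (from c) ⟩
    1 ∎
    where
    to : Fin q → Carrier
    to = Inverse.to enum
    from : Carrier → Fin q
    from = Inverse.from enum
    f : ∀ {i} → to i ≡ c → i ≡ from c
    f {i} e = trans (sym (Inverse.strictlyInverseʳ enum i)) (cong from e)
    g : ∀ {i} → i ≡ from c → to i ≡ c
    g refl = Inverse.strictlyInverseˡ enum c

  length-elems : length elems ≡ q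
  length-elems = trans (length-map _ (allFin q)) (LP.length-tabulate (λ i → i))

  𝟙-∷≟ : ∀ {n} (y x : Carrier) (u w : Monic n) → 𝟙 ((y ∷ u) ≟m (x ∷ w)) ≡ 𝟙 (y ≟c x) ℕ.* 𝟙 (u ≟m w)
  𝟙-∷≟ y x u w with y ≟c x | u ≟m w | (y ∷ u) ≟m (x ∷ w)
  ... | yes _ | yes _ | yes _ = refl
  ... | yes refl | yes refl | no ne = ⊥-elim (ne refl)
  ... | yes _ | no ne | yes e = ⊥-elim (ne (proj₂ (VP.∷-injective e)))
  ... | yes _ | no _ | no _ = refl
  ... | no ne | _ | yes e = ⊥-elim (ne (proj₁ (VP.∷-injective e)))
  ... | no _ | yes _ | no _ = refl
  ... | no _ | no _ | no _ = refl

  multiplicity-allMonic : ∀ n (v : Monic n) → multiplicity _≟m_ v (allMonic n) ≡ 1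
  multiplicity-allMonic zero [] = refl
  multiplicity-allMonic (suc n) (x ∷ w) = begin
    ∑ (concatMap (λ y → List.map (y ∷_) (allMonic n)) elems) (λ u → 𝟙 (u ≟m (x ∷ w)))
      ≡⟨ ∑-concatMap (λ y → List.map (y ∷_) (allMonic n)) elems _ ⟩
    ∑ elems (λ y → ∑ (List.map (y ∷_) (allMonic n)) (λ u → 𝟙 (u ≟m (x ∷ w))))
      ≡⟨ ∑-cong elems (λ y → ∑-map (y ∷_) (allMonic n) _) ⟩
    ∑ elems (λ y → ∑ (allMonic n) (λ u → 𝟙 ((y ∷ u) ≟m (x ∷ w))))
      ≡⟨ ∑-cong elems (λ y → trans (∑-cong (allMonic n) (λ u → 𝟙-∷≟ y x u w)) (∑-distribˡ-* (allMonic n) (𝟙 (y ≟c x)) _)) ⟩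
    ∑ elems (λ y → 𝟙 (y ≟c x) ℕ.* multiplicity _≟m_ w (allMonic n))
      ≡⟨ ∑-𝟙≟-once _≟c_ elems x (λ _ → multiplicity _≟m_ w (allMonic n)) (multiplicity-elems x) ⟩
    multiplicity _≟m_ w (allMonic n)
      ≡⟨ multiplicity-allMonic n w ⟩
    1 ∎

  ∑-const : ∀ {B : Set} (xs : List B) c → ∑ xs (λ _ → c) ≡ length xs ℕ.* c
  ∑-const []       c = refl
  ∑-const (x ∷ xs) c = cong (c ℕ.+_) (∑-const xs c)

  count-allMonic : ∀ n → ∑ (allMonic n) (λ _ → 1) ≡ q ℕ.^ n
  count-allMonic zero = refl
  count-allMonic (suc n) = begin
    ∑ (concatMap (λ y → List.map (y ∷_) (allMonic n)) elems) (λ _ → 1)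
      ≡⟨ ∑-concatMap (λ y → List.map (y ∷_) (allMonic n)) elems _ ⟩
    ∑ elems (λ y → ∑ (List.map (y ∷_) (allMonic n)) (λ _ → 1))
      ≡⟨ ∑-cong elems (λ y → trans (∑-map (y ∷_) (allMonic n) _) (count-allMonic n)) ⟩
    ∑ elems (λ y → q ℕ.^ n)
      ≡⟨ ∑-const elems _ ⟩
    length elems ℕ.* q ℕ.^ n
      ≡⟨ cong (ℕ._* q ℕ.^ n) length-elems ⟩
    q ℕ.* q ℕ.^ n ∎

  multiplicity≡1⇒∈ : ∀ {A : Set} (_≟_ : DecidableEquality A) x xs → multiplicity _≟_ x xs ≡ 1 → x ∈ xs
  multiplicity≡1⇒∈ _≟_ x [] ()
  multiplicity≡1⇒∈ _≟_ x (y ∷ xs) e with y ≟ x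
  ... | yes refl = here refl
  ... | no _ = there (multiplicity≡1⇒∈ _≟_ x xs e)

  ∈-allMonic : ∀ n (v : Monic n) → v ∈ allMonic n
  ∈-allMonic n v = multiplicity≡1⇒∈ _≟m_ v (allMonic n) (multiplicity-allMonic n v)

  search : ∀ {A : Set} (xs : List A) {P : A → Set} → (∀ x → Dec (P x)) →
            (Σ A λ x → x ∈ xs × P x) ⊎ (∀ x → x ∈ xs → ¬ P x)
  search [] P? = inj₂ (λ x ())
  search (y ∷ xs) P? with P? y
  ... | yes py = inj₁ (y , here refl , py)
  ... | no npy with search xs P?
  ... | inj₁ (x , x∈ , px) = inj₁ (x , there x∈ , px)
  ... | inj₂ none = inj₂ (λ { x (here refl) → npy ; x (there x∈) → none x x∈ })

  monic≈⇒≡ : ∀ {m n} (a : Monic m) (b : Monic n) → toPol a ≈ toPol b → toPol a ≡ toPol b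
  monic≈⇒≡ a b e = cong (λ z → toPol (proj₂ z)) (proj₂ (scale-monic≈monic a b 1# (≈-trans (scale-1 (toPol a)) e)))

  totalDegree : List MonicPoly → ℕ
  totalDegree [] = 0
  totalDegree ((d , _) ∷ fs) = d ℕ.+ totalDegree fs

  prodMP-monic : ∀ fs → ∃ λ (v : Monic (totalDegree fs)) → prodMP fs ≡ toPol v
  prodMP-monic [] = [] , refl
  prodMP-monic ((d , a) ∷ fs) with prodMP-monic fs
  ... | v , e with monic-mul a v
  ... | w , e' = w , trans (cong (toPol a *ₚ_) e) e'

  prodMP≈⇒≡ : ∀ fs {n} (p : Monic n) → prodMP fs ≈ toPol p → prodMP fs ≡ toPol p
  prodMP≈⇒≡ fs p e with prodMP-monic fs
  ... | v , ev = trans ev (monic≈⇒≡ v p (≈-trans (≡⇒≈ (sym ev)) e))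

  FactorOfDegree : ∀ {n} → Monic n → ℕ → Set
  FactorOfDegree {n} p m = Σ (Monic m) λ a → Σ (Monic (n ∸ m)) λ b → toPol a *ₚ toPol b ≡ toPol p

  factorOfDegree? : ∀ {n} (p : Monic n) m → Dec (FactorOfDegree p m)
  factorOfDegree? {n} p m with search (allMonic m) {λ a → Σ (Monic (n ∸ m)) λ b → toPol a *ₚ toPol b ≡ toPol p} inner
    where
    inner : ∀ a → Dec (Σ (Monic (n ∸ m)) λ b → toPol a *ₚ toPol b ≡ toPol p)
    inner a with search (allMonic (n ∸ m)) (λ b → (toPol a *ₚ toPol b) ≟P toPol p)
    ... | inj₁ (b , _ , e) = yes (b , e)
    ... | inj₂ none = no (λ { (b , e) → none b (∈-allMonic (n ∸ m) b) e })
  ... | inj₁ (a , _ , b , e) = yes (a , b , e)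
  ... | inj₂ none = no (λ { (a , b , e) → none a (∈-allMonic m a) (b , e) })

  toPol-subst : ∀ {k k'} (eq : k ≡ k') (b : Monic k) → toPol (subst Monic eq b) ≡ toPol b
  toPol-subst refl b = refl

  ProperFactorOrIrreducible : ∀ {n} → Monic n → Set
  ProperFactorOrIrreducible {n} p = (Σ ℕ λ m → 1 ≤ m × m < n × FactorOfDegree p m) ⊎
                   (∀ {m k} (a : Monic m) (b : Monic k) → toPol a *ₚ toPol b ≡ toPol p → m ≡ 0 ⊎ k ≡ 0)

  properFactor-or-irreducible : ∀ {n} (p : Monic n) → ProperFactorOrIrreducible p
  properFactor-or-irreducible {n} p with search (upTo n) {λ m → 1 ≤ m × FactorOfDegree p m} dec
    where
    dec : ∀ m → Dec (1 ≤ m × FactorOfDegree p m)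
    dec zero = no (λ { (() , _) })
    dec (suc m) with factorOfDegree? p (suc m)
    ... | yes pr = yes (s≤s z≤n , pr)
    ... | no npr = no (λ { (_ , pr) → npr pr })
  ... | inj₁ (m , m∈ , 1≤m , pr) = inj₁ (m , 1≤m , ∈-upTo⁻ m∈ , pr)
  ... | inj₂ none = inj₂ irr
    where
    irr : ∀ {m k} (a : Monic m) (b : Monic k) → toPol a *ₚ toPol b ≡ toPol p → m ≡ 0 ⊎ k ≡ 0
    irr {zero} a b e = inj₁ refl
    irr {suc m} {zero} a b e = inj₂ refl
    irr {suc m} {suc k} a b e = ⊥-elim (none (suc m) (∈-upTo⁺ m<n) (s≤s z≤n , a , subst Monic keq b , e'))
      where
      dm : suc m ℕ.+ suc k ≡ n
      dm = degree-* a b p e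
      m<n : suc m < n
      m<n = subst (suc m <_) dm (ℕP.m<m+n (suc m) (s≤s z≤n))
      keq : suc k ≡ n ∸ suc m
      keq = sym (trans (cong (_∸ suc m) (sym dm)) (ℕP.m+n∸m≡n (suc m) (suc k)))
      e' : toPol a *ₚ toPol (subst Monic keq b) ≡ toPol p
      e' = trans (cong (toPol a *ₚ_) (toPol-subst keq b)) e


module FactorCounts {q : ℕ} (F : FiniteField q) where
  open import Data.Nat using (zero; suc; _≤_; _<_; z≤n; s≤s; _∸_)

  open import Data.List as List using (List; []; _∷_; _++_; [_]; length; replicate)
  open import Data.List.Properties as LP using ()
  open import Data.Vec using ([]; _∷_)
  open import Data.Product using (Σ; ∃; _,_; proj₁; proj₂)
  open import Data.Sum using (inj₁; inj₂)
  open import Relation.Nullary using (yes; no)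
  open import Relation.Binary.PropositionalEquality hiding ([_])
  open import Data.List.Relation.Unary.All as All using (All; []; _∷_)
  import Data.List.Relation.Unary.All.Properties as AllP
  open import Data.List.Relation.Unary.Any using (here; there)
  open import Data.List.Membership.Propositional using (_∈_)
  open import Data.List.Membership.Propositional.Properties using (∈-∃++)
  open import Data.List.Relation.Binary.Permutation.Propositional as Perm using (_↭_; ↭-sym; ↭-trans; prep)
  open import Data.List.Relation.Binary.Permutation.Propositional.Properties using (↭-length; shift)
  open ℕΣ
  open Enumeration F public

  open ≡-Reasoning

  record Factorisation {n} (p : Monic n) : Set where
    constructor factorisation
    field
      fs : List MonicPoly
      irrs : All IrreducibleMP fs
      prod : prodMP fs ≡ toPol p
  open Factorisation public

  factoriseᶠ : ∀ fuel n → n < fuel → (p : Monic n) → Factorisation p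
  factoriseᶠ (suc fuel) zero _ [] = factorisation [] [] refl
  factoriseᶠ (suc fuel) (suc n) lt p with properFactor-or-irreducible p
  ... | inj₂ irr = factorisation [ (suc n , p) ] ((s≤s z≤n , irr) ∷ []) (prodMP≈⇒≡ [ (suc n , p) ] p (*ₚ-identityʳ (toPol p)))
  ... | inj₁ (m , 1≤m , m<n , a , b , e) =
    factorisation (fs fa ++ fs fb) (AllP.++⁺ (irrs fa) (irrs fb))
        (prodMP≈⇒≡ (fs fa ++ fs fb) p
          (≈-trans (prodMP-++ (fs fa) (fs fb)) (≈-trans (*ₚ-cong (≡⇒≈ (prod fa)) (≡⇒≈ (prod fb))) (≡⇒≈ e))))
    where
    le : suc n ≤ fuel
    le = ℕP.≤-pred lt
    fa : Factorisation a
    fa = factoriseᶠ fuel m (ℕP.<-≤-trans m<n le) a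
    fb : Factorisation b
    fb = factoriseᶠ fuel (suc n ∸ m) (ℕP.<-≤-trans (ℕP.∸-monoʳ-< {suc n} {m} {0} 1≤m (ℕP.<⇒≤ m<n)) le) b

  opaque
    factorise : ∀ {n} (p : Monic n) → Factorisation p
    factorise {n} p = factoriseᶠ (suc n) n ℕP.≤-refl p

  factorCount : ∀ {n} → Monic n → ℕ
  factorCount p = length (fs (factorise p))

  factorCount-correct : ∀ {n} (p : Monic n) → FactorCount p (factorCount p)
  factorCount-correct p = fs (factorise p) , refl , irrs (factorise p) , prod (factorise p)

  FactorCount-unique : ∀ {n} (p : Monic n) {k k'} → FactorCount p k → FactorCount p k' → k ≡ k'
  FactorCount-unique p (xs , refl , ix , px) (ys , refl , iy , py) =
    ↭-length (unique-factorisation xs ys ix iy (≡⇒≈ (trans px (sym py))))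

  factorCount-1ₚ : factorCount [] ≡ 0
  factorCount-1ₚ = FactorCount-unique [] (factorCount-correct []) ([] , refl , [] , refl)

  opaque
    pow : ∀ {d} → Monic d → (j : ℕ) → Monic (j ℕ.* d)
    pow x zero = []
    pow x (suc j) = proj₁ (monic-mul x (pow x j))

    pow-prodMP : ∀ {d} (x : Monic d) j → toPol (pow x j) ≡ prodMP (replicate j (d , x))
    pow-prodMP x zero = refl
    pow-prodMP x (suc j) = trans (sym (proj₂ (monic-mul x (pow x j)))) (cong (toPol x *ₚ_) (pow-prodMP x j))

  multiplicityMP : MonicPoly → List MonicPoly → ℕ
  multiplicityMP = multiplicity _≟MP_

  multiplicity-↭ : ∀ x {fs gs} → fs ↭ gs → multiplicityMP x fs ≡ multiplicityMP x gs
  multiplicity-↭ x Perm.refl = refl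
  multiplicity-↭ x (Perm.prep y p) = cong (𝟙 (y ≟MP x) ℕ.+_) (multiplicity-↭ x p)
  multiplicity-↭ x (Perm.swap {xs} {ys} y z p) = begin
    𝟙 (y ≟MP x) ℕ.+ (𝟙 (z ≟MP x) ℕ.+ multiplicityMP x xs) ≡⟨ sym (ℕP.+-assoc (𝟙 (y ≟MP x)) _ _) ⟩
    𝟙 (y ≟MP x) ℕ.+ 𝟙 (z ≟MP x) ℕ.+ multiplicityMP x xs ≡⟨ cong₂ ℕ._+_ (ℕP.+-comm (𝟙 (y ≟MP x)) _) (multiplicity-↭ x p) ⟩
    𝟙 (z ≟MP x) ℕ.+ 𝟙 (y ≟MP x) ℕ.+ multiplicityMP x ys ≡⟨ ℕP.+-assoc (𝟙 (z ≟MP x)) _ _ ⟩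
    𝟙 (z ≟MP x) ℕ.+ (𝟙 (y ≟MP x) ℕ.+ multiplicityMP x ys) ∎
  multiplicity-↭ x (Perm.trans p p') = trans (multiplicity-↭ x p) (multiplicity-↭ x p')

  multiplicity-++ : ∀ x fs gs → multiplicityMP x (fs ++ gs) ≡ multiplicityMP x fs ℕ.+ multiplicityMP x gs
  multiplicity-++ x fs gs = ∑-++ fs gs (λ y → 𝟙 (y ≟MP x))

  multiplicity-replicate : ∀ x j → multiplicityMP x (replicate j x) ≡ j
  multiplicity-replicate x zero = refl
  multiplicity-replicate x (suc j) = cong₂ ℕ._+_ (𝟙-yes (x ≟MP x) refl) (multiplicity-replicate x j)

  replicate-split : ∀ x j fs → j ≤ multiplicityMP x fs → ∃ λ rest → fs ↭ (replicate j x ++ rest)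
  replicate-split x zero fs _ = fs , Perm.refl
  replicate-split x (suc j) fs le with multiplicity>0⇒∈ fs le
    where
    multiplicity>0⇒∈ : ∀ fs → suc j ≤ multiplicityMP x fs → x ∈ fs
    multiplicity>0⇒∈ [] ()
    multiplicity>0⇒∈ (y ∷ fs) le with y ≟MP x
    ... | yes refl = here refl
    ... | no _ = there (multiplicity>0⇒∈ fs le)
  ... | x∈ with ∈-∃++ x∈
  ... | ys , zs , refl with replicate-split x j (ys ++ zs) le'
    where
    eq : multiplicityMP x (ys ++ x ∷ zs) ≡ suc (multiplicityMP x (ys ++ zs))
    eq = begin
      multiplicityMP x (ys ++ x ∷ zs) ≡⟨ multiplicity-↭ x (shift x ys zs) ⟩
      𝟙 (x ≟MP x) ℕ.+ multiplicityMP x (ys ++ zs) ≡⟨ cong (ℕ._+ multiplicityMP x (ys ++ zs)) (𝟙-yes (x ≟MP x) refl) ⟩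
      suc (multiplicityMP x (ys ++ zs)) ∎
    le' : j ≤ multiplicityMP x (ys ++ zs)
    le' = ℕP.≤-pred (subst (suc j ≤_) eq le)
  ... | rest , p = rest , ↭-trans (shift x ys zs) (prep x p)

  totalDegree-++ : ∀ fs gs → totalDegree (fs ++ gs) ≡ totalDegree fs ℕ.+ totalDegree gs
  totalDegree-++ [] gs = refl
  totalDegree-++ ((d , _) ∷ fs) gs = trans (cong (d ℕ.+_) (totalDegree-++ fs gs)) (sym (ℕP.+-assoc d _ _))

  totalDegree-replicate : ∀ {d} (x : Monic d) j → totalDegree (replicate j (d , x)) ≡ j ℕ.* d
  totalDegree-replicate {d} x zero = refl
  totalDegree-replicate {d} x (suc j) = cong (d ℕ.+_) (totalDegree-replicate x j)

  totalDegree-↭ : ∀ {fs gs} → fs ↭ gs → totalDegree fs ≡ totalDegree gs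
  totalDegree-↭ Perm.refl = refl
  totalDegree-↭ (Perm.prep (d , _) p) = cong (d ℕ.+_) (totalDegree-↭ p)
  totalDegree-↭ (Perm.swap {xs} {ys} (d , _) (e , _) p) = begin
    d ℕ.+ (e ℕ.+ totalDegree xs) ≡⟨ sym (ℕP.+-assoc d e _) ⟩
    d ℕ.+ e ℕ.+ totalDegree xs ≡⟨ cong₂ ℕ._+_ (ℕP.+-comm d e) (totalDegree-↭ p) ⟩
    e ℕ.+ d ℕ.+ totalDegree ys ≡⟨ ℕP.+-assoc e d _ ⟩
    e ℕ.+ (d ℕ.+ totalDegree ys) ∎
  totalDegree-↭ (Perm.trans p p') = trans (totalDegree-↭ p) (totalDegree-↭ p')

  totalDegree-prodMP : ∀ fs {n} (p : Monic n) → prodMP fs ≡ toPol p → totalDegree fs ≡ n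
  totalDegree-prodMP fs p e with prodMP-monic fs
  ... | v , ev = ℕP.suc-injective (trans (sym (len-toPol v)) (trans (cong length (trans (sym ev) e)) (len-toPol p)))

  opaque
    pow* : ∀ {d n} (x : Monic d) j → j ℕ.* d ≤ n → Monic (n ∸ j ℕ.* d) → Monic n
    pow* {d} {n} x j le r = subst Monic (ℕP.m+[n∸m]≡n le) (proj₁ (monic-mul (pow x j) r))

    pow*-toPol : ∀ {d n} (x : Monic d) j (le : j ℕ.* d ≤ n) r → toPol (pow* x j le r) ≡ toPol (pow x j) *ₚ toPol r
    pow*-toPol x j le r = trans (toPol-subst (ℕP.m+[n∸m]≡n le) _) (sym (proj₂ (monic-mul (pow x j) r)))

  pow*-injective : ∀ {d n} (x : Monic d) j (le : j ℕ.* d ≤ n) r r' → pow* x j le r ≡ pow* x j le r' → r ≡ r'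
  pow*-injective x j le r r' e = toPol-inj r r'
    (monic≈⇒≡ r r' (*ₚ-cancelˡ (pow x j) (toPol r) (toPol r')
      (≡⇒≈ (trans (sym (pow*-toPol x j le r)) (trans (cong toPol e) (pow*-toPol x j le r'))))))

  factorCount-pow* : ∀ {d n} (x : Monic d) → Irreducible x → ∀ j (le : j ℕ.* d ≤ n) r → factorCount (pow* x j le r) ≡ j ℕ.+ factorCount r
  factorCount-pow* {d} {n} x ix j le r = FactorCount-unique P (factorCount-correct P) (gs , L , I , E)
    where
    P : Monic n
    P = pow* x j le r
    gs : List MonicPoly
    gs = replicate j (d , x) ++ fs (factorise r)
    L : length gs ≡ j ℕ.+ factorCount r
    L = trans (LP.length-++ (replicate j (d , x))) (cong (ℕ._+ factorCount r) (LP.length-replicate j))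
    I : All IrreducibleMP gs
    I = AllP.++⁺ (AllP.replicate⁺ j ix) (irrs (factorise r))
    E : prodMP gs ≡ toPol P
    E = prodMP≈⇒≡ gs P (≈-trans (prodMP-++ (replicate j (d , x)) (fs (factorise r)))
          (≡⇒≈ (trans (cong₂ _*ₚ_ (sym (pow-prodMP x j)) (prod (factorise r))) (sym (pow*-toPol x j le r)))))

  module Valuation {n} (p : Monic n) {d} (x : Monic d) (ix : Irreducible x) where
    fsp : List MonicPoly
    fsp = fs (factorise p)
    valuation : ℕ
    valuation = multiplicityMP (d , x) fsp

    pow*≡⇒≤valuation : ∀ j (le : j ℕ.* d ≤ n) r → pow* x j le r ≡ p → j ≤ valuation
    pow*≡⇒≤valuation j le r e = subst (j ≤_) (sym eq) (ℕP.m≤m+n j _)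
      where
      gs : List MonicPoly
      gs = replicate j (d , x) ++ fs (factorise r)
      I : All IrreducibleMP gs
      I = AllP.++⁺ (AllP.replicate⁺ j ix) (irrs (factorise r))
      E : prodMP fsp ≈ prodMP gs
      E = ≈-trans (≡⇒≈ (trans (prod (factorise p)) (cong toPol (sym e))))
            (≈-trans (≡⇒≈ (pow*-toPol x j le r))
            (≈-sym (≈-trans (prodMP-++ (replicate j (d , x)) (fs (factorise r)))
                   (≡⇒≈ (cong₂ _*ₚ_ (sym (pow-prodMP x j)) (prod (factorise r)))))))
      eq : valuation ≡ j ℕ.+ multiplicityMP (d , x) (fs (factorise r))
      eq = trans (multiplicity-↭ (d , x) (unique-factorisation fsp gs (irrs (factorise p)) I E))
             (trans (multiplicity-++ (d , x) (replicate j (d , x)) (fs (factorise r)))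
                    (cong (ℕ._+ multiplicityMP (d , x) (fs (factorise r))) (multiplicity-replicate (d , x) j)))

    ≤valuation⇒pow*≡ : ∀ j → j ≤ valuation → Σ (j ℕ.* d ≤ n) λ le → Σ (Monic (n ∸ j ℕ.* d)) λ r → pow* x j le r ≡ p
    ≤valuation⇒pow*≡ j jv with replicate-split (d , x) j fsp jv
    ... | rest , perm with prodMP-monic rest
    ... | w , ew = le , r , toPol-inj _ p (monic≈⇒≡ _ p E)
      where
      dsum : j ℕ.* d ℕ.+ totalDegree rest ≡ n
      dsum = begin
        j ℕ.* d ℕ.+ totalDegree rest ≡⟨ cong (ℕ._+ totalDegree rest) (sym (totalDegree-replicate x j)) ⟩
        totalDegree (replicate j (d , x)) ℕ.+ totalDegree rest ≡⟨ sym (totalDegree-++ (replicate j (d , x)) rest) ⟩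
        totalDegree (replicate j (d , x) ++ rest) ≡⟨ sym (totalDegree-↭ perm) ⟩
        totalDegree fsp ≡⟨ totalDegree-prodMP fsp p (prod (factorise p)) ⟩
        n ∎
      le : j ℕ.* d ≤ n
      le = subst (j ℕ.* d ≤_) dsum (ℕP.m≤m+n _ _)
      keq : totalDegree rest ≡ n ∸ j ℕ.* d
      keq = sym (trans (cong (_∸ j ℕ.* d) (sym dsum)) (ℕP.m+n∸m≡n (j ℕ.* d) _))
      r : Monic (n ∸ j ℕ.* d)
      r = subst Monic keq w
      E : toPol (pow* x j le r) ≈ toPol p
      E = ≈-trans (≡⇒≈ (trans (pow*-toPol x j le r) (cong₂ _*ₚ_ (pow-prodMP x j) (trans (toPol-subst keq w) (sym ew)))))
          (≈-trans (≈-sym (prodMP-++ (replicate j (d , x)) rest))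
          (≈-trans (prodMP-↭ (↭-sym perm)) (≡⇒≈ (prod (factorise p)))))


module IrreducibleEnumeration {q : ℕ} (F : FiniteField q) where
  open import Data.Nat using (zero; suc; _≤_; _<_; z≤n; s≤s)

  open import Data.List as List using (List; []; _∷_; [_]; concatMap; upTo)
  open import Data.Vec using ([]; _∷_)
  open import Data.Product using (Σ; _,_; proj₁; proj₂)
  open import Data.Sum using (inj₁; inj₂)
  open import Data.Empty using (⊥-elim)
  open import Relation.Nullary using (¬_; Dec; yes; no)
  open import Relation.Binary.PropositionalEquality hiding ([_])
  open import Data.List.Relation.Unary.All using ([]; _∷_)
  open ℕΣ
  open FactorCounts F public

  open ≡-Reasoning

  IrreducibleMonic : Set
  IrreducibleMonic = Σ MonicPoly IrreducibleMP

  irreducible? : ∀ {n} (a : Monic n) → Dec (Irreducible a)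
  irreducible? {zero} a = no (λ { (() , _) })
  irreducible? {suc n} a with properFactor-or-irreducible a
  ... | inj₂ irr = yes (s≤s z≤n , irr)
  ... | inj₁ (m , 1≤m , m<n , b , c , e) = no bad
    where
    bad : ¬ Irreducible a
    bad (_ , irr) with irr b c e
    ... | inj₁ m≡0 = ℕP.<-irrefl (sym m≡0) 1≤m
    ... | inj₂ k≡0 = ℕP.<-irrefl (sym k≡0) (ℕP.m<n⇒0<n∸m m<n)

  keepIrreducible : ∀ {e} → List (Monic e) → List IrreducibleMonic
  keepIrreducible [] = []
  keepIrreducible {e} (b ∷ bs) with irreducible? b
  ... | yes ib = ((e , b) , ib) ∷ keepIrreducible bs
  ... | no _ = keepIrreducible bs

  ifIrreducible : ∀ {e} (b : Monic e) → Dec (Irreducible b) → (IrreducibleMonic → ℕ) → ℕ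
  ifIrreducible {e} b (yes ib) g = g ((e , b) , ib)
  ifIrreducible b (no _) g = 0

  ∑-keepIrreducible : ∀ {e} (bs : List (Monic e)) (g : IrreducibleMonic → ℕ) → ∑ (keepIrreducible bs) g ≡ ∑ bs (λ b → ifIrreducible b (irreducible? b) g)
  ∑-keepIrreducible [] g = refl
  ∑-keepIrreducible (b ∷ bs) g with irreducible? b
  ... | yes ib = cong (g _ ℕ.+_) (∑-keepIrreducible bs g)
  ... | no _ = ∑-keepIrreducible bs g

  module Irreducibles (N : ℕ) where

    irreducibles : List IrreducibleMonic
    irreducibles = concatMap (λ e → keepIrreducible (allMonic e)) (upTo (suc N))

    ∑-irreducibles : (g : IrreducibleMonic → ℕ) → ∑ irreducibles g ≡ ∑ (upTo (suc N)) (λ e → ∑ (allMonic e) (λ b → ifIrreducible b (irreducible? b) g))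
    ∑-irreducibles g = trans (∑-concatMap (λ e → keepIrreducible (allMonic e)) (upTo (suc N)) g)
                     (∑-cong (upTo (suc N)) (λ e → ∑-keepIrreducible (allMonic e) g))

    degree : IrreducibleMonic → ℕ
    degree ((d , _) , _) = d

    irreducibles-once : ∀ {d} (a : Monic d) → Irreducible a → d ≤ N → ∑ irreducibles (λ y → 𝟙 (proj₁ y ≟MP (d , a))) ≡ 1
    irreducibles-once {d} a ia d≤N = begin
      ∑ irreducibles (λ y → 𝟙 (proj₁ y ≟MP (d , a)))
        ≡⟨ ∑-irreducibles _ ⟩
      ∑ (upTo (suc N)) G
        ≡⟨ ∑-upTo (suc N) G ⟩
      ∑< (suc N) G
        ≡⟨ ∑<-cong (suc N) (λ e _ → G≡ e) ⟩
      ∑[ e < suc N ] (𝟙 (e ℕ.≟ d) ℕ.* 1)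
        ≡⟨ ∑<-𝟙≟ (suc N) d (λ _ → 1) ⟩
      𝟙 (d ℕ.<? suc N) ℕ.* 1
        ≡⟨ cong (ℕ._* 1) (𝟙-yes (d ℕ.<? suc N) (s≤s d≤N)) ⟩
      1 ∎
      where
      G : ℕ → ℕ
      G e = ∑ (allMonic e) (λ b → ifIrreducible b (irreducible? b) (λ y → 𝟙 (proj₁ y ≟MP (d , a))))
      G0 : ∀ e → ¬ e ≡ d → G e ≡ 0
      G0 e ne = ∑-zero (allMonic e) (λ b → vanishes b (irreducible? b))
        where
        vanishes : ∀ b (dec : Dec (Irreducible b)) → ifIrreducible b dec (λ y → 𝟙 (proj₁ y ≟MP (d , a))) ≡ 0
        vanishes b (yes ib) = 𝟙-no ((e , b) ≟MP (d , a)) (λ eq → ne (cong proj₁ eq))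
        vanishes b (no _) = refl
      Gd : G d ≡ 1
      Gd = begin
        G d ≡⟨ ∑-cong (allMonic d) vanishes ⟩
        ∑ (allMonic d) (λ b → 𝟙 (b ≟m a) ℕ.* 1) ≡⟨ ∑-𝟙≟-once _≟m_ (allMonic d) a (λ _ → 1) (multiplicity-allMonic d a) ⟩
        1 ∎
        where
        vanishes : ∀ b → ifIrreducible b (irreducible? b) (λ y → 𝟙 (proj₁ y ≟MP (d , a))) ≡ 𝟙 (b ≟m a) ℕ.* 1
        vanishes b with irreducible? b | b ≟m a
        ... | yes ib | yes refl = 𝟙-yes ((d , b) ≟MP (d , b)) refl
        ... | yes ib | no ne = 𝟙-no ((d , b) ≟MP (d , a)) (λ eq → ne (toPol-inj b a (cong (λ z → toPol (proj₂ z)) eq)))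
        ... | no nb | yes refl = ⊥-elim (nb ia)
        ... | no nb | no _ = refl
      G≡ : ∀ e → G e ≡ 𝟙 (e ℕ.≟ d) ℕ.* 1
      G≡ e with e ℕ.≟ d
      ... | yes refl = Gd
      ... | no e≢d   = G0 e e≢d


module DoubleCounting {q : ℕ} (F : FiniteField q) (N : ℕ) where
  open import Data.Nat using (zero; suc; _≤_; _<_; z≤n; s≤s; _∸_; _≤?_)

  open import Data.List as List using (List; []; _∷_; [_]; applyUpTo)
  open import Data.Vec using ([]; _∷_)
  open import Data.Product using (Σ; _,_; proj₁)
  open import Data.Empty using (⊥-elim)
  open import Relation.Nullary using (Dec; yes; no)
  open import Relation.Binary.PropositionalEquality hiding ([_])
  open import Data.List.Relation.Unary.All using (All; []; _∷_)
  open ℕΣ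
  open IrreducibleEnumeration F public
  open Irreducibles N public

  open ≡-Reasoning

  exponents : ℕ → List ℕ
  exponents n = applyUpTo suc n

  ∑<-𝟙≤ : ∀ n v → v ≤ n → ∑[ j < n ] 𝟙 (suc j ≤? v) ≡ v
  ∑<-𝟙≤ zero    zero    _ = refl
  ∑<-𝟙≤ (suc n) zero    _ = ∑<-zero (suc n) (λ j _ → 𝟙-no (suc j ≤? 0) (λ ()))
  ∑<-𝟙≤ (suc n) (suc v) (s≤s v≤n) =
    cong suc (trans (∑<-cong n (λ j _ → 𝟙-cong (suc (suc j) ≤? suc v) (suc j ≤? v) ℕP.≤-pred s≤s)) (∑<-𝟙≤ n v v≤n))

  ∑-exponents-𝟙≤ : ∀ n v → v ≤ n → ∑ (exponents n) (λ j → 𝟙 (j ≤? v)) ≡ v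
  ∑-exponents-𝟙≤ n v le = trans (∑-applyUpTo suc n (λ j → 𝟙 (j ≤? v))) (∑<-𝟙≤ n v le)

  -- d if x^j divides p, and 0 otherwise.
  exponentWeight′ : ∀ {n} → Monic n → ∀ {d} → Monic d → ∀ j → Dec (j ℕ.* d ≤ n) → ℕ
  exponentWeight′ {n} p {d} x j (yes le) = d ℕ.* ∑ (allMonic (n ∸ j ℕ.* d)) (λ r → 𝟙 (pow* x j le r ≟m p))
  exponentWeight′ p x j (no _) = 0

  exponentWeight : ∀ {n} → Monic n → IrreducibleMonic → ℕ → ℕ
  exponentWeight {n} p ((d , x) , ix) j = exponentWeight′ p x j (j ℕ.* d ≤? n)

  module ExponentWeight {n} (p : Monic n) {d} (x : Monic d) (1≤d : 1 ≤ d) (v : ℕ)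
    (pow*≡⇒≤valuation : ∀ j (le : j ℕ.* d ≤ n) r → pow* x j le r ≡ p → j ≤ v)
    (≤valuation⇒pow*≡ : ∀ j → j ≤ v → Σ (j ℕ.* d ≤ n) λ le → Σ (Monic (n ∸ j ℕ.* d)) λ r → pow* x j le r ≡ p) where

    inner : ∀ j (le : j ℕ.* d ≤ n) → ∑ (allMonic (n ∸ j ℕ.* d)) (λ r → 𝟙 (pow* x j le r ≟m p)) ≡ 𝟙 (j ≤? v)
    inner j le with j ≤? v
    ... | yes jv with ≤valuation⇒pow*≡ j jv
    ... | le' , r₀ , e₀ = trans (∑-cong (allMonic (n ∸ j ℕ.* d)) (λ r → 𝟙-cong (pow* x j le r ≟m p) (r ≟m r₀) (f r) (g r)))
                                (multiplicity-allMonic _ r₀)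
      where
      e₀' : pow* x j le r₀ ≡ p
      e₀' = subst (λ z → pow* x j z r₀ ≡ p) (ℕP.≤-irrelevant le' le) e₀
      f : ∀ r → pow* x j le r ≡ p → r ≡ r₀
      f r e = pow*-injective x j le r r₀ (trans e (sym e₀'))
      g : ∀ r → r ≡ r₀ → pow* x j le r ≡ p
      g r refl = e₀'
    inner j le | no njv = ∑-zero (allMonic (n ∸ j ℕ.* d)) (λ r → 𝟙-no (pow* x j le r ≟m p) (λ e → njv (pow*≡⇒≤valuation j le r e)))

    exponentWeight′-value : ∀ j dec → exponentWeight′ p x j dec ≡ d ℕ.* 𝟙 (j ≤? v)
    exponentWeight′-value j (yes le) = cong (d ℕ.*_) (inner j le)
    exponentWeight′-value j (no nle) = sym (trans (cong (d ℕ.*_) (𝟙-no (j ≤? v) (λ jv → nle (proj₁ (≤valuation⇒pow*≡ j jv))))) (ℕP.*-zeroʳ d))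

    v≤n' : ∀ v' → v' ≤ v → v' ≤ n
    v≤n' zero _ = z≤n
    v≤n' (suc v') le with ≤valuation⇒pow*≡ (suc v') le
    ... | le' , _ = ℕP.≤-trans (ℕP.m≤m*n (suc v') d {{nz 1≤d}}) le'
      where
      nz : 1 ≤ d → ℕ.NonZero d
      nz (s≤s _) = _

    ∑-exponentWeight′ : ∑ (exponents n) (λ j → exponentWeight′ p x j (j ℕ.* d ≤? n)) ≡ d ℕ.* v
    ∑-exponentWeight′ = trans (∑-cong (exponents n) (λ j → exponentWeight′-value j (j ℕ.* d ≤? n)))
                  (trans (∑-distribˡ-* (exponents n) d (λ j → 𝟙 (j ≤? v))) (cong (d ℕ.*_) (∑-exponents-𝟙≤ n v (v≤n' v ℕP.≤-refl))))

  ∑-irreducibleDegrees : ∀ fs → All IrreducibleMP fs → totalDegree fs ≤ N →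
              ∑ fs (λ f → ∑ irreducibles (λ y → 𝟙 (f ≟MP proj₁ y) ℕ.* degree y)) ≡ totalDegree fs
  ∑-irreducibleDegrees [] _ _ = refl
  ∑-irreducibleDegrees ((e , a) ∷ fs) (ia ∷ ias) le = cong₂ ℕ._+_ head-term (∑-irreducibleDegrees fs ias (ℕP.≤-trans (ℕP.m≤n+m _ e) le))
    where
    head-term : ∑ irreducibles (λ y → 𝟙 ((e , a) ≟MP proj₁ y) ℕ.* degree y) ≡ e
    head-term = begin
      ∑ irreducibles (λ y → 𝟙 ((e , a) ≟MP proj₁ y) ℕ.* degree y) ≡⟨ ∑-cong irreducibles term ⟩
      ∑ irreducibles (λ y → 𝟙 (proj₁ y ≟MP (e , a)) ℕ.* e) ≡⟨ ∑-distribʳ-* irreducibles e _ ⟩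
      ∑ irreducibles (λ y → 𝟙 (proj₁ y ≟MP (e , a))) ℕ.* e ≡⟨ cong (ℕ._* e) (irreducibles-once a ia (ℕP.≤-trans (ℕP.m≤m+n e _) le)) ⟩
      1 ℕ.* e ≡⟨ ℕP.*-identityˡ e ⟩
      e ∎
      where
      term : ∀ y → 𝟙 ((e , a) ≟MP proj₁ y) ℕ.* degree y ≡ 𝟙 (proj₁ y ≟MP (e , a)) ℕ.* e
      term (((e' , a') , _)) with (e , a) ≟MP (e' , a') | (e' , a') ≟MP (e , a)
      ... | yes refl | yes _ = refl
      ... | yes refl | no ne = ⊥-elim (ne refl)
      ... | no ne | yes refl = ⊥-elim (ne refl)
      ... | no _ | no _ = refl

  -- deg p = ∑_P deg P · v_P(p) = ∑_P ∑_{j≥1} deg P · [P^j ∣ p].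
  degree-as-exponentWeights : ∀ {n} (p : Monic n) → n ≤ N → ∑ irreducibles (λ y → ∑ (exponents n) (λ j → exponentWeight p y j)) ≡ n
  degree-as-exponentWeights {n} p n≤N = begin
    ∑ irreducibles (λ y → ∑ (exponents n) (λ j → exponentWeight p y j))
      ≡⟨ ∑-cong irreducibles per-irreducible ⟩
    ∑ irreducibles (λ y → ∑ fsp (λ f → ∑ [ y ] (λ y' → 𝟙 (f ≟MP proj₁ y') ℕ.* degree y')))
      ≡⟨ ∑-comm irreducibles fsp (λ y f → ∑ [ y ] (λ y' → 𝟙 (f ≟MP proj₁ y') ℕ.* degree y')) ⟩
    ∑ fsp (λ f → ∑ irreducibles (λ y → 𝟙 (f ≟MP proj₁ y) ℕ.* degree y ℕ.+ 0))
      ≡⟨ ∑-cong fsp (λ f → ∑-cong irreducibles (λ y → ℕP.+-identityʳ _)) ⟩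
    ∑ fsp (λ f → ∑ irreducibles (λ y → 𝟙 (f ≟MP proj₁ y) ℕ.* degree y))
      ≡⟨ ∑-irreducibleDegrees fsp (irrs (factorise p)) (subst (_≤ N) (sym dsp) n≤N) ⟩
    totalDegree fsp
      ≡⟨ dsp ⟩
    n ∎
    where
    fsp : List MonicPoly
    fsp = fs (factorise p)
    dsp : totalDegree fsp ≡ n
    dsp = totalDegree-prodMP fsp p (prod (factorise p))
    per-irreducible : ∀ y → ∑ (exponents n) (λ j → exponentWeight p y j) ≡ ∑ fsp (λ f → ∑ [ y ] (λ y' → 𝟙 (f ≟MP proj₁ y') ℕ.* degree y'))
    per-irreducible ((d , x) , ix) = begin
      ∑ (exponents n) (λ j → exponentWeight′ p x j (j ℕ.* d ≤? n))
        ≡⟨ ExponentWeight.∑-exponentWeight′ p x (proj₁ ix) (Valuation.valuation p x ix)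
             (Valuation.pow*≡⇒≤valuation p x ix) (Valuation.≤valuation⇒pow*≡ p x ix) ⟩
      d ℕ.* multiplicityMP (d , x) fsp ≡⟨ sym (∑-distribˡ-* fsp d _) ⟩
      ∑ fsp (λ f → d ℕ.* 𝟙 (f ≟MP (d , x))) ≡⟨ ∑-cong fsp (λ f → trans (ℕP.*-comm d _) (sym (ℕP.+-identityʳ _))) ⟩
      ∑ fsp (λ f → 𝟙 (f ≟MP (d , x)) ℕ.* d ℕ.+ 0) ∎

  cofactorSum′ : ∀ {n} (W : Monic n → ℕ) {d} → Monic d → ∀ j → Dec (j ℕ.* d ≤ n) → ℕ
  cofactorSum′ {n} W {d} x j (yes le) = d ℕ.* ∑ (allMonic (n ∸ j ℕ.* d)) (λ r → W (pow* x j le r))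
  cofactorSum′ W x j (no _) = 0

  cofactorSum : ∀ {n} (W : Monic n → ℕ) → IrreducibleMonic → ℕ → ℕ
  cofactorSum {n} W ((d , x) , _) j = cofactorSum′ W x j (j ℕ.* d ≤? n)

  ∑-exponentWeight′-weighted : ∀ {n} (W : Monic n → ℕ) {d} (x : Monic d) j dec →
         ∑ (allMonic n) (λ p → exponentWeight′ p x j dec ℕ.* W p) ≡ cofactorSum′ W x j dec
  ∑-exponentWeight′-weighted {n} W {d} x j (yes le) = begin
    ∑ (allMonic n) (λ p → d ℕ.* S p ℕ.* W p)
      ≡⟨ ∑-cong (allMonic n) (λ p → ℕP.*-assoc d (S p) (W p)) ⟩
    ∑ (allMonic n) (λ p → d ℕ.* (S p ℕ.* W p))
      ≡⟨ ∑-distribˡ-* (allMonic n) d _ ⟩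
    d ℕ.* ∑ (allMonic n) (λ p → S p ℕ.* W p)
      ≡⟨ cong (d ℕ.*_) (∑-cong (allMonic n) (λ p → sym (∑-distribʳ-* Rs (W p) _))) ⟩
    d ℕ.* ∑ (allMonic n) (λ p → ∑ Rs (λ r → 𝟙 (pow* x j le r ≟m p) ℕ.* W p))
      ≡⟨ cong (d ℕ.*_) (∑-comm (allMonic n) Rs _) ⟩
    d ℕ.* ∑ Rs (λ r → ∑ (allMonic n) (λ p → 𝟙 (pow* x j le r ≟m p) ℕ.* W p))
      ≡⟨ cong (d ℕ.*_) (∑-cong Rs (λ r → trans (∑-cong (allMonic n) (λ p → cong (ℕ._* W p) (𝟙-cong (pow* x j le r ≟m p) (p ≟m pow* x j le r) sym sym)))
                                                 (∑-𝟙≟-once _≟m_ (allMonic n) (pow* x j le r) W (multiplicity-allMonic n _)))) ⟩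
    d ℕ.* ∑ Rs (λ r → W (pow* x j le r)) ∎
    where
    Rs : List (Monic (n ∸ j ℕ.* d))
    Rs = allMonic (n ∸ j ℕ.* d)
    S : Monic n → ℕ
    S p = ∑ Rs (λ r → 𝟙 (pow* x j le r ≟m p))
  ∑-exponentWeight′-weighted {n} W x j (no _) = ∑-zero (allMonic n) (λ p → refl)

  double-counting : ∀ {n} (W : Monic n → ℕ) → n ≤ N →
           n ℕ.* ∑ (allMonic n) W ≡ ∑ irreducibles (λ y → ∑ (exponents n) (λ j → cofactorSum W y j))
  double-counting {n} W n≤N = begin
    n ℕ.* ∑ (allMonic n) W
      ≡⟨ sym (∑-distribˡ-* (allMonic n) n W) ⟩
    ∑ (allMonic n) (λ p → n ℕ.* W p)
      ≡⟨ ∑-cong (allMonic n) (λ p → cong (ℕ._* W p) (sym (degree-as-exponentWeights p n≤N))) ⟩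
    ∑ (allMonic n) (λ p → ∑ irreducibles (λ y → ∑ (exponents n) (λ j → exponentWeight p y j)) ℕ.* W p)
      ≡⟨ ∑-cong (allMonic n) (λ p → trans (sym (∑-distribʳ-* irreducibles (W p) _)) (∑-cong irreducibles (λ y → sym (∑-distribʳ-* (exponents n) (W p) _)))) ⟩
    ∑ (allMonic n) (λ p → ∑ irreducibles (λ y → ∑ (exponents n) (λ j → exponentWeight p y j ℕ.* W p)))
      ≡⟨ ∑-comm (allMonic n) irreducibles _ ⟩
    ∑ irreducibles (λ y → ∑ (allMonic n) (λ p → ∑ (exponents n) (λ j → exponentWeight p y j ℕ.* W p)))
      ≡⟨ ∑-cong irreducibles (λ y → ∑-comm (allMonic n) (exponents n) _) ⟩
    ∑ irreducibles (λ y → ∑ (exponents n) (λ j → ∑ (allMonic n) (λ p → exponentWeight p y j ℕ.* W p)))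
      ≡⟨ ∑-cong irreducibles per-irreducible ⟩
    ∑ irreducibles (λ y → ∑ (exponents n) (λ j → cofactorSum W y j)) ∎
    where
    per-irreducible : ∀ y → ∑ (exponents n) (λ j → ∑ (allMonic n) (λ p → exponentWeight p y j ℕ.* W p)) ≡ ∑ (exponents n) (λ j → cofactorSum W y j)
    per-irreducible ((d , x) , ix) = ∑-cong (exponents n) (λ j → ∑-exponentWeight′-weighted W x j (j ℕ.* d ≤? n))


module CountingIdentities {q : ℕ} (F : FiniteField q) (N : ℕ) where
  open import Data.Nat using (suc; _≤_; _<_; _∸_; _≤?_)

  open import Data.List as List using (List; []; _∷_; [_]; length)
  open import Data.Vec using ([]; _∷_)
  open import Data.Product using (_×_; _,_; proj₁)
  open import Data.Sum using (_⊎_; inj₁; inj₂)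
  open import Relation.Nullary using (Dec; yes; no)
  open import Relation.Binary.PropositionalEquality hiding ([_])
  open import Data.List.Relation.Unary.All using (All; []; _∷_)
  open ℕΣ
  open DoubleCounting F N public

  open ≡-Reasoning

  irreducibleDegrees : List ℕ
  irreducibleDegrees = List.map degree irreducibles

  degrees-positive : ∀ (ys : List IrreducibleMonic) → All (1 ≤_) (List.map degree ys)
  degrees-positive [] = []
  degrees-positive (((d , x) , ix) ∷ ys) = proj₁ ix ∷ degrees-positive ys

  irreducibleDegrees-positive : All (1 ≤_) irreducibleDegrees
  irreducibleDegrees-positive = degrees-positive irreducibles

  monicCount : ℕ → ℕ → ℕ
  monicCount m k = ∑ (allMonic m) (λ r → 𝟙 (factorCount r ℕ.≟ k))

  monicCount-zero : ∀ k → monicCount 0 k ≡ 𝟙 (k ℕ.≟ 0)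
  monicCount-zero k = trans (ℕP.+-identityʳ _) (trans (cong (λ z → 𝟙 (z ℕ.≟ k)) factorCount-1ₚ) (𝟙-cong (0 ℕ.≟ k) (k ℕ.≟ 0) sym sym))

  𝟙-+≟ : ∀ j f k → 𝟙 (j ℕ.+ f ℕ.≟ k) ≡ 𝟙 (j ≤? k) ℕ.* 𝟙 (f ℕ.≟ k ∸ j)
  𝟙-+≟ j f k with j ≤? k
  ... | yes le = trans (𝟙-cong (j ℕ.+ f ℕ.≟ k) (f ℕ.≟ k ∸ j) (λ e → trans (sym (ℕP.m+n∸m≡n j f)) (cong (_∸ j) e))
                                                             (λ e → trans (cong (j ℕ.+_) e) (ℕP.m+[n∸m]≡n le)))
                       (sym (ℕP.+-identityʳ _))
  ... | no nle = 𝟙-no (j ℕ.+ f ℕ.≟ k) (λ e → nle (subst (j ≤_) e (ℕP.m≤m+n j f)))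

  count-identity : ∀ n → n ≤ N → ∀ k → n ℕ.* monicCount n k ≡
        ∑[ e ∈ irreducibleDegrees ] ∑[ j < n ] (𝟙 (suc j ℕ.* e ≤? n) ℕ.* (e ℕ.* (𝟙 (suc j ≤? k) ℕ.* monicCount (n ∸ suc j ℕ.* e) (k ∸ suc j))))
  count-identity n n≤N k = begin
    n ℕ.* monicCount n k
      ≡⟨ double-counting W n≤N ⟩
    ∑ irreducibles (λ y → ∑ (exponents n) (λ j → cofactorSum W y j))
      ≡⟨ ∑-cong irreducibles per-irreducible ⟩
    ∑ irreducibles (λ y → ∑[ j < n ] G (degree y) (suc j))
      ≡⟨ sym (∑-map degree irreducibles (λ e → ∑[ j < n ] G e (suc j))) ⟩
    ∑[ e ∈ irreducibleDegrees ] ∑[ j < n ] G e (suc j) ∎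
    where
    W : Monic n → ℕ
    W p = 𝟙 (factorCount p ℕ.≟ k)
    G : ℕ → ℕ → ℕ
    G e j = 𝟙 (j ℕ.* e ≤? n) ℕ.* (e ℕ.* (𝟙 (j ≤? k) ℕ.* monicCount (n ∸ j ℕ.* e) (k ∸ j)))
    per-exponent : ∀ {d} (x : Monic d) → Irreducible x → ∀ j dec →
                   cofactorSum′ W x j dec ≡ 𝟙 dec ℕ.* (d ℕ.* (𝟙 (j ≤? k) ℕ.* monicCount (n ∸ j ℕ.* d) (k ∸ j)))
    per-exponent {d} x ix j (yes le) = trans (cong (d ℕ.*_) (begin
      ∑ (allMonic (n ∸ j ℕ.* d)) (λ r → 𝟙 (factorCount (pow* x j le r) ℕ.≟ k))
        ≡⟨ ∑-cong (allMonic (n ∸ j ℕ.* d)) (λ r → trans (cong (λ z → 𝟙 (z ℕ.≟ k)) (factorCount-pow* x ix j le r)) (𝟙-+≟ j (factorCount r) k)) ⟩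
      ∑ (allMonic (n ∸ j ℕ.* d)) (λ r → 𝟙 (j ≤? k) ℕ.* 𝟙 (factorCount r ℕ.≟ k ∸ j))
        ≡⟨ ∑-distribˡ-* (allMonic (n ∸ j ℕ.* d)) (𝟙 (j ≤? k)) (λ r → 𝟙 (factorCount r ℕ.≟ k ∸ j)) ⟩
      𝟙 (j ≤? k) ℕ.* monicCount (n ∸ j ℕ.* d) (k ∸ j) ∎)) (sym (ℕP.+-identityʳ _))
    per-exponent x ix j (no _) = refl
    per-irreducible : ∀ y → ∑ (exponents n) (λ j → cofactorSum W y j) ≡ ∑[ j < n ] G (degree y) (suc j)
    per-irreducible ((d , x) , ix) = trans (∑-applyUpTo suc n (cofactorSum W ((d , x) , ix))) (∑<-cong n (λ j _ → per-exponent x ix (suc j) (suc j ℕ.* d ≤? n)))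

  degree-identity : ∀ n → n ≤ N →
    n ℕ.* q ℕ.^ n ≡ ∑[ e ∈ irreducibleDegrees ] ∑[ j < n ] (𝟙 (suc j ℕ.* e ≤? n) ℕ.* (e ℕ.* q ℕ.^ (n ∸ suc j ℕ.* e)))
  degree-identity n n≤N = begin
    n ℕ.* q ℕ.^ n
      ≡⟨ cong (n ℕ.*_) (sym (count-allMonic n)) ⟩
    n ℕ.* ∑ (allMonic n) (λ _ → 1)
      ≡⟨ double-counting W n≤N ⟩
    ∑ irreducibles (λ y → ∑ (exponents n) (λ j → cofactorSum W y j))
      ≡⟨ ∑-cong irreducibles per-irreducible ⟩
    ∑ irreducibles (λ y → ∑[ j < n ] H (degree y) (suc j))
      ≡⟨ sym (∑-map degree irreducibles (λ e → ∑[ j < n ] H e (suc j))) ⟩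
    ∑[ e ∈ irreducibleDegrees ] ∑[ j < n ] H e (suc j) ∎
    where
    W : Monic n → ℕ
    W p = 1
    H : ℕ → ℕ → ℕ
    H e j = 𝟙 (j ℕ.* e ≤? n) ℕ.* (e ℕ.* q ℕ.^ (n ∸ j ℕ.* e))
    per-exponent : ∀ {d} (x : Monic d) → ∀ j dec → cofactorSum′ W x j dec ≡ 𝟙 dec ℕ.* (d ℕ.* q ℕ.^ (n ∸ j ℕ.* d))
    per-exponent {d} x j (yes le) = trans (cong (d ℕ.*_) (count-allMonic (n ∸ j ℕ.* d))) (sym (ℕP.+-identityʳ _))
    per-exponent x j (no _) = refl
    per-irreducible : ∀ y → ∑ (exponents n) (λ j → cofactorSum W y j) ≡ ∑[ j < n ] H (degree y) (suc j)
    per-irreducible ((d , x) , ix) = trans (∑-applyUpTo suc n (cofactorSum W ((d , x) , ix))) (∑<-cong n (λ j _ → per-exponent x (suc j) (suc j ℕ.* d ≤? n)))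

  length-filter : ∀ {B : Set} {P : B → Set} (P? : ∀ x → Dec (P x)) (xs : List B) →
                  length (List.filter P? xs) ≡ ∑ xs (λ x → 𝟙 (P? x))
  length-filter P? [] = refl
  length-filter P? (x ∷ xs) with P? x
  ... | yes _ = cong suc (length-filter P? xs)
  ... | no _  = length-filter P? xs

  count≡monicCount : (fc : Monic N → ℕ) → (∀ p → FactorCount p (fc p)) → ∀ k → count N fc k ≡ monicCount N k
  count≡monicCount fc hyp k = trans (length-filter (λ p → fc p ℕ.≟ k) (allMonic N))
    (∑-cong (allMonic N) (λ p → cong (λ z → 𝟙 (z ℕ.≟ k)) (FactorCount-unique p (hyp p) (factorCount-correct p))))

  open DegreeArithmetic q N irreducibleDegrees irreducibleDegrees-positive using (β; divisorSumLaw; recurrence)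
  open CoefficientValues q N β (divisorSumLaw degree-identity) using (eval-countPoly)
  open Evaluation q using (eval)
  open Coefficients using (countPoly)

  count≡eval-countPoly : (fc : Monic N → ℕ) → (∀ p → FactorCount p (fc p)) →
                         ∀ k → ℕ→ℚ (count N fc k) ≡ eval (suc N) (λ i → countPoly N i k)
  count≡eval-countPoly fc fc-correct k = begin
    ℕ→ℚ (count N fc k)
      ≡⟨ cong ℕ→ℚ (count≡monicCount fc fc-correct k) ⟩
    ℕ→ℚ (monicCount N k)
      ≡⟨ sym (eval-countPoly monicCount (recurrence monicCount count-identity) monicCount-zero N ℕP.≤-refl k) ⟩
    eval (suc N) (λ i → countPoly N i k) ∎

open import Data.Product using (_,_)
open import Data.Sum using (inj₁; inj₂)
open import Relation.Binary.PropositionalEquality using (trans; sym)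
open Coefficients using (countPoly; countPolyᶠ-sym; countPolyᶠ-vanishes)

proposition5p2 : ∀ (n : ℕ) → ∃[ D ] ∃[ c ]
    ((∀ i j → D < i ⊎ D < j → c i j ≡ 0ℚ)
    × (∀ i j → c i j ≡ c j i)
    × (∀ {q} (F : FiniteField q) (fc : Poly.Monic F n → ℕ) →
         (∀ p → Poly.FactorCount F p (fc p)) →
         ∀ k → ℕ→ℚ (Poly.count F n fc k) ≡ coeffAt D c q k))
proposition5p2 n = n , countPoly n , vanishes , countPolyᶠ-sym (ℕ.suc n) n , counts
  where
  vanishes : ∀ i j → n < i ⊎ n < j → countPoly n i j ≡ 0ℚ
  vanishes i j (inj₁ n<i) = countPolyᶠ-vanishes (ℕ.suc n) n i j n<i
  vanishes i j (inj₂ n<j) = trans (countPolyᶠ-sym (ℕ.suc n) n i j) (countPolyᶠ-vanishes (ℕ.suc n) n j i n<j)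
  counts : ∀ {q} (F : FiniteField q) (fc : Poly.Monic F n → ℕ) → (∀ p → Poly.FactorCount F p (fc p)) →
           ∀ k → ℕ→ℚ (Poly.count F n fc k) ≡ coeffAt n (countPoly n) q k
  counts {q} F fc fc-correct k =
    trans (CountingIdentities.count≡eval-countPoly F n fc fc-correct k)
          (sym (ℚΣ.∑-upTo (ℕ.suc n) (λ i → countPoly n i k ℚ.* ℕ→ℚ (q ℕ.^ i))))
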